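{- Let $\mathrm{TM}$ be the model over $\{0,1\}^*$ consisting of all total functions $\{0,1\}^*\to\{0,1\}^*$ computed by Turing machines. Then $\mathrm{TM}$ is complete: for every model $M$ over $\{0,1\}^*$ with $M\supseteq\mathrm{TM}$ and $\mathrm{TM}\succsim M$, we have $M=\mathrm{TM}$.
   Context: A model of computation over a set $D$ is any set of functions $f:D\to D\cup\{\bot\}$, where $\bot$ denotes "undefined". An encoding is an injection $\rho:\mathrm{dom}\,B\to\mathrm{dom}\,A$, extended by $\rho(\bot)=\bot$. Model $A$ simulates model $B$ via $\rho$, written $A\succsim_\rho B$, if for every $g\in B$ there is $f\in A$ with $\rho\circ g=f\circ\rho$. $A\succsim B$ means $A\succsim_\rho B$ for some injection $\rho$. -}

module Defs where

open import Data.Nat using (ℕ; zero; suc; _+_)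
open import Data.Fin using (Fin; zero; suc)
open import Data.Bool using (Bool; true; false)
open import Data.List using (List; []; _∷_)
open import Data.Maybe using (Maybe; just; nothing)
import Data.Maybe as Maybe
open import Data.Product using (Σ; _×_; _,_; ∃)
open import Data.Sum using (_⊎_; inj₁; inj₂)
open import Relation.Binary.PropositionalEquality using (_≡_)
open import Function.Definitions using (Injective)

-- A model of computation over D: a set of functions D → D ∪ {⊥},
-- with ⊥ represented by `nothing`.
Model : Set → Set₁
Model D = (D → Maybe D) → Set

extend : {D E : Set} → (D → E) → Maybe D → Maybe E
extend ρ = Maybe.map ρ

SimulatesVia : {DA DB : Set} → Model DA → Model DB → (DB → DA) → Set
SimulatesVia {DA} {DB} A B ρ =
  (g : DB → Maybe DB) → B g →
  Σ (DA → Maybe DA) λ f → A f × ((x : DB) → extend ρ (g x) ≡ f (ρ x))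

Simulates : {DA DB : Set} → Model DA → Model DB → Set
Simulates {DA} {DB} A B =
  Σ (DB → DA) λ ρ → Injective _≡_ _≡_ ρ × SimulatesVia A B ρ

Word : Set
Word = List Bool

-- Tape alphabet Fin (3 + extra): symbol 0 = blank, 1 = bit 0, 2 = bit 1,
-- others are auxiliary.  States Fin (suc states); state zero is initial.
-- δ q a = nothing means the machine halts in state q reading a.

data Move : Set where
  left right : Move

record TM : Set where
  field
    states : ℕ
    extra  : ℕ
    δ      : Fin (suc states) → Fin (3 + extra) →
             Maybe (Fin (suc states) × Fin (3 + extra) × Move)

module _ (M : TM) where
  open TM M

  Sym : Set
  Sym = Fin (3 + extra)

  blank : Sym
  blank = zero

  bitSym : Bool → Sym
  bitSym false = suc zero
  bitSym true  = suc (suc zero)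

  -- configuration: state, tape left of head (nearest first), head symbol,
  -- tape right of head; all remaining cells are blank
  record Config : Set where
    constructor config
    field
      state : Fin (suc states)
      lft   : List Sym
      hd    : Sym
      rgt   : List Sym

  moveL : Fin (suc states) → List Sym → Sym → List Sym → Config
  moveL q []       a r = config q [] blank (a ∷ r)
  moveL q (b ∷ l)  a r = config q l b (a ∷ r)

  moveR : Fin (suc states) → List Sym → Sym → List Sym → Config
  moveR q l a []      = config q (a ∷ l) blank []
  moveR q l a (b ∷ r) = config q (a ∷ l) b r

  step : Config → Config ⊎ Config
  step c@(config q l a r) with δ q a
  ... | nothing                  = inj₁ c
  ... | just (q' , b , left)     = inj₂ (moveL q' l b r)
  ... | just (q' , b , right)    = inj₂ (moveR q' l b r)

  runFor : ℕ → Config → Maybe Config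
  runFor zero    c = nothing
  runFor (suc k) c with step c
  ... | inj₁ h  = just h
  ... | inj₂ c' = runFor k c'

  initial : Word → Config
  initial []      = config zero [] blank []
  initial (b ∷ w) = config zero [] (bitSym b) (Data.List.map bitSym w)

  readBit : Sym → Maybe Bool
  readBit zero                   = nothing
  readBit (suc zero)             = just false
  readBit (suc (suc zero))       = just true
  readBit (suc (suc (suc _)))    = nothing

  readBits : List Sym → Word
  readBits []      = []
  readBits (a ∷ r) with readBit a
  ... | nothing = []
  ... | just b  = b ∷ readBits r

  output : Config → Word
  output (config _ _ a r) = readBits (a ∷ r)

  Computes : Word → Word → Set
  Computes x y = ∃ λ k → Maybe.map output (runFor k (initial x)) ≡ just y

TMmodel : Model Word
TMmodel g = Σ TM λ M → (x : Word) → Σ Word λ y → g x ≡ just y × Computes M x y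

_⊇_ : {D : Set} → Model D → Model D → Set
M ⊇ N = ∀ f → N f → M f

module Submission where

-- Write F_h for a Turing machine with ρ ∘ h = F_h ∘ ρ; it exists for every total TM-computable h,
-- since TM ⊆ M and TM simulates M via ρ. Given g ∈ M, a machine for g first computes ρ x from x,
-- starting from the constant ρ [] and applying F_(b ∷_) for the bits b of x from last to first.
-- It then applies F_g, obtaining ρ (g x); in particular g is total because F_g is. Finally it
-- decodes ρ y back to y: y is empty iff ρ y = ρ [], the head of y is true iff F_tagHead (ρ y) = ρ [],
-- and F_dropHead (ρ y) = ρ (tail y). The machines F_h run on separate tracks of a larger alphabet.

open import Data.Bool using (Bool; true; false; not; if_then_else_)
open import Data.Empty using (⊥; ⊥-elim)
open import Data.Fin using (Fin; zero; suc; _↑ˡ_; _↑ʳ_; splitAt; combine; remQuot)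
open import Data.Fin.Properties using (splitAt-↑ˡ; splitAt-↑ʳ; remQuot-combine)
open import Data.List using (List; []; _∷_; _++_; _ʳ++_; length; map; replicate; reverse)
open import Data.List.Properties
  using (∷-injectiveˡ; ∷-injectiveʳ; ++-assoc; ++-identityʳ; ++-ʳ++; ʳ++-ʳ++; map-++; map-ʳ++; map-∘; map-id; map-cong-local;
         map-replicate; reverse-involutive)
open import Data.List.Relation.Unary.All as All using (All; []; _∷_)
open import Data.List.Relation.Unary.All.Properties using (++⁺; ++⁻ˡ; ++⁻ʳ; map⁺; map⁻; replicate⁺)
open import Data.Maybe as Maybe using (Maybe; just; nothing)
open import Data.Maybe.Properties using (just-injective)
open import Data.Nat using (ℕ; zero; suc; _+_; _*_; _≤_; s≤s)
open import Data.Nat.Properties using (m≤m+n; m≤n+m; m≤n⇒m≤n+o)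
open import Data.Product as Product using (Σ; _×_; _,_; proj₁; proj₂)
open import Data.Sum as Sum using (_⊎_; inj₁; inj₂; [_,_])
open import Data.Unit using (⊤; tt)
import Defs as D
open import Function.Base using (case_of_)
open import Function.Definitions using (Injective)
open import Relation.Binary.PropositionalEquality using (_≡_; cong; cong₂; refl; subst; sym; trans; module ≡-Reasoning)

private
  variable
    A B : Set

ʳ++-++ : ∀ (xs : List A) {ys zs} → (xs ʳ++ ys) ++ zs ≡ xs ʳ++ (ys ++ zs)
ʳ++-++ []       = refl
ʳ++-++ (x ∷ xs) {ys} = ʳ++-++ xs {x ∷ ys}

replicate-∷ʳ : ∀ n (x : A) → replicate n x ++ x ∷ [] ≡ x ∷ replicate n x
replicate-∷ʳ zero    x = refl
replicate-∷ʳ (suc n) x = cong (x ∷_) (replicate-∷ʳ n x)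

replicate-ʳ++ : ∀ n (x : A) ys → replicate n x ʳ++ ys ≡ replicate n x ++ ys
replicate-ʳ++ zero    x ys = refl
replicate-ʳ++ (suc n) x ys = begin
  replicate n x ʳ++ (x ∷ ys)         ≡⟨ replicate-ʳ++ n x (x ∷ ys) ⟩
  replicate n x ++ (x ∷ [] ++ ys)    ≡⟨ ++-assoc (replicate n x) (x ∷ []) ys ⟨
  (replicate n x ++ x ∷ []) ++ ys    ≡⟨ cong (_++ ys) (replicate-∷ʳ n x) ⟩
  x ∷ replicate n x ++ ys            ∎
  where open ≡-Reasoning

replicate-++ : ∀ m n (x : A) → replicate m x ++ replicate n x ≡ replicate (m + n) x
replicate-++ zero    n x = refl
replicate-++ (suc m) n x = cong (x ∷_) (replicate-++ m n x)

ʳ++-∷-nonempty : ∀ (xs : List A) y ys → Σ A λ c → Σ (List A) λ zs → xs ʳ++ (y ∷ ys) ≡ c ∷ zs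
ʳ++-∷-nonempty []       y ys = y , ys , refl
ʳ++-∷-nonempty (x ∷ xs) y ys = ʳ++-∷-nonempty xs x (y ∷ ys)

map-++-split : (f : A → B) → ∀ xs ys zs → map f xs ≡ ys ++ zs →
  Σ (List A) λ xs₁ → Σ (List A) λ xs₂ → (xs ≡ xs₁ ++ xs₂) × (map f xs₁ ≡ ys) × (map f xs₂ ≡ zs)
map-++-split f xs       []       zs e = [] , xs , refl , refl , e
map-++-split f (x ∷ xs) (y ∷ ys) zs e with map-++-split f xs ys zs (∷-injectiveʳ e)
... | xs₁ , xs₂ , e₁ , e₂ , e₃ = x ∷ xs₁ , xs₂ , cong (x ∷_) e₁ , cong₂ _∷_ (∷-injectiveˡ e) e₂ , e₃

ʳ++⁺ : ∀ {P : A → Set} {xs ys} → All P xs → All P ys → All P (xs ʳ++ ys)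
ʳ++⁺ []       q = q
ʳ++⁺ (p ∷ ps) q = ʳ++⁺ ps (p ∷ q)

ʳ++⁻ʳ : ∀ {P : A → Set} xs {ys} → All P (xs ʳ++ ys) → All P ys
ʳ++⁻ʳ []       p = p
ʳ++⁻ʳ (x ∷ xs) p with ʳ++⁻ʳ xs p
... | _ ∷ qs = qs

ʳ++⁻ˡ : ∀ {P : A → Set} xs {ys} → All P (xs ʳ++ ys) → All P xs
ʳ++⁻ˡ []       p = []
ʳ++⁻ˡ (x ∷ xs) p with ʳ++⁻ʳ xs p
... | q ∷ _ = q ∷ ʳ++⁻ˡ xs p

all-≡-replicate : ∀ (x₀ : A) xs → All (_≡ x₀) xs → Σ ℕ λ n → xs ≡ replicate n x₀
all-≡-replicate x₀ []       []         = 0 , refl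
all-≡-replicate x₀ (x ∷ xs) (refl ∷ ps) with all-≡-replicate x₀ xs ps
... | n , e = suc n , cong (x₀ ∷_) e

Padded : A → List A → List A → Set
Padded x₀ W ys = Σ ℕ λ a → Σ ℕ λ b → ys ≡ replicate a x₀ ++ (W ++ replicate b x₀)

padded-∷ : ∀ (x₀ : A) W ys → Padded x₀ W ys → Padded x₀ W (x₀ ∷ ys)
padded-∷ x₀ W ys (a , b , e) = suc a , b , cong (x₀ ∷_) e

padded-∷ʳ : ∀ (x₀ : A) W ys → Padded x₀ W ys → Padded x₀ W (ys ++ x₀ ∷ [])
padded-∷ʳ x₀ W ys (a , b , refl) = a , suc b , (begin
  (replicate a x₀ ++ (W ++ replicate b x₀)) ++ x₀ ∷ []  ≡⟨ ++-assoc (replicate a x₀) _ (x₀ ∷ []) ⟩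
  replicate a x₀ ++ ((W ++ replicate b x₀) ++ x₀ ∷ [])  ≡⟨ cong (replicate a x₀ ++_) (++-assoc W (replicate b x₀) (x₀ ∷ [])) ⟩
  replicate a x₀ ++ (W ++ (replicate b x₀ ++ x₀ ∷ []))  ≡⟨ cong (λ z → replicate a x₀ ++ (W ++ z)) (replicate-∷ʳ b x₀) ⟩
  replicate a x₀ ++ (W ++ replicate (suc b) x₀)         ∎)
  where open ≡-Reasoning

AllFalse : (A → Bool) → List A → Set
AllFalse p = All (λ x → p x ≡ false)

true≢false : ∀ {b} → b ≡ true → b ≡ false → ⊥
true≢false refl ()

split-unique : (p : A → Bool) → ∀ xs x ys xs′ x′ ys′ → p x ≡ true → AllFalse p xs′ → AllFalse p ys′ →
  xs ++ x ∷ ys ≡ xs′ ++ x′ ∷ ys′ → (xs ≡ xs′) × (x ≡ x′) × (ys ≡ ys′)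
split-unique p []       x ys []        x′ ys′ px _          _    refl = refl , refl , refl
split-unique p []       x ys (_ ∷ xs′) x′ ys′ px (px′ ∷ _)  _    refl = ⊥-elim (true≢false px px′)
split-unique p (_ ∷ xs) x ys []        x′ ys′ px _          fys′ refl with ++⁻ʳ xs fys′
... | px′ ∷ _ = ⊥-elim (true≢false px px′)
split-unique p (a ∷ xs) x ys (_ ∷ xs′) x′ ys′ px (_ ∷ fxs′) fys′ e
  with split-unique p xs x ys xs′ x′ ys′ px fxs′ fys′ (∷-injectiveʳ e)
... | e₁ , e₂ , e₃ = cong₂ _∷_ (∷-injectiveˡ e) e₁ , e₂ , e₃

first-true : (p : A → Bool) → (zs : List A) →
  (Σ (List A) λ xs → Σ A λ x → Σ (List A) λ ys → (zs ≡ xs ++ x ∷ ys) × AllFalse p xs × p x ≡ true) ⊎ AllFalse p zs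
first-true p [] = inj₂ []
first-true p (z ∷ zs) with p z in eq
... | true = inj₁ ([] , z , zs , refl , [] , eq)
... | false with first-true p zs
...   | inj₁ (xs , x , ys , e , f , px) = inj₁ (z ∷ xs , x , ys , cong (z ∷_) e , eq ∷ f , px)
...   | inj₂ f = inj₂ (eq ∷ f)

record Finite (A : Set) : Set where
  field
    size         : ℕ
    index        : A → Fin size
    decode       : Fin size → A
    decode-index : ∀ a → decode (index a) ≡ a

finite-⊤ : Finite ⊤
finite-⊤ = record { size = 1 ; index = λ _ → zero ; decode = λ _ → tt ; decode-index = λ _ → refl }

finite-Fin : ∀ n → Finite (Fin n)
finite-Fin n = record { size = n ; index = λ i → i ; decode = λ i → i ; decode-index = λ _ → refl }

finite-Bool : Finite Bool
finite-Bool = record { size = 2 ; index = index ; decode = decode ; decode-index = decode-index }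
  where
  index : Bool → Fin 2
  index false = zero
  index true  = suc zero
  decode : Fin 2 → Bool
  decode zero    = false
  decode (suc _) = true
  decode-index : ∀ b → decode (index b) ≡ b
  decode-index false = refl
  decode-index true  = refl

finite-⊎ : Finite A → Finite B → Finite (A ⊎ B)
finite-⊎ {A} {B} FA FB = record { size = m + n ; index = index ; decode = decode ; decode-index = decode-index }
  where
  open Finite FA renaming (size to m; index to indexA; decode to decodeA; decode-index to decode-indexA)
  open Finite FB renaming (size to n; index to indexB; decode to decodeB; decode-index to decode-indexB)
  index : A ⊎ B → Fin (m + n)
  index (inj₁ a) = indexA a ↑ˡ n
  index (inj₂ b) = m ↑ʳ indexB b
  decode : Fin (m + n) → A ⊎ B
  decode i = Sum.map decodeA decodeB (splitAt m i)
  decode-index : ∀ x → decode (index x) ≡ x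
  decode-index (inj₁ a) = trans (cong (Sum.map decodeA decodeB) (splitAt-↑ˡ m (indexA a) n)) (cong inj₁ (decode-indexA a))
  decode-index (inj₂ b) = trans (cong (Sum.map decodeA decodeB) (splitAt-↑ʳ m n (indexB b))) (cong inj₂ (decode-indexB b))

finite-× : Finite A → Finite B → Finite (A × B)
finite-× {A} {B} FA FB = record { size = m * n ; index = index ; decode = decode ; decode-index = decode-index }
  where
  open Finite FA renaming (size to m; index to indexA; decode to decodeA; decode-index to decode-indexA)
  open Finite FB renaming (size to n; index to indexB; decode to decodeB; decode-index to decode-indexB)
  index : A × B → Fin (m * n)
  index (a , b) = combine (indexA a) (indexB b)
  decode : Fin (m * n) → A × B
  decode i = Product.map decodeA decodeB (remQuot n i)
  decode-index : ∀ x → decode (index x) ≡ x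
  decode-index (a , b) =
    trans (cong (Product.map decodeA decodeB) (remQuot-combine (indexA a) (indexB b))) (cong₂ _,_ (decode-indexA a) (decode-indexB b))

data Dir : Set where
  ◂ ▸ ● : Dir

-- The tape is blank outside lefts and rights.
module Machines (S : Set) (blank : S) where

  record Tape : Set where
    constructor tape
    field
      lefts  : List S
      hd     : S
      rights : List S
  open Tape public

  headᵇ : List S → S
  headᵇ []      = blank
  headᵇ (x ∷ _) = x

  tailᵇ : List S → List S
  tailᵇ []       = []
  tailᵇ (_ ∷ xs) = xs

  padᵇ : List S → List S
  padᵇ xs = headᵇ xs ∷ tailᵇ xs

  -- A compiled machine realises ● by a step right followed by a step left, which may
  -- materialise one blank cell on the right; padᵇ mirrors this.
  move : Dir → S → Tape → Tape
  move ◂ b (tape l _ r) = tape (tailᵇ l) (headᵇ l) (b ∷ r)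
  move ▸ b (tape l _ r) = tape (b ∷ l) (headᵇ r) (tailᵇ r)
  move ● b (tape l _ r) = tape l b (padᵇ r)

  Action : Set → Set → Set
  Action Q E = (Q ⊎ E) × S × Dir

  written : ∀ {Q E} → Action Q E → S
  written (_ , b , _) = b

  record Machine (E : Set) : Set₁ where
    field
      State  : Set
      finite : Finite State
      start  : State
      δ      : State → S → Action State E
  open Machine public

  data Run {E : Set} (A : Machine E) : State A → Tape → E → Tape → Set where
    done : ∀ {q t e b m t′} → δ A q (hd t) ≡ (inj₂ e , b , m) → t′ ≡ move m b t → Run A q t e t′
    step : ∀ {q t e b m q′ t′} → δ A q (hd t) ≡ (inj₁ q′ , b , m) → Run A q′ (move m b t) e t′ → Run A q t e t′

  Runs : ∀ {E} → Machine E → Tape → E → Tape → Set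
  Runs A = Run A (start A)

  Runs-cong : ∀ {E} {A : Machine E} {t e t₁ t₂} → Runs A t e t₁ → t₁ ≡ t₂ → Runs A t e t₂
  Runs-cong r refl = r

  relabel : ∀ {Q Q′ E E′ : Set} → (Q → Q′) → (E → Q′ ⊎ E′) → Action Q E → Action Q′ E′
  relabel f g (x , b , m) = [ (λ q → inj₁ (f q)) , g ] x , b , m

  act : ∀ {E} → (S → E) → (S → S) → Dir → Machine E
  act f u m = record { State = ⊤ ; finite = finite-⊤ ; start = tt ; δ = λ _ a → inj₂ (f a) , u a , m }

  act-run : ∀ {E} (f : S → E) u m t → Runs (act f u m) t (f (hd t)) (move m (u (hd t)) t)
  act-run f u m t = done refl refl

  sweep : (S → Bool) → (S → S) → Dir → (S → S) → Machine ⊤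
  sweep p u d x = record { State = ⊤ ; finite = finite-⊤ ; start = tt ;
    δ = λ _ a → if p a then (inj₁ tt , u a , d) else (inj₂ tt , x a , ●) }

  private
    if-true : ∀ {A : Set} {b} (x y : A) → b ≡ true → (if b then x else y) ≡ x
    if-true x y refl = refl
    if-false : ∀ {A : Set} {b} (x y : A) → b ≡ false → (if b then x else y) ≡ y
    if-false x y refl = refl

  sweep-right-run : ∀ p u x (cs ys : List S) L → All (λ c → p c ≡ true) cs → p (headᵇ ys) ≡ false →
    Runs (sweep p u ▸ x) (tape L (headᵇ (cs ++ ys)) (tailᵇ (cs ++ ys))) tt
         (tape (map u cs ʳ++ L) (x (headᵇ ys)) (padᵇ (tailᵇ ys)))
  sweep-right-run p u x []       ys L []         e = done (if-false _ _ e) refl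
  sweep-right-run p u x (c ∷ cs) ys L (pc ∷ pcs) e = step (if-true _ _ pc) (sweep-right-run p u x cs ys (u c ∷ L) pcs e)

  sweep-right-run′ : ∀ p u x L c Z cs ys → c ∷ Z ≡ cs ++ ys → All (λ c → p c ≡ true) cs → p (headᵇ ys) ≡ false →
    Runs (sweep p u ▸ x) (tape L c Z) tt (tape (map u cs ʳ++ L) (x (headᵇ ys)) (padᵇ (tailᵇ ys)))
  sweep-right-run′ p u x L c Z cs ys e pcs pys =
    subst (λ zs → Runs (sweep p u ▸ x) (tape L (headᵇ zs) (tailᵇ zs)) tt (tape (map u cs ʳ++ L) (x (headᵇ ys)) (padᵇ (tailᵇ ys))))
      (sym e) (sweep-right-run p u x cs ys L pcs pys)

  sweep-left-run : ∀ p u x (cs ys : List S) R → All (λ c → p c ≡ true) cs → p (headᵇ ys) ≡ false →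
    Runs (sweep p u ◂ x) (tape (tailᵇ (cs ++ ys)) (headᵇ (cs ++ ys)) R) tt
         (tape (tailᵇ ys) (x (headᵇ ys)) (padᵇ (map u cs ʳ++ R)))
  sweep-left-run p u x []       ys R []         e = done (if-false _ _ e) refl
  sweep-left-run p u x (c ∷ cs) ys R (pc ∷ pcs) e = step (if-true _ _ pc) (sweep-left-run p u x cs ys (u c ∷ R) pcs e)

  infixr 4 _⟫_
  _⟫_ : ∀ {E} → Machine ⊤ → Machine E → Machine E
  _⟫_ {E} A B = record { State = State A ⊎ State B ; finite = finite-⊎ (finite A) (finite B) ; start = inj₁ (start A) ; δ = δ′ }
    where
    δ′ : State A ⊎ State B → S → Action (State A ⊎ State B) E
    δ′ (inj₁ q) a = relabel inj₁ (λ _ → inj₁ (inj₂ (start B))) (δ A q a)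
    δ′ (inj₂ q) a = relabel inj₂ inj₂ (δ B q a)

  seq-run₂ : ∀ {E} (A : Machine ⊤) (B : Machine E) {q t e t′} → Run B q t e t′ → Run (A ⟫ B) (inj₂ q) t e t′
  seq-run₂ A B (done x y) = done (cong (relabel inj₂ inj₂) x) y
  seq-run₂ A B (step x r) = step (cong (relabel inj₂ inj₂) x) (seq-run₂ A B r)

  seq-run : ∀ {E} (A : Machine ⊤) (B : Machine E) {q t t₁ e t₂} → Run A q t tt t₁ → Runs B t₁ e t₂ → Run (A ⟫ B) (inj₁ q) t e t₂
  seq-run A B (done x refl) r₂ = step (cong (relabel inj₁ (λ _ → inj₁ (inj₂ (start B)))) x) (seq-run₂ A B r₂)
  seq-run A B (step x r)    r₂ = step (cong (relabel inj₁ (λ _ → inj₁ (inj₂ (start B)))) x) (seq-run A B r r₂)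

  seq-run′ : ∀ {E} {A : Machine ⊤} {B : Machine E} {t t₁ e t₂} → Runs A t tt t₁ → Runs B t₁ e t₂ → Runs (A ⟫ B) t e t₂
  seq-run′ {A = A} {B} = seq-run A B

  Reaches : ∀ {E} → Machine E → Tape → E → (Tape → Set) → Set
  Reaches A t e P = Σ Tape λ t′ → Runs A t e t′ × P t′

  reaches-⟫ : ∀ {E} {A : Machine ⊤} {B : Machine E} {t e} {P Q : Tape → Set} →
    Reaches A t tt P → (∀ {t′} → P t′ → Reaches B t′ e Q) → Reaches (A ⟫ B) t e Q
  reaches-⟫ (_ , r₁ , p) k with k p
  ... | t₂ , r₂ , q = t₂ , seq-run′ r₁ r₂ , q

  branch : ∀ {E} → Machine Bool → Machine E → Machine E → Machine E
  branch {E} T A B = record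
    { State = State T ⊎ (State A ⊎ State B) ; finite = finite-⊎ (finite T) (finite-⊎ (finite A) (finite B))
    ; start = inj₁ (start T) ; δ = δ′ }
    where
    Q : Set
    Q = State T ⊎ (State A ⊎ State B)
    enter : Bool → Q ⊎ E
    enter true  = inj₁ (inj₂ (inj₁ (start A)))
    enter false = inj₁ (inj₂ (inj₂ (start B)))
    δ′ : Q → S → Action Q E
    δ′ (inj₁ q)        a = relabel inj₁ enter (δ T q a)
    δ′ (inj₂ (inj₁ q)) a = relabel (λ z → inj₂ (inj₁ z)) inj₂ (δ A q a)
    δ′ (inj₂ (inj₂ q)) a = relabel (λ z → inj₂ (inj₂ z)) inj₂ (δ B q a)

  branch-run₁ : ∀ {E} (T : Machine Bool) (A B : Machine E) {q t e t′} → Run A q t e t′ → Run (branch T A B) (inj₂ (inj₁ q)) t e t′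
  branch-run₁ T A B (done x y) = done (cong (relabel (λ z → inj₂ (inj₁ z)) inj₂) x) y
  branch-run₁ T A B (step x r) = step (cong (relabel (λ z → inj₂ (inj₁ z)) inj₂) x) (branch-run₁ T A B r)

  branch-run₂ : ∀ {E} (T : Machine Bool) (A B : Machine E) {q t e t′} → Run B q t e t′ → Run (branch T A B) (inj₂ (inj₂ q)) t e t′
  branch-run₂ T A B (done x y) = done (cong (relabel (λ z → inj₂ (inj₂ z)) inj₂) x) y
  branch-run₂ T A B (step x r) = step (cong (relabel (λ z → inj₂ (inj₂ z)) inj₂) x) (branch-run₂ T A B r)

  branch-true : ∀ {E} (T : Machine Bool) (A B : Machine E) {q t t₁ e t₂} →
    Run T q t true t₁ → Runs A t₁ e t₂ → Run (branch T A B) (inj₁ q) t e t₂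
  branch-true T A B (done x refl) r₂ = step (cong (relabel inj₁ _) x) (branch-run₁ T A B r₂)
  branch-true T A B (step x r)    r₂ = step (cong (relabel inj₁ _) x) (branch-true T A B r r₂)

  branch-false : ∀ {E} (T : Machine Bool) (A B : Machine E) {q t t₁ e t₂} →
    Run T q t false t₁ → Runs B t₁ e t₂ → Run (branch T A B) (inj₁ q) t e t₂
  branch-false T A B (done x refl) r₂ = step (cong (relabel inj₁ _) x) (branch-run₂ T A B r₂)
  branch-false T A B (step x r)    r₂ = step (cong (relabel inj₁ _) x) (branch-false T A B r r₂)

  branch-true′ : ∀ {E} {T : Machine Bool} {A B : Machine E} {t t₁ e t₂} → Runs T t true t₁ → Runs A t₁ e t₂ → Runs (branch T A B) t e t₂
  branch-true′ {T = T} {A} {B} = branch-true T A B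

  branch-false′ : ∀ {E} {T : Machine Bool} {A B : Machine E} {t t₁ e t₂} → Runs T t false t₁ → Runs B t₁ e t₂ → Runs (branch T A B) t e t₂
  branch-false′ {T = T} {A} {B} = branch-false T A B

  loop : Machine Bool → Machine ⊤
  loop B = record { State = State B ; finite = finite B ; start = start B ; δ = λ q a → relabel (λ z → z) continue (δ B q a) }
    where
    continue : Bool → State B ⊎ ⊤
    continue true  = inj₁ (start B)
    continue false = inj₂ tt

  loop-again : ∀ (B : Machine Bool) {q t t₁ t₂} → Run B q t true t₁ → Runs (loop B) t₁ tt t₂ → Run (loop B) q t tt t₂
  loop-again B (done x refl) r₂ = step (cong (relabel (λ z → z) _) x) r₂
  loop-again B (step x r)    r₂ = step (cong (relabel (λ z → z) _) x) (loop-again B r r₂)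

  loop-exit : ∀ (B : Machine Bool) {q t t₁} → Run B q t false t₁ → Run (loop B) q t tt t₁
  loop-exit B (done x y) = done (cong (relabel (λ z → z) _) x) y
  loop-exit B (step x r) = step (cong (relabel (λ z → z) _) x) (loop-exit B r)

  Writes : ∀ {E} → Machine E → (S → S → Set) → Set
  Writes A P = ∀ q a → P a (written (δ A q a))

  writes-weaken : ∀ {E} (A : Machine E) {P Q : S → S → Set} → (∀ a b → P a b → Q a b) → Writes A P → Writes A Q
  writes-weaken A f aw q a = f a _ (aw q a)

  run-invariant : ∀ {E} (A : Machine E) (P : S → S → Set) (I : Tape → Set) →
    Writes A P → (∀ t b m → P (hd t) b → I t → I (move m b t)) →
    ∀ {q t e t′} → Run A q t e t′ → I t → I t′
  run-invariant A P I aw inv (done {q = q} {t = t} x refl) it = inv t _ _ (subst (P (hd t)) (cong written x) (aw q (hd t))) it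
  run-invariant A P I aw inv (step {q = q} {t = t} x r)    it =
    run-invariant A P I aw inv r (inv t _ _ (subst (P (hd t)) (cong written x) (aw q (hd t))) it)

  act-writes : ∀ {E} (f : S → E) u m (P : S → S → Set) → (∀ a → P a (u a)) → Writes (act f u m) P
  act-writes f u m P h q a = h a

  sweep-writes : ∀ p u d x (P : S → S → Set) → (∀ a → P a (u a)) → (∀ a → P a (x a)) → Writes (sweep p u d x) P
  sweep-writes p u d x P hu hx q a with p a
  ... | true  = hu a
  ... | false = hx a

  seq-writes : ∀ {E} (A : Machine ⊤) (B : Machine E) (P : S → S → Set) → Writes A P → Writes B P → Writes (A ⟫ B) P
  seq-writes A B P ha hb (inj₁ q) a = ha q a
  seq-writes A B P ha hb (inj₂ q) a = hb q a

  branch-writes : ∀ {E} (T : Machine Bool) (A B : Machine E) (P : S → S → Set) →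
    Writes T P → Writes A P → Writes B P → Writes (branch T A B) P
  branch-writes T A B P ht ha hb (inj₁ q)        a = ht q a
  branch-writes T A B P ht ha hb (inj₂ (inj₁ q)) a = ha q a
  branch-writes T A B P ht ha hb (inj₂ (inj₂ q)) a = hb q a

  module Track {X : Set} (f : S → X) (x₀ : X) (f-blank : f blank ≡ x₀) where

    contents : Tape → List X
    contents (tape l h r) = map f l ʳ++ (f h ∷ map f r)

    data Padding : List X → List X → Set where
      base : ∀ {xs} → Padding xs xs
      padL : ∀ {xs ys} → Padding xs ys → Padding xs (x₀ ∷ ys)
      padR : ∀ {xs ys} → Padding xs ys → Padding xs (ys ++ x₀ ∷ [])

    padding-trans : ∀ {xs ys zs} → Padding xs ys → Padding ys zs → Padding xs zs
    padding-trans p base     = p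
    padding-trans p (padL q) = padL (padding-trans p q)
    padding-trans p (padR q) = padR (padding-trans p q)

    PaddingClosed : (List X → Set) → Set
    PaddingClosed P = ∀ ys → P ys → P (x₀ ∷ ys) × P (ys ++ x₀ ∷ [])

    padding-transport : ∀ {P} → PaddingClosed P → ∀ {xs ys} → Padding xs ys → P xs → P ys
    padding-transport pc base     p = p
    padding-transport pc (padL d) p = proj₁ (pc _ (padding-transport pc d p))
    padding-transport pc (padR d) p = proj₂ (pc _ (padding-transport pc d p))

    padding-snoc : ∀ l h → Padding (map f l ʳ++ (h ∷ [])) (map f l ʳ++ (h ∷ x₀ ∷ []))
    padding-snoc l h = subst (Padding (map f l ʳ++ (h ∷ []))) (ʳ++-++ (map f l)) (padR base)

    move-padding : ∀ m b t → f b ≡ f (hd t) → Padding (contents t) (contents (move m b t))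
    move-padding ◂ b (tape [] h r) e = subst (λ z → Padding (f h ∷ map f r) (z ∷ f b ∷ map f r)) (sym f-blank)
      (subst (λ z → Padding (f h ∷ map f r) (x₀ ∷ z ∷ map f r)) (sym e) (padL base))
    move-padding ◂ b (tape (y ∷ l) h r) e rewrite e = base
    move-padding ▸ b (tape l h [])      e rewrite e =
      subst (λ z → Padding _ (map f l ʳ++ (f h ∷ z ∷ []))) (sym f-blank) (padding-snoc l (f h))
    move-padding ▸ b (tape l h (y ∷ r)) e rewrite e = base
    move-padding ● b (tape l h [])      e rewrite e =
      subst (λ z → Padding _ (map f l ʳ++ (f h ∷ z ∷ []))) (sym f-blank) (padding-snoc l (f h))
    move-padding ● b (tape l h (y ∷ r)) e rewrite e = base

    run-padding : ∀ {E} (A : Machine E) → Writes A (λ a b → f b ≡ f a) →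
      ∀ {q t e t′} → Run A q t e t′ → Padding (contents t) (contents t′)
    run-padding A aw (done {q = q} {t = t} {b = b} {m = m} x refl) =
      move-padding m b t (subst (λ z → f (written z) ≡ f (hd t)) x (aw q (hd t)))
    run-padding A aw (step {q = q} {t = t} {b = b} {m = m} x r) =
      padding-trans (move-padding m b t (subst (λ z → f (written z) ≡ f (hd t)) x (aw q (hd t)))) (run-padding A aw r)

module RunFor (T : D.TM) where
  open D.TM T

  runFor-step : ∀ {c c′} k → D.step T c ≡ inj₂ c′ → D.runFor T (suc k) c ≡ D.runFor T k c′
  runFor-step k e rewrite e = refl

  runFor-halt : ∀ {c} k → D.step T c ≡ inj₁ c → D.runFor T (suc k) c ≡ just c
  runFor-halt k e rewrite e = refl

  step-left : ∀ {q l a r q′ b} → δ q a ≡ just (q′ , b , D.left) → D.step T (D.config q l a r) ≡ inj₂ (D.moveL T q′ l b r)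
  step-left e rewrite e = refl

  step-right : ∀ {q l a r q′ b} → δ q a ≡ just (q′ , b , D.right) → D.step T (D.config q l a r) ≡ inj₂ (D.moveR T q′ l b r)
  step-right e rewrite e = refl

  step-halt : ∀ {q l a r} → δ q a ≡ nothing → D.step T (D.config q l a r) ≡ inj₁ (D.config q l a r)
  step-halt e rewrite e = refl

bitFin : ∀ {n} → Bool → Fin (3 + n)
bitFin false = suc zero
bitFin true  = suc (suc zero)

module Compile (n : ℕ) (S : Set) (blank : S)
               (encode : S → Fin (3 + n)) (decode : Fin (3 + n) → S) (decode-encode : ∀ s → decode (encode s) ≡ s)
               (encode-blank : encode blank ≡ zero) (bit : Bool → S) (encode-bit : ∀ b → encode (bit b) ≡ bitFin b) where
  open Machines S blank

  module _ (A : Machine ⊤) where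
    -- The states inj₂ q are the intermediate states of a ● move.
    CState : Set
    CState = (State A ⊎ ⊤) ⊎ (State A ⊎ ⊤)

    finite-CState : Finite CState
    finite-CState = finite-⊎ (finite-⊎ (finite A) finite-⊤) (finite-⊎ (finite A) finite-⊤)

    N : ℕ
    N = Finite.size finite-CState

    -- The initial state zero of the compiled machine stands for start A.
    decodeState : Fin (suc N) → CState
    decodeState zero    = inj₁ (inj₁ (start A))
    decodeState (suc j) = Finite.decode finite-CState j

    encodeState : CState → Fin (suc N)
    encodeState x = suc (Finite.index finite-CState x)

    decode-encodeState : ∀ x → decodeState (encodeState x) ≡ x
    decode-encodeState = Finite.decode-index finite-CState

    Transition : Set
    Transition = Maybe (Fin (suc N) × Fin (3 + n) × D.Move)

    action : Action (State A) ⊤ → Transition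
    action (x , b , ◂) = just (encodeState (inj₁ x) , encode b , D.left)
    action (x , b , ▸) = just (encodeState (inj₁ x) , encode b , D.right)
    action (x , b , ●) = just (encodeState (inj₂ x) , encode b , D.right)

    transition : CState → Fin (3 + n) → Transition
    transition (inj₁ (inj₁ q))  a = action (δ A q (decode a))
    transition (inj₁ (inj₂ tt)) a = nothing
    transition (inj₂ x)         a = just (encodeState (inj₁ x) , a , D.left)

    compile : D.TM
    compile = record { states = N ; extra = n ; δ = λ i a → transition (decodeState i) a }

    open RunFor compile

    encodeConfig : Fin (suc N) → Tape → D.Config compile
    encodeConfig i (tape l h r) = D.config i (map encode l) (encode h) (map encode r)

    moveL-encode : ∀ q l b r → D.moveL compile q (map encode l) b r ≡ D.config q (map encode (tailᵇ l)) (encode (headᵇ l)) (b ∷ r)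
    moveL-encode q []      b r = cong (λ z → D.config q [] z (b ∷ r)) (sym encode-blank)
    moveL-encode q (x ∷ l) b r = refl

    moveR-encode : ∀ q l b r → D.moveR compile q l b (map encode r) ≡ D.config q (b ∷ l) (encode (headᵇ r)) (map encode (tailᵇ r))
    moveR-encode q l b []      = cong (λ z → D.config q (b ∷ l) z []) (sym encode-blank)
    moveR-encode q l b (x ∷ r) = refl

    haltState : Fin (suc N)
    haltState = encodeState (inj₁ (inj₂ tt))

    compile-step : ∀ i q t x b m → decodeState i ≡ inj₁ (inj₁ q) → δ A q (hd t) ≡ (x , b , m) →
      Σ ℕ λ k → ∀ k′ → D.runFor compile (k + k′) (encodeConfig i t) ≡ D.runFor compile k′ (encodeConfig (encodeState (inj₁ x)) (move m b t))
    compile-step i q (tape l h r) x b ◂ ei ed = 1 , λ k′ →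
      trans (runFor-step k′ (step-left {q = i} {l = map encode l} {a = encode h} {r = map encode r} δ-left)) (cong (D.runFor compile k′) (moveL-encode _ l (encode b) (map encode r)))
      where
      δ-left : transition (decodeState i) (encode h) ≡ just (encodeState (inj₁ x) , encode b , D.left)
      δ-left rewrite ei | decode-encode h | ed = refl
    compile-step i q (tape l h r) x b ▸ ei ed = 1 , λ k′ →
      trans (runFor-step k′ (step-right {q = i} {l = map encode l} {a = encode h} {r = map encode r} δ-right)) (cong (D.runFor compile k′) (moveR-encode _ (map encode l) (encode b) r))
      where
      δ-right : transition (decodeState i) (encode h) ≡ just (encodeState (inj₁ x) , encode b , D.right)
      δ-right rewrite ei | decode-encode h | ed = refl
    compile-step i q (tape l h r) x b ● ei ed = 2 , λ k′ → begin
      D.runFor compile (2 + k′) (encodeConfig i (tape l h r))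
        ≡⟨ runFor-step (suc k′) (step-right {q = i} {l = map encode l} {a = encode h} {r = map encode r} δ-right) ⟩
      D.runFor compile (suc k′) (D.moveR compile (encodeState (inj₂ x)) (map encode l) (encode b) (map encode r))
        ≡⟨ cong (D.runFor compile (suc k′)) (moveR-encode _ (map encode l) (encode b) r) ⟩
      D.runFor compile (suc k′) (D.config (encodeState (inj₂ x)) (encode b ∷ map encode l) (encode (headᵇ r)) (map encode (tailᵇ r)))
        ≡⟨ runFor-step k′ (step-left {q = encodeState (inj₂ x)} {l = encode b ∷ map encode l} {a = encode (headᵇ r)} {r = map encode (tailᵇ r)} δ-back) ⟩
      D.runFor compile k′ (encodeConfig (encodeState (inj₁ x)) (move ● b (tape l h r)))
        ∎
      where
      open ≡-Reasoning
      δ-right : transition (decodeState i) (encode h) ≡ just (encodeState (inj₂ x) , encode b , D.right)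
      δ-right rewrite ei | decode-encode h | ed = refl
      δ-back : transition (decodeState (encodeState (inj₂ x))) (encode (headᵇ r)) ≡ just (encodeState (inj₁ x) , encode (headᵇ r) , D.left)
      δ-back rewrite decode-encodeState (inj₂ x) = refl

    compile-run : ∀ {q t t′} → Run A q t tt t′ → ∀ i → decodeState i ≡ inj₁ (inj₁ q) →
      Σ ℕ λ k → D.runFor compile k (encodeConfig i t) ≡ just (encodeConfig haltState t′)
    compile-run {q} {t} (done {b = b} {m = m} ed refl) i ei with compile-step i q t (inj₂ tt) b m ei ed
    ... | k , h = k + 1 , trans (h 1) (runFor-halt 0 (step-halt halts))
      where
      halts : transition (decodeState haltState) (encode (hd (move m b t))) ≡ nothing
      halts rewrite decode-encodeState (inj₁ (inj₂ tt)) = refl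
    compile-run {q} {t} (step {b = b} {m = m} {q′ = q′} ed r) i ei
      with compile-step i q t (inj₁ q′) b m ei ed | compile-run r (encodeState (inj₁ (inj₁ q′))) (decode-encodeState _)
    ... | k , h | k′ , h′ = k + k′ , trans (h k′) h′

    initialTape : List Bool → Tape
    initialTape []      = tape [] blank []
    initialTape (b ∷ w) = tape [] (bit b) (map bit w)

    encode-bits : ∀ w → map encode (map bit w) ≡ map (D.bitSym compile) w
    encode-bits []          = refl
    encode-bits (false ∷ w) = cong₂ _∷_ (encode-bit false) (encode-bits w)
    encode-bits (true ∷ w)  = cong₂ _∷_ (encode-bit true) (encode-bits w)

    encode-initialTape : ∀ x → encodeConfig zero (initialTape x) ≡ D.initial compile x
    encode-initialTape []          = cong (λ z → D.config zero [] z []) encode-blank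
    encode-initialTape (false ∷ w) = cong₂ (D.config zero []) (encode-bit false) (encode-bits w)
    encode-initialTape (true ∷ w)  = cong₂ (D.config zero []) (encode-bit true) (encode-bits w)

    compile-computes : ∀ x y t → Runs A (initialTape x) tt t → D.readBits compile (encode (hd t) ∷ map encode (rights t)) ≡ y →
      D.Computes compile x y
    compile-computes x y (tape l h r) run out with compile-run run zero refl
    ... | k , runs = k , (begin
      Maybe.map (D.output compile) (D.runFor compile k (D.initial compile x))
        ≡⟨ cong (λ c → Maybe.map (D.output compile) (D.runFor compile k c)) (encode-initialTape x) ⟨
      Maybe.map (D.output compile) (D.runFor compile k (encodeConfig zero (initialTape x)))
        ≡⟨ cong (Maybe.map (D.output compile)) runs ⟩
      just (D.readBits compile (encode h ∷ map encode r))
        ≡⟨ cong just out ⟩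
      just y ∎)
      where open ≡-Reasoning

embed : ∀ {m n} → m ≤ n → Fin m → Fin n
embed (s≤s p) zero    = zero
embed (s≤s p) (suc i) = suc (embed p i)

project : ∀ {m n} → suc m ≤ n → Fin n → Fin (suc m)
project         (s≤s p)       zero    = zero
project {zero}  (s≤s p)       (suc j) = zero
project {suc m} (s≤s (s≤s p)) (suc j) = suc (project (s≤s p) j)

project-embed : ∀ {m n} (p : suc m ≤ n) i → project p (embed p i) ≡ i
project-embed         (s≤s p)       zero    = refl
project-embed {suc m} (s≤s (s≤s p)) (suc i) = cong suc (project-embed (s≤s p) i)

data IOSym : Set where
  ioBlank ioSep : IOSym
  ioBit         : Bool → IOSym

finite-IOSym : Finite IOSym
finite-IOSym = record { size = 4 ; index = index ; decode = decode ; decode-index = decode-index }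
  where
  index : IOSym → Fin 4
  index ioBlank       = zero
  index ioSep         = suc zero
  index (ioBit false) = suc (suc zero)
  index (ioBit true)  = suc (suc (suc zero))
  decode : Fin 4 → IOSym
  decode zero                = ioBlank
  decode (suc zero)          = ioSep
  decode (suc (suc zero))    = ioBit false
  decode (suc (suc (suc _))) = ioBit true
  decode-index : ∀ x → decode (index x) ≡ x
  decode-index ioBlank       = refl
  decode-index ioSep         = refl
  decode-index (ioBit false) = refl
  decode-index (ioBit true)  = refl

-- E bounds the auxiliary alphabets of the Turing machines that will run on the w and w2 tracks.
module Cells (E : ℕ) where
  K : ℕ
  K = 3 + E

  -- v: the cell has been visited; t: the input word, later the output word, followed by ioSep;
  -- m: the anchor, marking the first cell of the word on track w; w: the track on which the
  -- simulating machines compute; w2: a scratch track.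
  record Cell : Set where
    constructor cell
    field
      v  : Bool
      t  : IOSym
      m  : Bool
      w  : Fin K
      w2 : Fin K
  open Cell public

  blankCell : Cell
  blankCell = cell false ioBlank false zero zero

  rawBit : Bool → Cell
  rawBit b = cell false (ioBit b) false zero zero

  finite-Cell : Finite Cell
  finite-Cell = record
    { size = Finite.size P ; index = λ c → Finite.index P (fields c) ; decode = λ i → fromFields (Finite.decode P i)
    ; decode-index = λ c → cong fromFields (Finite.decode-index P (fields c)) }
    where
    P : Finite (Bool × IOSym × Bool × Fin K × Fin K)
    P = finite-× finite-Bool (finite-× finite-IOSym (finite-× finite-Bool (finite-× (finite-Fin K) (finite-Fin K))))
    fields : Cell → Bool × IOSym × Bool × Fin K × Fin K
    fields (cell a b c d e) = a , b , c , d , e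
    fromFields : Bool × IOSym × Bool × Fin K × Fin K → Cell
    fromFields (a , b , c , d , e) = cell a b c d e

  cellCount : ℕ
  cellCount = Finite.size finite-Cell

  data CellView (c : Cell) : Set where
    isBlank : c ≡ blankCell → CellView c
    isRaw   : ∀ b → c ≡ rawBit b → CellView c
    isOther : CellView c

  cellView : ∀ c → CellView c
  cellView (cell false ioBlank   false zero zero) = isBlank refl
  cellView (cell false (ioBit b) false zero zero) = isRaw b refl
  cellView c                                      = isOther

  -- The blank cell and the cells of an input word must be encoded by the blank and the bit
  -- symbols of the compiled machine, so they get the first three codes.
  encodeView : ∀ c → CellView c → Fin (3 + cellCount)
  encodeView c (isBlank _) = zero
  encodeView c (isRaw b _) = bitFin b
  encodeView c isOther     = suc (suc (suc (Finite.index finite-Cell c)))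

  encodeCell : Cell → Fin (3 + cellCount)
  encodeCell c = encodeView c (cellView c)

  decodeCell : Fin (3 + cellCount) → Cell
  decodeCell zero                = blankCell
  decodeCell (suc zero)          = rawBit false
  decodeCell (suc (suc zero))    = rawBit true
  decodeCell (suc (suc (suc j))) = Finite.decode finite-Cell j

  decode-encodeView : ∀ c s → decodeCell (encodeView c s) ≡ c
  decode-encodeView c (isBlank e)     = sym e
  decode-encodeView c (isRaw false e) = sym e
  decode-encodeView c (isRaw true e)  = sym e
  decode-encodeView c isOther         = Finite.decode-index finite-Cell c

  decode-encodeCell : ∀ c → decodeCell (encodeCell c) ≡ c
  decode-encodeCell c = decode-encodeView c (cellView c)

  open Machines Cell blankCell public
  open Compile cellCount Cell blankCell encodeCell decodeCell decode-encodeCell refl rawBit (λ _ → refl) public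

  mark : Cell → Cell
  mark c = record c { v = true }

  setIO : IOSym → Cell → Cell
  setIO x c = record c { t = x }

  setAnchor : Bool → Cell → Cell
  setAnchor x c = record c { m = x }

  setWork : Fin K → Cell → Cell
  setWork x c = record c { w = x }

  setScratch : Fin K → Cell → Cell
  setScratch x c = record c { w2 = x }

  visitedBlank : Cell
  visitedBlank = mark blankCell

  Visited : Cell → Set
  Visited c = v c ≡ true

  Blank : Cell → Set
  Blank c = c ≡ blankCell

  record VisitedRegion (x : Tape) : Set where
    constructor region
    field
      visitedL blankL visitedR blankR : List Cell
      eqL         : lefts x ≡ visitedL ++ blankL
      eqR         : rights x ≡ visitedR ++ blankR
      allVisitedL : All Visited visitedL
      allBlankL   : All Blank blankL
      allVisitedR : All Visited visitedR
      allBlankR   : All Blank blankR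

  all-tailᵇ : ∀ {P : Cell → Set} {xs} → All P xs → All P (tailᵇ xs)
  all-tailᵇ []       = []
  all-tailᵇ (_ ∷ ps) = ps

  all-headᵇ : ∀ {P : Cell → Set} {xs} → P blankCell → All P xs → P (headᵇ xs)
  all-headᵇ p []      = p
  all-headᵇ p (q ∷ _) = q

  all-padᵇ : ∀ {P : Cell → Set} {xs} → P blankCell → All P xs → All P (padᵇ xs)
  all-padᵇ p []       = p ∷ []
  all-padᵇ p (q ∷ qs) = q ∷ qs

  headᵇ-blank : ∀ {xs} → All Blank xs → headᵇ xs ≡ blankCell
  headᵇ-blank = all-headᵇ refl

  move-visited : ∀ d b x → v b ≡ true → VisitedRegion x → VisitedRegion (move d b x)
  move-visited ◂ b _ vb (region []       Lb Rv Rb refl refl []        aLb aRv aRb) =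
    region [] (tailᵇ Lb) (b ∷ Rv) Rb refl refl [] (all-tailᵇ aLb) (vb ∷ aRv) aRb
  move-visited ◂ b _ vb (region (_ ∷ Lv) Lb Rv Rb refl refl (_ ∷ aLv) aLb aRv aRb) =
    region Lv Lb (b ∷ Rv) Rb refl refl aLv aLb (vb ∷ aRv) aRb
  move-visited ▸ b _ vb (region Lv Lb []       Rb refl refl aLv aLb []        aRb) =
    region (b ∷ Lv) Lb [] (tailᵇ Rb) refl refl (vb ∷ aLv) aLb [] (all-tailᵇ aRb)
  move-visited ▸ b _ vb (region Lv Lb (_ ∷ Rv) Rb refl refl aLv aLb (_ ∷ aRv) aRb) =
    region (b ∷ Lv) Lb Rv Rb refl refl (vb ∷ aLv) aLb aRv aRb
  move-visited ● b _ vb (region Lv Lb []       Rb refl refl aLv aLb []        aRb) =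
    region Lv Lb [] (padᵇ Rb) refl refl aLv aLb [] (all-padᵇ refl aRb)
  move-visited ● b _ vb (region Lv Lb (c ∷ Rv) Rb refl refl aLv aLb (p ∷ aRv) aRb) =
    region Lv Lb (c ∷ Rv) Rb refl refl aLv aLb (p ∷ aRv) aRb

  WritesVisited : Cell → Cell → Set
  WritesVisited a b = v b ≡ true

  run-visited : ∀ {X} (A : Machine X) → Writes A WritesVisited → ∀ {q x e x′} → Run A q x e x′ → VisitedRegion x → VisitedRegion x′
  run-visited A aw r g = run-invariant A WritesVisited VisitedRegion aw (λ x b d vb gx → move-visited d b x vb gx) r g

module Lifting (E : ℕ) where
  open Cells E

  record Lens : Set where
    field
      get        : Cell → Fin K
      put        : Fin K → Cell → Cell
      get-put    : ∀ x c → get (put x c) ≡ x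
      get-mark   : ∀ c → get (mark c) ≡ get c
      get-blank  : get blankCell ≡ zero
      other      : Cell → Fin K
      other-put  : ∀ x c → other (put x c) ≡ other c
      other-mark : ∀ c → other (mark c) ≡ other c
      io-put     : ∀ x c → t (put x c) ≡ t c
      anchor-put : ∀ x c → m (put x c) ≡ m c

  workLens : Lens
  workLens = record
    { get = w ; put = setWork ; get-put = λ _ _ → refl ; get-mark = λ _ → refl ; get-blank = refl
    ; other = w2 ; other-put = λ _ _ → refl ; other-mark = λ _ → refl ; io-put = λ _ _ → refl ; anchor-put = λ _ _ → refl }

  scratchLens : Lens
  scratchLens = record
    { get = w2 ; put = setScratch ; get-put = λ _ _ → refl ; get-mark = λ _ → refl ; get-blank = refl
    ; other = w ; other-put = λ _ _ → refl ; other-mark = λ _ → refl ; io-put = λ _ _ → refl ; anchor-put = λ _ _ → refl }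

  module Lift (N : D.TM) (le : D.TM.extra N ≤ E) (lens : Lens) where
    open Lens lens
    open D.TM N using (states; extra)

    3+extra≤K : 3 + extra ≤ K
    3+extra≤K = s≤s (s≤s (s≤s le))

    embedSym : Fin (3 + extra) → Fin K
    embedSym = embed 3+extra≤K

    projectSym : Fin K → Fin (3 + extra)
    projectSym = project 3+extra≤K

    embedSym-bitSym : ∀ b → embedSym (D.bitSym N b) ≡ bitFin b
    embedSym-bitSym false = refl
    embedSym-bitSym true  = refl

    embed-bits : ∀ u → map embedSym (map (D.bitSym N) u) ≡ map bitFin u
    embed-bits []      = refl
    embed-bits (b ∷ u) = cong₂ _∷_ (embedSym-bitSym b) (embed-bits u)

    liftedAction : Cell → Maybe (Fin (suc states) × Fin (3 + extra) × D.Move) → Action (Fin (suc states)) ⊤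
    liftedAction c nothing                  = inj₂ tt , mark c , ●
    liftedAction c (just (q , a , D.left))  = inj₁ q , mark (put (embedSym a) c) , ◂
    liftedAction c (just (q , a , D.right)) = inj₁ q , mark (put (embedSym a) c) , ▸

    lifted : Machine ⊤
    lifted = record
      { State = Fin (suc states) ; finite = finite-Fin _ ; start = zero
      ; δ = λ q c → liftedAction c (D.TM.δ N q (projectSym (get c))) }

    PaddedTrack : List (Fin K) → List (Fin (3 + extra)) → Set
    PaddedTrack xs ys = Σ ℕ λ k → xs ≡ map embedSym ys ++ replicate k zero

    Mirrors : Tape → D.Config N → Set
    Mirrors (tape L H R) (D.config q l a r) = PaddedTrack (map get L) l × get H ≡ embedSym a × PaddedTrack (map get R) r

    mirrors-moveL : ∀ L R c q b l r → get c ≡ embedSym b → PaddedTrack (map get L) l → PaddedTrack (map get R) r →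
      Mirrors (tape (tailᵇ L) (headᵇ L) (c ∷ R)) (D.moveL N q l b r)
    mirrors-moveL []      R c q b []      r gc (k , e)     (k′ , e′) = (0 , refl) , get-blank , (k′ , cong₂ _∷_ gc e′)
    mirrors-moveL (x ∷ L) R c q b []      r gc (suc k , e) (k′ , e′) = (k , ∷-injectiveʳ e) , ∷-injectiveˡ e , (k′ , cong₂ _∷_ gc e′)
    mirrors-moveL []      R c q b (y ∷ l) r gc (k , ())    _
    mirrors-moveL (x ∷ L) R c q b (y ∷ l) r gc (k , e)     (k′ , e′) = (k , ∷-injectiveʳ e) , ∷-injectiveˡ e , (k′ , cong₂ _∷_ gc e′)

    mirrors-moveR : ∀ L R c q b l r → get c ≡ embedSym b → PaddedTrack (map get L) l → PaddedTrack (map get R) r →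
      Mirrors (tape (c ∷ L) (headᵇ R) (tailᵇ R)) (D.moveR N q l b r)
    mirrors-moveR L []      c q b l []      gc (k , e) (k′ , e′)     = (k , cong₂ _∷_ gc e) , get-blank , (0 , refl)
    mirrors-moveR L (x ∷ R) c q b l []      gc (k , e) (suc k′ , e′) = (k , cong₂ _∷_ gc e) , ∷-injectiveˡ e′ , (k′ , ∷-injectiveʳ e′)
    mirrors-moveR L []      c q b l (y ∷ r) gc _       (k′ , ())
    mirrors-moveR L (x ∷ R) c q b l (y ∷ r) gc (k , e) (k′ , e′)     = (k , cong₂ _∷_ gc e) , ∷-injectiveˡ e′ , (k′ , ∷-injectiveʳ e′)

    padded-padᵇ : ∀ R r → PaddedTrack (map get R) r → PaddedTrack (map get (padᵇ R)) r
    padded-padᵇ []      []      (zero , refl) = 1 , cong (_∷ []) get-blank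
    padded-padᵇ []      (y ∷ r) (k , ())
    padded-padᵇ []      []      (suc k , ())
    padded-padᵇ (x ∷ R) r       p = p

    lifted-δ : ∀ q H a → get H ≡ embedSym a → δ lifted q H ≡ liftedAction H (D.TM.δ N q a)
    lifted-δ q H a e = cong (λ z → liftedAction H (D.TM.δ N q z)) (trans (cong projectSym e) (project-embed 3+extra≤K a))

    moveL-state : ∀ q l b r → D.Config.state (D.moveL N q l b r) ≡ q
    moveL-state q []      b r = refl
    moveL-state q (x ∷ l) b r = refl

    moveR-state : ∀ q l b r → D.Config.state (D.moveR N q l b r) ≡ q
    moveR-state q l b []      = refl
    moveR-state q l b (x ∷ r) = refl

    lift-run : ∀ k (c c′ : D.Config N) (x : Tape) → D.runFor N k c ≡ just c′ → Mirrors x c →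
      Σ Tape λ x′ → Run lifted (D.Config.state c) x tt x′ × Mirrors x′ c′
    lift-run zero c c′ x () _
    lift-run (suc k) (D.config q l a r) c′ (tape L H R) e (pl , ph , pr) with D.TM.δ N q a in eq
    ... | nothing = tape L (mark H) (padᵇ R) ,
          done (trans (lifted-δ q H a ph) (cong (liftedAction H) eq)) refl ,
          subst (Mirrors (tape L (mark H) (padᵇ R))) (just-injective e) (pl , trans (get-mark H) ph , padded-padᵇ R r pr)
    ... | just (q′ , b , D.left)
      with lift-run k (D.moveL N q′ l b r) c′ (move ◂ (mark (put (embedSym b) H)) (tape L H R)) e
                    (mirrors-moveL L R (mark (put (embedSym b) H)) q′ b l r (trans (get-mark _) (get-put _ _)) pl pr)
    ...   | x′ , run , mirrors =
      x′ , step (trans (lifted-δ q H a ph) (cong (liftedAction H) eq)) (subst (λ z → Run lifted z _ tt x′) (moveL-state q′ l b r) run) , mirrors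
    lift-run (suc k) (D.config q l a r) c′ (tape L H R) e (pl , ph , pr) | just (q′ , b , D.right)
      with lift-run k (D.moveR N q′ l b r) c′ (move ▸ (mark (put (embedSym b) H)) (tape L H R)) e
                    (mirrors-moveR L R (mark (put (embedSym b) H)) q′ b l r (trans (get-mark _) (get-put _ _)) pl pr)
    ... | x′ , run , mirrors =
      x′ , step (trans (lifted-δ q H a ph) (cong (liftedAction H) eq)) (subst (λ z → Run lifted z _ tt x′) (moveR-state q′ l b r) run) , mirrors

    LiftWrites : Cell → Cell → Set
    LiftWrites a b = (v b ≡ true) × (t b ≡ t a) × (m b ≡ m a) × (other b ≡ other a)

    lifted-writes : Writes lifted LiftWrites
    lifted-writes q a with D.TM.δ N q (projectSym (get a))
    ... | nothing                = refl , refl , refl , other-mark a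
    ... | just (q′ , b , D.left)  = refl , io-put _ a , anchor-put _ a , trans (other-mark _) (other-put _ a)
    ... | just (q′ , b , D.right) = refl , io-put _ a , anchor-put _ a , trans (other-mark _) (other-put _ a)

module Layouts (E : ℕ) where
  open Cells E

  isVisited : Cell → Bool
  isVisited = v

  notAnchor : Cell → Bool
  notAnchor c = not (m c)

  toLeftEnd : Machine ⊤
  toLeftEnd = sweep isVisited mark ◂ mark ⟫ act (λ _ → tt) mark ▸

  toAnchor : Machine ⊤
  toAnchor = toLeftEnd ⟫ sweep notAnchor mark ▸ mark

  NavWrites : Cell → Cell → Set
  NavWrites a b = (v b ≡ true) × (t b ≡ t a) × (m b ≡ m a) × (w b ≡ w a) × (w2 b ≡ w2 a)

  nav-mark : ∀ a → NavWrites a (mark a)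
  nav-mark a = refl , refl , refl , refl , refl

  toLeftEnd-writes : Writes toLeftEnd NavWrites
  toLeftEnd-writes = seq-writes (sweep isVisited mark ◂ mark) (act (λ _ → tt) mark ▸) NavWrites
    (sweep-writes isVisited mark ◂ mark NavWrites nav-mark nav-mark) (act-writes (λ _ → tt) mark ▸ NavWrites nav-mark)

  toAnchor-writes : Writes toAnchor NavWrites
  toAnchor-writes = seq-writes toLeftEnd (sweep notAnchor mark ▸ mark) NavWrites
    toLeftEnd-writes (sweep-writes notAnchor mark ▸ mark NavWrites nav-mark nav-mark)

  blank-unvisited : ∀ {c} → c ≡ blankCell → v c ≡ false
  blank-unvisited refl = refl

  padᵇ-ʳ++∷ : ∀ (xs : List Cell) y ys → padᵇ (xs ʳ++ (y ∷ ys)) ≡ xs ʳ++ (y ∷ ys)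
  padᵇ-ʳ++∷ []       y ys = refl
  padᵇ-ʳ++∷ (x ∷ xs) y ys = padᵇ-ʳ++∷ xs x (y ∷ ys)

  toLeftEnd-run : ∀ {L H R} (g : VisitedRegion (tape L H R)) → v H ≡ true →
    Σ Cell λ c → Σ (List Cell) λ Z → (map mark (VisitedRegion.visitedL g) ʳ++ (mark H ∷ R) ≡ c ∷ Z) ×
      Runs toLeftEnd (tape L H R) tt (tape (visitedBlank ∷ tailᵇ (VisitedRegion.blankL g)) c Z)
  toLeftEnd-run {H = H} {R} (region Lv Lb Rv Rb refl _ aLv aLb _ _) vH with ʳ++-∷-nonempty (map mark Lv) (mark H) R
  ... | c , Z , e = c , Z , e , seq-run′ sweep-run (Runs-cong (act-run (λ _ → tt) mark ▸ _) step-back)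
    where
    sweep-run : Runs (sweep isVisited mark ◂ mark) (tape (Lv ++ Lb) H R) tt
                     (tape (tailᵇ Lb) (mark (headᵇ Lb)) (padᵇ (map mark Lv ʳ++ (mark H ∷ R))))
    sweep-run = sweep-left-run isVisited mark mark (H ∷ Lv) Lb R (vH ∷ aLv) (blank-unvisited (headᵇ-blank aLb))
    step-back : move ▸ (mark (mark (headᵇ Lb))) (tape (tailᵇ Lb) (mark (headᵇ Lb)) (padᵇ (map mark Lv ʳ++ (mark H ∷ R))))
              ≡ tape (visitedBlank ∷ tailᵇ Lb) c Z
    step-back rewrite e | headᵇ-blank aLb = refl

  module IOTrack      = Track t ioBlank refl
  module AnchorTrack  = Track m false refl
  module ScratchTrack = Track w2 zero refl

  workAnchor : Cell → Fin K × Bool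
  workAnchor c = w c , m c

  noWork : Fin K × Bool
  noWork = zero , false

  module WorkTrack = Track workAnchor noWork refl

  not-false : ∀ {b} → b ≡ false → not b ≡ true
  not-false refl = refl

  all-not : ∀ (f : Cell → Bool) {xs} → All (λ c → f c ≡ false) xs → All (λ c → not (f c) ≡ true) xs
  all-not f = All.map not-false

  padded-closed : ∀ {X : Set} (x₀ : X) W ys → Padded x₀ W ys → Padded x₀ W (x₀ ∷ ys) × Padded x₀ W (ys ++ x₀ ∷ [])
  padded-closed x₀ W ys p = padded-∷ x₀ W ys p , padded-∷ʳ x₀ W ys p

  padded-[]-all : ∀ {X : Set} (x₀ : X) ys → Padded x₀ [] ys → All (_≡ x₀) ys
  padded-[]-all x₀ ys (a , b , refl) = ++⁺ (replicate⁺ a refl) (replicate⁺ b refl)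

  all-padded-[] : ∀ {X : Set} (x₀ : X) ys → All (_≡ x₀) ys → Padded x₀ [] ys
  all-padded-[] x₀ ys p with all-≡-replicate x₀ ys p
  ... | n , e = n , 0 , trans e (sym (++-identityʳ (replicate n x₀)))

  contents-all⁻ : ∀ {X : Set} (f : Cell → X) x₀ L H R → All (_≡ x₀) (map f L ʳ++ (f H ∷ map f R)) →
    All (λ c → f c ≡ x₀) L × f H ≡ x₀ × All (λ c → f c ≡ x₀) R
  contents-all⁻ f x₀ L H R p with ʳ++⁻ʳ (map f L) p
  ... | ph ∷ pr = map⁻ (ʳ++⁻ˡ (map f L) p) , ph , map⁻ pr

  contents-all⁺ : ∀ {X : Set} (f : Cell → X) x₀ L H R → All (λ c → f c ≡ x₀) L → f H ≡ x₀ → All (λ c → f c ≡ x₀) R →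
    All (_≡ x₀) (map f L ʳ++ (f H ∷ map f R))
  contents-all⁺ f x₀ L H R pl ph pr = ʳ++⁺ (map⁺ pl) (ph ∷ map⁺ pr)

  workContents : List Bool → List (Fin K × Bool)
  workContents []      = (zero , true) ∷ []
  workContents (b ∷ u) = (bitFin b , true) ∷ map (λ c → bitFin c , false) u

  IOShape : List Bool → List IOSym → Set
  IOShape z = Padded ioBlank (map ioBit z ++ ioSep ∷ [])

  WorkShape : List Bool → List (Fin K × Bool) → Set
  WorkShape acc = Padded noWork (workContents acc)

  ScratchClear : List (Fin K) → Set
  ScratchClear = Padded zero []

  record Layout (z acc : List Bool) (x : Tape) : Set where
    constructor layout
    field
      visitedRegion : VisitedRegion x
      headVisited   : v (hd x) ≡ true
      ioShape       : IOShape z (IOTrack.contents x)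
      workShape     : WorkShape acc (WorkTrack.contents x)
      scratchClear  : ScratchClear (ScratchTrack.contents x)
  open Layout public

  AnchoredLayout : List Bool → List Bool → Tape → Set
  AnchoredLayout z acc x = Layout z acc x × m (hd x) ≡ true

  nav-layout : ∀ {X} (A : Machine X) → Writes A NavWrites → ∀ {q x e x′ z acc} → Run A q x e x′ →
    Layout z acc x → v (hd x′) ≡ true → Layout z acc x′
  nav-layout A aw r (layout g _ sT sWM sZ) v′ = layout
    (run-visited A (writes-weaken A {NavWrites} (λ _ _ p → proj₁ p) aw) r g) v′
    (IOTrack.padding-transport (padded-closed ioBlank _) (IOTrack.run-padding A (writes-weaken A {NavWrites} (λ _ _ p → proj₁ (proj₂ p)) aw) r) sT)
    (WorkTrack.padding-transport (padded-closed noWork _)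
      (WorkTrack.run-padding A (writes-weaken A {NavWrites} (λ _ _ (_ , _ , pm , pw , _) → cong₂ _,_ pw pm) aw) r) sWM)
    (ScratchTrack.padding-transport (padded-closed zero _)
      (ScratchTrack.run-padding A (writes-weaken A {NavWrites} (λ _ _ (_ , _ , _ , _ , pw2) → pw2) aw) r) sZ)

  -- If the work shape holds then the anchor occurs exactly once, so toAnchor stops on it.
  toAnchor-run : ∀ {L H R} → VisitedRegion (tape L H R) → v H ≡ true → Padded false (true ∷ []) (AnchorTrack.contents (tape L H R)) →
    Σ Tape λ x′ → Runs toAnchor (tape L H R) tt x′ × m (hd x′) ≡ true × v (hd x′) ≡ true
  toAnchor-run {L} {H} {R} g vH sh with toLeftEnd-run g vH
  ... | c , Z , e , r₁ with first-true m (c ∷ Z)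
  ...   | inj₁ (cs , c′ , ds , e′ , f , mc) =
    _ , seq-run′ r₁ (sweep-right-run′ notAnchor mark mark _ c Z cs (c′ ∷ ds) e′ (all-not m f) (cong not mc)) , mc , refl
  ...   | inj₂ f with g | sh
  ...     | region Lv Lb Rv Rb refl _ _ aLb _ _ | a , b , esh = ⊥-elim (no-anchor a b (subst (All (_≡ false)) esh all-false))
    where
    no-anchor : ∀ a b → All (_≡ false) (replicate a false ++ (true ∷ [] ++ replicate b false)) → ⊥
    no-anchor zero    b (() ∷ _)
    no-anchor (suc a) b (_ ∷ p) = no-anchor a b p
    f′ : All (λ c → m c ≡ false) (map mark Lv ʳ++ (mark H ∷ R))
    f′ = subst (All (λ c → m c ≡ false)) (sym e) f
    all-false : All (_≡ false) (AnchorTrack.contents (tape (Lv ++ Lb) H R))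
    all-false with ʳ++⁻ʳ (map mark Lv) f′
    ... | mH ∷ mR = contents-all⁺ m false (Lv ++ Lb) H R (++⁺ (map⁻ (ʳ++⁻ˡ (map mark Lv) f′)) (All.map (λ { refl → refl }) aLb)) mH mR

  contents-map : ∀ {X Y : Set} (f : Cell → X) (g : X → Y) (x : Tape) →
    map g (map f (lefts x) ʳ++ (f (hd x) ∷ map f (rights x))) ≡ map (λ c → g (f c)) (lefts x) ʳ++ (g (f (hd x)) ∷ map (λ c → g (f c)) (rights x))
  contents-map f g (tape L H R) =
    trans (map-ʳ++ g (map f L) {f H ∷ map f R}) (cong₂ (λ a b → a ʳ++ (g (f H) ∷ b)) (sym (map-∘ L)) (sym (map-∘ R)))

  anchor-workContents : ∀ acc → Σ ℕ λ n → map proj₂ (workContents acc) ≡ true ∷ replicate n false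
  anchor-workContents []      = 0 , refl
  anchor-workContents (b ∷ u) = length u , cong (true ∷_) (trans (sym (map-∘ u)) (map-const u))
    where
    map-const : ∀ (u : List Bool) → map (λ _ → false) u ≡ replicate (length u) false
    map-const []      = refl
    map-const (_ ∷ u) = cong (false ∷_) (map-const u)

  anchorShape : ∀ acc x → WorkShape acc (WorkTrack.contents x) → Padded false (true ∷ []) (AnchorTrack.contents x)
  anchorShape acc x (a , b , e) with anchor-workContents acc
  ... | n , anchors = a , n + b , (begin
    AnchorTrack.contents x
      ≡⟨ contents-map workAnchor proj₂ x ⟨
    map proj₂ (WorkTrack.contents x)
      ≡⟨ cong (map proj₂) e ⟩
    map proj₂ (replicate a noWork ++ (workContents acc ++ replicate b noWork))
      ≡⟨ map-++ proj₂ (replicate a noWork) _ ⟩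
    map proj₂ (replicate a noWork) ++ map proj₂ (workContents acc ++ replicate b noWork)
      ≡⟨ cong₂ _++_ (map-replicate proj₂ a noWork) (map-++ proj₂ (workContents acc) (replicate b noWork)) ⟩
    replicate a false ++ (map proj₂ (workContents acc) ++ map proj₂ (replicate b noWork))
      ≡⟨ cong (replicate a false ++_) (cong₂ _++_ anchors (map-replicate proj₂ b noWork)) ⟩
    replicate a false ++ (true ∷ replicate n false ++ replicate b false)
      ≡⟨ cong (λ z → replicate a false ++ (true ∷ z)) (replicate-++ n b false) ⟩
    replicate a false ++ (true ∷ [] ++ replicate (n + b) false) ∎)
    where open ≡-Reasoning

  toAnchor-layout : ∀ {z acc x} → Layout z acc x → Reaches toAnchor x tt (AnchoredLayout z acc)
  toAnchor-layout {acc = acc} {x} l@(layout g vH _ sWM _) with toAnchor-run g vH (anchorShape acc x sWM)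
  ... | x′ , r , mH , vH′ = x′ , r , nav-layout toAnchor toAnchor-writes r l vH′ , mH

  ʳ++[]-replicate : ∀ {X : Set} (xs : List X) n x → xs ʳ++ [] ≡ replicate n x → xs ≡ replicate n x
  ʳ++[]-replicate xs n x e = begin
    xs                     ≡⟨ ++-identityʳ xs ⟨
    xs ++ []               ≡⟨ ʳ++-ʳ++ xs {[]} {[]} ⟨
    (xs ʳ++ []) ʳ++ []     ≡⟨ cong (_ʳ++ []) e ⟩
    replicate n x ʳ++ []   ≡⟨ replicate-ʳ++ n x [] ⟩
    replicate n x ++ []    ≡⟨ ++-identityʳ _ ⟩
    replicate n x          ∎
    where open ≡-Reasoning

  workContents-split : ∀ acc b → Σ (Fin K × Bool) λ y → Σ (List (Fin K × Bool)) λ D →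
    (workContents acc ++ replicate b noWork ≡ y ∷ D) × proj₂ y ≡ true × AllFalse proj₂ D
  workContents-split []      b = (zero , true) , replicate b noWork , refl , refl , replicate⁺ b refl
  workContents-split (c ∷ u) b = (bitFin c , true) , _ , refl , refl , ++⁺ (map⁺ (unanchored u)) (replicate⁺ b refl)
    where
    unanchored : ∀ u → All (λ c → proj₂ {B = λ _ → Bool} (bitFin {E} c , false) ≡ false) u
    unanchored []      = []
    unanchored (_ ∷ u) = refl ∷ unanchored u

  work-workContents : ∀ acc → map proj₁ (workContents acc) ≡ map bitFin acc ++ (zero ∷ []) ⊎ map proj₁ (workContents acc) ≡ map bitFin acc
  work-workContents []      = inj₁ refl
  work-workContents (c ∷ u) = inj₂ (cong (bitFin c ∷_) (sym (map-∘ u)))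

  anchored-tracks : ∀ {z acc L H R} → AnchoredLayout z acc (tape L H R) →
    (Σ ℕ λ a → map w L ≡ replicate a zero) × (Σ ℕ λ k → w H ∷ map w R ≡ map bitFin acc ++ replicate k zero) ×
    All (λ c → m c ≡ false) L × All (λ c → m c ≡ false) R
  anchored-tracks {z} {acc} {L} {H} {R} (layout _ _ _ (a , b , e) _ , mH) with workContents-split acc b
  ... | y , D , eD , my , fD
    with split-unique proj₂ (map workAnchor L ʳ++ []) (workAnchor H) (map workAnchor R) (replicate a noWork) y D mH (replicate⁺ a refl) fD
           (trans (ʳ++-++ (map workAnchor L)) (trans e (cong (replicate a noWork ++_) eD)))
  ...   | e₁ , e₂ , e₃ = (a , work-left) , work-right , anchor-left , anchor-right
    where
    blank-left : map workAnchor L ≡ replicate a noWork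
    blank-left = ʳ++[]-replicate (map workAnchor L) a noWork e₁
    work-left : map w L ≡ replicate a zero
    work-left = trans (map-∘ L) (trans (cong (map proj₁) blank-left) (map-replicate proj₁ a noWork))
    anchor-left : All (λ c → m c ≡ false) L
    anchor-left = map⁻ (subst (All (λ p → proj₂ p ≡ false)) (sym blank-left) (replicate⁺ a refl))
    anchor-right : All (λ c → m c ≡ false) R
    anchor-right = map⁻ (subst (AllFalse proj₂) (sym e₃) fD)
    work-all : w H ∷ map w R ≡ map proj₁ (workContents acc) ++ replicate b zero
    work-all = begin
      w H ∷ map w R                                                       ≡⟨ cong (w H ∷_) (map-∘ R) ⟩
      map proj₁ (workAnchor H ∷ map workAnchor R)                         ≡⟨ cong (map proj₁) (trans (cong₂ _∷_ e₂ e₃) (sym eD)) ⟩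
      map proj₁ (workContents acc ++ replicate b noWork)                  ≡⟨ map-++ proj₁ (workContents acc) (replicate b noWork) ⟩
      map proj₁ (workContents acc) ++ map proj₁ (replicate b noWork)      ≡⟨ cong (map proj₁ (workContents acc) ++_) (map-replicate proj₁ b noWork) ⟩
      map proj₁ (workContents acc) ++ replicate b zero                    ∎
      where open ≡-Reasoning
    work-right : Σ ℕ λ k → w H ∷ map w R ≡ map bitFin acc ++ replicate k zero
    work-right with work-workContents acc
    ... | inj₁ p = suc b , trans work-all (trans (cong (_++ replicate b zero) p) (++-assoc (map bitFin acc) (zero ∷ []) (replicate b zero)))
    ... | inj₂ p = b , trans work-all (cong (_++ replicate b zero) p)

module Cleaning (E : ℕ) where
  open Cells E
  open Lifting E
  open Layouts E

  isBitFin : Fin K → Bool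
  isBitFin (suc zero) = true
  isBitFin (suc (suc zero)) = true
  isBitFin _ = false

  isBitFin-bitFin : ∀ b → isBitFin (bitFin {E} b) ≡ true
  isBitFin-bitFin false = refl
  isBitFin-bitFin true  = refl

  isWorkBit : Cell → Bool
  isWorkBit c = isBitFin (w c)

  eraseWork : Cell → Cell
  eraseWork c = mark (setWork zero c)

  setAnchorHere : Machine ⊤
  setAnchorHere = act (λ _ → tt) (λ c → mark (setAnchor true c)) ●

  eraseToAnchor : Machine ⊤
  eraseToAnchor = sweep notAnchor eraseWork ▸ mark
  skipWorkBits : Machine ⊤
  skipWorkBits = sweep isWorkBit mark ▸ mark
  eraseRest : Machine ⊤
  eraseRest = sweep isVisited eraseWork ▸ mark

  cleanWork : Machine ⊤
  cleanWork = setAnchorHere ⟫ toLeftEnd ⟫ eraseToAnchor ⟫ skipWorkBits ⟫ eraseRest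

  module ReadOut (N : D.TM) (le : D.TM.extra N ≤ E) (Ln : Lens) where
    open Lift N le Ln
    open Lens Ln

    readBit-nothing : ∀ s → D.readBit N s ≡ nothing → isBitFin (embedSym s) ≡ false
    readBit-nothing zero e = refl
    readBit-nothing (suc zero) ()
    readBit-nothing (suc (suc zero)) ()
    readBit-nothing (suc (suc (suc s))) e = refl

    readBit-just : ∀ s b → D.readBit N s ≡ just b → embedSym s ≡ bitFin b
    readBit-just (suc zero) .false refl = refl
    readBit-just (suc (suc zero)) .true refl = refl

    zeros-not-bit : ∀ k (Y : List Cell) → map get Y ≡ replicate k zero → isBitFin (get (headᵇ Y)) ≡ false
    zeros-not-bit k [] e = cong isBitFin get-blank
    zeros-not-bit (suc k) (y ∷ Y) e = cong isBitFin (∷-injectiveˡ e)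

    split-output : ∀ (ss : List (Fin (3 + D.TM.extra N))) k (Y : List Cell) → map get Y ≡ map embedSym ss ++ replicate k zero →
      Σ (List Cell) λ ds → Σ (List Cell) λ es → (Y ≡ ds ++ es) × (map get ds ≡ map bitFin (D.readBits N ss)) ×
        All (λ c → isBitFin (get c) ≡ true) ds × isBitFin (get (headᵇ es)) ≡ false
    split-output [] k Y e = [] , Y , refl , refl , [] , zeros-not-bit k Y e
    split-output (s ∷ ss) k [] ()
    split-output (s ∷ ss) k (y ∷ Y) e with D.readBit N s in eq
    ... | nothing = [] , y ∷ Y , refl , refl , [] , trans (cong isBitFin (∷-injectiveˡ e)) (readBit-nothing s eq)
    ... | just b with split-output ss k Y (∷-injectiveʳ e)
    ...   | ds , es , e1 , e2 , a , f = y ∷ ds , es , cong (y ∷_) e1 ,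
              cong₂ _∷_ (trans (∷-injectiveˡ e) (readBit-just s b eq)) e2 ,
              trans (cong isBitFin (trans (∷-injectiveˡ e) (readBit-just s b eq))) (isBitFin-bitFin b) ∷ a , f

  WorkWrites : Cell → Cell → Set
  WorkWrites a b = (v b ≡ true) × (t b ≡ t a) × (w2 b ≡ w2 a)

  work-mark : ∀ a → WorkWrites a (mark a)
  work-mark a = refl , refl , refl

  work-erase : ∀ a → WorkWrites a (eraseWork a)
  work-erase a = refl , refl , refl

  nav⇒work : ∀ a b → NavWrites a b → WorkWrites a b
  nav⇒work a b (p1 , p2 , p3 , p4 , p5) = p1 , p2 , p5

  work-run-layout : ∀ {X} (A : Machine X) → Writes A WorkWrites → ∀ {q x e x′ z} → Run A q x e x′ →
    VisitedRegion x → IOShape z (IOTrack.contents x) → ScratchClear (ScratchTrack.contents x) →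
    VisitedRegion x′ × IOShape z (IOTrack.contents x′) × ScratchClear (ScratchTrack.contents x′)
  work-run-layout A aw r g sT sZ =
    run-visited A (writes-weaken A {WorkWrites} (λ _ _ p → proj₁ p) aw) r g ,
    IOTrack.padding-transport (padded-closed ioBlank _) (IOTrack.run-padding A (writes-weaken A {WorkWrites} (λ _ _ p → proj₁ (proj₂ p)) aw) r) sT ,
    ScratchTrack.padding-transport (padded-closed zero _) (ScratchTrack.run-padding A (writes-weaken A {WorkWrites} (λ _ _ p → proj₂ (proj₂ p)) aw) r) sZ

  cleanWork-writes : Writes cleanWork WorkWrites
  cleanWork-writes =
    seq-writes setAnchorHere _ WorkWrites (act-writes (λ _ → tt) (λ c → mark (setAnchor true c)) ● WorkWrites (λ a → refl , refl , refl))
    (seq-writes toLeftEnd _ WorkWrites (writes-weaken toLeftEnd nav⇒work toLeftEnd-writes)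
    (seq-writes eraseToAnchor _ WorkWrites (sweep-writes notAnchor eraseWork ▸ mark WorkWrites work-erase work-mark)
    (seq-writes skipWorkBits _ WorkWrites (sweep-writes isWorkBit mark ▸ mark WorkWrites work-mark work-mark)
    (sweep-writes isVisited eraseWork ▸ mark WorkWrites work-erase work-mark))))

  workAnchor-bits : ∀ (ds : List Cell) out → map w ds ≡ map bitFin out → All (λ c → m c ≡ false) ds →
    map workAnchor ds ≡ map (λ c → (bitFin c , false)) out
  workAnchor-bits [] [] e a = refl
  workAnchor-bits (d ∷ ds) (b ∷ out) e (p ∷ a) = cong₂ _∷_ (cong₂ _,_ (∷-injectiveˡ e) p) (workAnchor-bits ds out (∷-injectiveʳ e) a)

  workAnchor-erase : ∀ (xs : List Cell) → All (λ c → m c ≡ false) xs → map workAnchor (map eraseWork xs) ≡ replicate (length xs) noWork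
  workAnchor-erase [] [] = refl
  workAnchor-erase (x ∷ xs) (p ∷ a) = cong₂ _∷_ (cong (zero ,_) p) (workAnchor-erase xs a)

  workAnchor-blank : ∀ (xs : List Cell) → All Blank xs → map workAnchor xs ≡ replicate (length xs) noWork
  workAnchor-blank [] [] = refl
  workAnchor-blank (x ∷ xs) (refl ∷ a) = cong (noWork ∷_) (workAnchor-blank xs a)

  map-bitFin-[] : ∀ (out : List Bool) → [] ≡ map (bitFin {E}) out → out ≡ []
  map-bitFin-[] [] e = refl

  Unanchored : Cell → Set
  Unanchored c = m c ≡ false

  cleaned-work : ∀ (H : Cell) (P : List Cell) ds es (Rv Rb : List Cell) out → m H ≡ true → All Unanchored P →
    (mark (mark H) ∷ P ≡ ds ++ es) → map w ds ≡ map bitFin out → padᵇ (tailᵇ es) ≡ Rv ++ Rb →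
    Σ ℕ λ j → map workAnchor (map mark ds) ++ map workAnchor (map eraseWork (mark (headᵇ es) ∷ Rv))
            ≡ workContents out ++ replicate j noWork
  cleaned-work H P [] es Rv Rb out mH aP eY wds eqR with map-bitFin-[] out wds
  ... | refl = length Rv , cong₂ _∷_ (cong (zero ,_) (trans (cong (λ z → m (headᵇ z)) (sym eY)) mH)) (workAnchor-erase Rv unanchored-Rv)
    where
    unanchored-Rv : All Unanchored Rv
    unanchored-Rv = ++⁻ˡ Rv (subst (All Unanchored) eqR (all-padᵇ refl (subst (All Unanchored) (cong tailᵇ eY) aP)))
  cleaned-work H P (d ∷ ds) es Rv Rb [] mH aP eY () eqR
  cleaned-work H P (d ∷ ds) es Rv Rb (b ∷ out) mH aP eY wds eqR =
    suc (length Rv) , cong₂ _∷_ (cong₂ _,_ (∷-injectiveˡ wds) (trans (cong m (sym (∷-injectiveˡ eY))) mH)) rest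
    where
    eP : P ≡ ds ++ es
    eP = ∷-injectiveʳ eY
    aDsEs : All Unanchored (ds ++ es)
    aDsEs = subst (All Unanchored) eP aP
    aDs : All Unanchored ds
    aDs = ++⁻ˡ ds aDsEs
    aEs : All Unanchored es
    aEs = ++⁻ʳ ds aDsEs
    unanchored-Rv : All Unanchored Rv
    unanchored-Rv = ++⁻ˡ Rv (subst (All Unanchored) eqR (all-padᵇ refl (all-tailᵇ aEs)))
    hEs : m (headᵇ es) ≡ false
    hEs = all-headᵇ refl aEs
    rest : map workAnchor (map mark ds) ++ map workAnchor (map eraseWork (mark (headᵇ es) ∷ Rv))
         ≡ map (λ c → (bitFin c , false)) out ++ replicate (suc (length Rv)) noWork
    rest = cong₂ _++_ (trans (sym (map-∘ {g = workAnchor} {f = mark} ds)) (workAnchor-bits ds out (∷-injectiveʳ wds) aDs))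
             (cong₂ _∷_ (cong (zero ,_) hEs) (workAnchor-erase Rv unanchored-Rv))

  toLeftEnd-visits : Writes toLeftEnd WritesVisited
  toLeftEnd-visits = writes-weaken toLeftEnd {NavWrites} {WritesVisited} (λ a b p → proj₁ p) toLeftEnd-writes
  sweep-visits : ∀ p u d → (∀ a → v (u a) ≡ true) → Writes (sweep p u d mark) WritesVisited
  sweep-visits p u d h = sweep-writes p u d mark WritesVisited h (λ a → refl)

  module CleanRun (N : D.TM) (le : D.TM.extra N ≤ E) where
    open Lift N le workLens
    open ReadOut N le workLens

    cleanWork-run : ∀ L3 H3 R3 q ls hf rf → VisitedRegion (tape L3 H3 R3) → Mirrors (tape L3 H3 R3) (D.config q ls hf rf) →
      All Unanchored L3 → All Unanchored R3 →
      Σ Tape λ x8 → Runs cleanWork (tape L3 H3 R3) tt x8 × WorkShape (D.readBits N (hf ∷ rf)) (WorkTrack.contents x8) × v (hd x8) ≡ true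
    cleanWork-run L3 H3 R3 q ls hf rf g (pl , ph , pr) mL3 mR3 = afterAnchorSet g4 mL3
      where
      H4 : Cell
      H4 = mark (setAnchor true H3)
      R4 : List Cell
      R4 = padᵇ R3
      g4 : VisitedRegion (tape L3 H4 R4)
      g4 = move-visited ● H4 (tape L3 H3 R3) refl g
      r1 : Runs setAnchorHere (tape L3 H3 R3) tt (tape L3 H4 R4)
      r1 = act-run (λ _ → tt) (λ c → mark (setAnchor true c)) ● _
      mR4 : All Unanchored (padᵇ (padᵇ R3))
      mR4 = all-padᵇ refl (all-padᵇ refl mR3)
      prY : PaddedTrack (map w (padᵇ (padᵇ R3))) rf
      prY = padded-padᵇ (padᵇ R3) rf (padded-padᵇ R3 rf pr)
      afterAnchorSet : VisitedRegion (tape L3 H4 R4) → All Unanchored L3 →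
        Σ Tape λ x8 → Runs cleanWork (tape L3 H3 R3) tt x8 × WorkShape (D.readBits N (hf ∷ rf)) (WorkTrack.contents x8) × v (hd x8) ≡ true
      afterAnchorSet g′@(region visitedL blankL visitedR blankR refl eqR allVisitedL allBlankL allVisitedR allBlankR) mLL
        with toLeftEnd-run g′ refl
      ... | c , Z , e , r2 with split-output (hf ∷ rf) (proj₁ prY) (mark (mark H4) ∷ padᵇ R4) (cong₂ _∷_ ph (proj₂ prY))
      ...   | ds , es , eY , wds , allB , nb = afterSkip g7
        where
        cs6 : List Cell
        cs6 = map mark visitedL ʳ++ []
        mLv : All Unanchored visitedL
        mLv = ++⁻ˡ visitedL mLL
        L6 : List Cell
        L6 = map eraseWork cs6 ʳ++ (visitedBlank ∷ tailᵇ blankL)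
        r3 : Runs eraseToAnchor (tape (visitedBlank ∷ tailᵇ blankL) c Z) tt (tape L6 (mark (mark H4)) (padᵇ R4))
        r3 = sweep-right-run′ notAnchor eraseWork mark (visitedBlank ∷ tailᵇ blankL) c Z cs6 (mark H4 ∷ R4)
               (trans (sym e) (sym (ʳ++-++ (map mark visitedL)))) (ʳ++⁺ (map⁺ (all-not m mLv)) []) refl
        L7 : List Cell
        L7 = map mark ds ʳ++ L6
        r4 : Runs skipWorkBits (tape L6 (mark (mark H4)) (padᵇ R4)) tt (tape L7 (mark (headᵇ es)) (padᵇ (tailᵇ es)))
        r4 = sweep-right-run′ isWorkBit mark mark L6 (mark (mark H4)) (padᵇ R4) ds es eY allB nb
        g5 = run-visited toLeftEnd toLeftEnd-visits r2 g′
        g6 = run-visited eraseToAnchor (sweep-visits notAnchor eraseWork ▸ (λ a → refl)) r3 g5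
        g7 = run-visited skipWorkBits (sweep-visits isWorkBit mark ▸ (λ a → refl)) r4 g6
        afterSkip : VisitedRegion (tape L7 (mark (headᵇ es)) (padᵇ (tailᵇ es))) →
          Σ Tape λ x8 → Runs cleanWork (tape (visitedL ++ blankL) H3 R3) tt x8 × WorkShape (D.readBits N (hf ∷ rf)) (WorkTrack.contents x8) × v (hd x8) ≡ true
        afterSkip (region Lv7 Lb7 Rv7 Rb7 eL7 eR7 aLv7 aLb7 aRv7 aRb7) with cleaned-work H4 (padᵇ R4) ds es Rv7 Rb7 (D.readBits N (hf ∷ rf)) refl mR4 eY wds eR7
        ... | j , ecrux = x8 , seq-run′ r1 (seq-run′ r2 (seq-run′ r3 (seq-run′ r4 r5))) , shape , refl
          where
          x8 : Tape
          x8 = tape (map eraseWork (mark (headᵇ es) ∷ Rv7) ʳ++ L7) (mark (headᵇ Rb7)) (padᵇ (tailᵇ Rb7))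
          r5 : Runs eraseRest (tape L7 (mark (headᵇ es)) (padᵇ (tailᵇ es))) tt x8
          r5 = subst (λ R → Runs eraseRest (tape L7 (mark (headᵇ es)) R) tt x8) (sym eR7)
                 (sweep-right-run isVisited eraseWork mark (mark (headᵇ es) ∷ Rv7) Rb7 L7 (refl ∷ aRv7) (blank-unvisited (headᵇ-blank aRb7)))
          Erased : List Cell
          Erased = map eraseWork (mark (headᵇ es) ∷ Rv7)
          D0 : List Cell
          D0 = visitedBlank ∷ tailᵇ blankL
          RPl : List Cell
          RPl = padᵇ (tailᵇ Rb7)
          n1 = length D0
          n2 = length cs6
          n3 = length RPl
          eD0 : map workAnchor D0 ≡ replicate n1 noWork
          eD0 = cong (noWork ∷_) (workAnchor-blank (tailᵇ blankL) (all-tailᵇ allBlankL))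
          eC : map workAnchor (map eraseWork cs6) ≡ replicate n2 noWork
          eC = workAnchor-erase cs6 (ʳ++⁺ (map⁺ mLv) [])
          eRP : workAnchor (mark (headᵇ Rb7)) ∷ map workAnchor RPl ≡ replicate (suc n3) noWork
          eRP = cong₂ _∷_ (cong (λ z → workAnchor (mark z)) (headᵇ-blank aRb7)) (workAnchor-blank RPl (all-padᵇ refl (all-tailᵇ aRb7)))
          out = D.readBits N (hf ∷ rf)
          open ≡-Reasoning
          shape : WorkShape out (WorkTrack.contents x8)
          shape = n1 + n2 , j + suc n3 , (begin
            map workAnchor (Erased ʳ++ L7) ʳ++ (workAnchor (mark (headᵇ Rb7)) ∷ map workAnchor RPl)
              ≡⟨ cong (_ʳ++ (workAnchor (mark (headᵇ Rb7)) ∷ map workAnchor RPl)) (map-ʳ++ workAnchor Erased {L7}) ⟩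
            (map workAnchor Erased ʳ++ map workAnchor L7) ʳ++ (workAnchor (mark (headᵇ Rb7)) ∷ map workAnchor RPl)
              ≡⟨ ʳ++-ʳ++ (map workAnchor Erased) ⟩
            map workAnchor L7 ʳ++ (map workAnchor Erased ++ (workAnchor (mark (headᵇ Rb7)) ∷ map workAnchor RPl))
              ≡⟨ cong (_ʳ++ (map workAnchor Erased ++ (workAnchor (mark (headᵇ Rb7)) ∷ map workAnchor RPl))) (map-ʳ++ workAnchor (map mark ds) {L6}) ⟩
            (map workAnchor (map mark ds) ʳ++ map workAnchor L6) ʳ++ (map workAnchor Erased ++ (workAnchor (mark (headᵇ Rb7)) ∷ map workAnchor RPl))
              ≡⟨ ʳ++-ʳ++ (map workAnchor (map mark ds)) ⟩
            map workAnchor L6 ʳ++ (map workAnchor (map mark ds) ++ (map workAnchor Erased ++ (workAnchor (mark (headᵇ Rb7)) ∷ map workAnchor RPl)))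
              ≡⟨ cong (_ʳ++ (map workAnchor (map mark ds) ++ (map workAnchor Erased ++ (workAnchor (mark (headᵇ Rb7)) ∷ map workAnchor RPl)))) (map-ʳ++ workAnchor (map eraseWork cs6) {D0}) ⟩
            (map workAnchor (map eraseWork cs6) ʳ++ map workAnchor D0) ʳ++ (map workAnchor (map mark ds) ++ (map workAnchor Erased ++ (workAnchor (mark (headᵇ Rb7)) ∷ map workAnchor RPl)))
              ≡⟨ ʳ++-ʳ++ (map workAnchor (map eraseWork cs6)) ⟩
            map workAnchor D0 ʳ++ (map workAnchor (map eraseWork cs6) ++ (map workAnchor (map mark ds) ++ (map workAnchor Erased ++ (workAnchor (mark (headᵇ Rb7)) ∷ map workAnchor RPl))))
              ≡⟨ cong₂ (λ a b → a ʳ++ (b ++ (map workAnchor (map mark ds) ++ (map workAnchor Erased ++ (workAnchor (mark (headᵇ Rb7)) ∷ map workAnchor RPl))))) eD0 eC ⟩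
            replicate n1 noWork ʳ++ (replicate n2 noWork ++ (map workAnchor (map mark ds) ++ (map workAnchor Erased ++ (workAnchor (mark (headᵇ Rb7)) ∷ map workAnchor RPl))))
              ≡⟨ replicate-ʳ++ n1 noWork _ ⟩
            replicate n1 noWork ++ (replicate n2 noWork ++ (map workAnchor (map mark ds) ++ (map workAnchor Erased ++ (workAnchor (mark (headᵇ Rb7)) ∷ map workAnchor RPl))))
              ≡⟨ cong (λ z → replicate n1 noWork ++ (replicate n2 noWork ++ z)) (sym (++-assoc (map workAnchor (map mark ds)) (map workAnchor Erased) _)) ⟩
            replicate n1 noWork ++ (replicate n2 noWork ++ ((map workAnchor (map mark ds) ++ map workAnchor Erased) ++ (workAnchor (mark (headᵇ Rb7)) ∷ map workAnchor RPl)))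
              ≡⟨ cong₂ (λ a b → replicate n1 noWork ++ (replicate n2 noWork ++ (a ++ b))) ecrux eRP ⟩
            replicate n1 noWork ++ (replicate n2 noWork ++ ((workContents out ++ replicate j noWork) ++ replicate (suc n3) noWork))
              ≡⟨ cong (λ z → replicate n1 noWork ++ (replicate n2 noWork ++ z)) (trans (++-assoc (workContents out) (replicate j noWork) _) (cong (workContents out ++_) (replicate-++ j (suc n3) noWork))) ⟩
            replicate n1 noWork ++ (replicate n2 noWork ++ (workContents out ++ replicate (j + suc n3) noWork))
              ≡⟨ sym (++-assoc (replicate n1 noWork) (replicate n2 noWork) _) ⟩
            (replicate n1 noWork ++ replicate n2 noWork) ++ (workContents out ++ replicate (j + suc n3) noWork)
              ≡⟨ cong (_++ (workContents out ++ replicate (j + suc n3) noWork)) (replicate-++ n1 n2 noWork) ⟩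
            replicate (n1 + n2) noWork ++ (workContents out ++ replicate (j + suc n3) noWork) ∎)

map-just⁻ : ∀ {A B : Set} (f : A → B) (mx : Maybe A) y → Maybe.map f mx ≡ just y → Σ A λ x → (mx ≡ just x) × (f x ≡ y)
map-just⁻ f (just x) y refl = x , refl , refl
map-just⁻ f nothing y ()

module Application (E : ℕ) where
  open Cells E
  open Lifting E
  open Layouts E
  open Cleaning E

  module Apply (N : D.TM) (le : D.TM.extra N ≤ E) where
    open Lift N le workLens
    open ReadOut N le workLens
    open CleanRun N le

    clearAnchor : Cell → Cell
    clearAnchor c = mark (setAnchor false c)

    runLifted : Machine ⊤
    runLifted = act (λ _ → tt) clearAnchor ● ⟫ lifted

    apply : Machine ⊤
    apply = toAnchor ⟫ runLifted ⟫ cleanWork ⟫ toAnchor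

    initial-state : ∀ acc → D.Config.state (D.initial N acc) ≡ zero
    initial-state []      = refl
    initial-state (b ∷ u) = refl

    mirrors-initial : ∀ acc L H R a k → map w L ≡ replicate a zero → w H ∷ map w R ≡ map bitFin acc ++ replicate k zero →
      Mirrors (tape L H (padᵇ R)) (D.initial N acc)
    mirrors-initial []      L H R a (suc k) eL eR = (a , eL) , ∷-injectiveˡ eR , padded-padᵇ R [] (k , ∷-injectiveʳ eR)
    mirrors-initial []      L H R a zero    eL ()
    mirrors-initial (b ∷ u) L H R a k eL eR =
      (a , eL) , trans (∷-injectiveˡ eR) (sym (embedSym-bitSym b)) ,
      padded-padᵇ R _ (k , trans (∷-injectiveʳ eR) (cong (_++ replicate k zero) (sym (embed-bits u))))

    record AfterLift (z : List Bool) (c : D.Config N) (x : Tape) : Set where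
      field
        visits     : VisitedRegion x
        mirrors    : Mirrors x c
        io         : IOShape z (IOTrack.contents x)
        scratch    : ScratchClear (ScratchTrack.contents x)
        unanchored : All Unanchored (lefts x) × m (hd x) ≡ false × All Unanchored (rights x)

    lifted-io : Writes lifted (λ a b → t b ≡ t a)
    lifted-io q a = proj₁ (proj₂ (lifted-writes q a))

    lifted-anchor : Writes lifted (λ a b → m b ≡ m a)
    lifted-anchor q a = proj₁ (proj₂ (proj₂ (lifted-writes q a)))

    lifted-scratch : Writes lifted (λ a b → w2 b ≡ w2 a)
    lifted-scratch q a = proj₂ (proj₂ (proj₂ (lifted-writes q a)))

    runLifted-run : ∀ {z acc k c} t → AnchoredLayout z acc t → D.runFor N k (D.initial N acc) ≡ just c →
      Reaches runLifted t tt (AfterLift z c)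
    runLifted-run {z} {acc} {k} {c} (tape L H R) al@(l , _) runs with anchored-tracks al
    ... | (a , wL) , (k′ , wR) , mL , mR
      with lift-run k (D.initial N acc) c (tape L (clearAnchor H) (padᵇ R)) runs (mirrors-initial acc L (clearAnchor H) R a k′ wL wR)
    ...   | x′@(tape L′ H′ R′) , r , mirrors = x′ , seq-run′ cleared r′ , record
      { visits     = run-visited lifted (λ q a → proj₁ (lifted-writes q a)) r′ (move-visited ● _ (tape L H R) refl (visitedRegion l))
      ; mirrors    = mirrors
      ; io         = IOTrack.padding-transport (padded-closed ioBlank _) (IOTrack.run-padding lifted lifted-io r′)
                       (IOTrack.padding-transport (padded-closed ioBlank _) (IOTrack.move-padding ● (clearAnchor H) (tape L H R) refl) (ioShape l))
      ; scratch    = ScratchTrack.padding-transport (padded-closed zero _) (ScratchTrack.run-padding lifted lifted-scratch r′)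
                       (ScratchTrack.padding-transport (padded-closed zero _) (ScratchTrack.move-padding ● (clearAnchor H) (tape L H R) refl) (scratchClear l))
      ; unanchored = contents-all⁻ m false L′ H′ R′ (padded-[]-all false _
                       (AnchorTrack.padding-transport (padded-closed false []) (AnchorTrack.run-padding lifted lifted-anchor r′)
                         (all-padded-[] false _ (contents-all⁺ m false L (clearAnchor H) (padᵇ R) mL refl (all-padᵇ refl mR)))))
      }
      where
      cleared : Runs (act (λ _ → tt) clearAnchor ●) (tape L H R) tt (tape L (clearAnchor H) (padᵇ R))
      cleared = act-run (λ _ → tt) clearAnchor ● (tape L H R)
      r′ : Runs lifted (tape L (clearAnchor H) (padᵇ R)) tt x′
      r′ = subst (λ q → Run lifted q _ tt x′) (initial-state acc) r

    cleanWork-io : Writes cleanWork (λ a b → t b ≡ t a)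
    cleanWork-io = writes-weaken cleanWork {WorkWrites} (λ a b p → proj₁ (proj₂ p)) cleanWork-writes

    cleanWork-scratch : Writes cleanWork (λ a b → w2 b ≡ w2 a)
    cleanWork-scratch = writes-weaken cleanWork {WorkWrites} (λ a b p → proj₂ (proj₂ p)) cleanWork-writes

    cleanWork-layout : ∀ {z c} x → AfterLift z c x → Reaches cleanWork x tt (Layout z (D.output N c))
    cleanWork-layout {c = D.config q ls hf rf} (tape L H R) after
      with cleanWork-run L H R q ls hf rf (AfterLift.visits after) (AfterLift.mirrors after)
             (proj₁ (AfterLift.unanchored after)) (proj₂ (proj₂ (AfterLift.unanchored after)))
    ... | x′ , r , sWM , vH = x′ , r , layout
      (run-visited cleanWork (writes-weaken cleanWork {WorkWrites} (λ a b p → proj₁ p) cleanWork-writes) r (AfterLift.visits after)) vH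
      (IOTrack.padding-transport (padded-closed ioBlank _) (IOTrack.run-padding cleanWork cleanWork-io r) (AfterLift.io after)) sWM
      (ScratchTrack.padding-transport (padded-closed zero _) (ScratchTrack.run-padding cleanWork cleanWork-scratch r) (AfterLift.scratch after))

    apply-run : ∀ z acc acc′ x → Layout z acc x → D.Computes N acc acc′ → Reaches apply x tt (AnchoredLayout z acc′)
    apply-run z acc acc′ x l (k , computes) with map-just⁻ (D.output N) (D.runFor N k (D.initial N acc)) acc′ computes
    ... | c , runs , refl =
      reaches-⟫ (toAnchor-layout l) λ anchored →
      reaches-⟫ (runLifted-run {k = k} _ anchored runs) λ after →
      reaches-⟫ (cleanWork-layout _ after) λ cleaned →
      toAnchor-layout cleaned

module Comparison (E : ℕ) where
  open Cells E
  open Lifting E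
  open Layouts E
  open Cleaning E

  eqBitFin : Bool → Fin K → Bool
  eqBitFin false (suc zero)       = true
  eqBitFin true  (suc (suc zero)) = true
  eqBitFin _     _                = false

  compare : (Cell → Fin K) → List Bool → Machine Bool
  compare g [] = act (λ c → not (isBitFin (g c))) mark ●
  compare g (b ∷ ks) = branch (act (λ c → eqBitFin b (g c)) mark ▸) (compare g ks) (act (λ _ → false) mark ●)

  compare-writes : ∀ g ks → Writes (compare g ks) NavWrites
  compare-writes g [] = act-writes (λ c → not (isBitFin (g c))) mark ● NavWrites nav-mark
  compare-writes g (b ∷ ks) = branch-writes (act (λ c → eqBitFin b (g c)) mark ▸) (compare g ks) (act (λ _ → false) mark ●) NavWrites
    (act-writes (λ c → eqBitFin b (g c)) mark ▸ NavWrites nav-mark) (compare-writes g ks) (act-writes (λ _ → false) mark ● NavWrites nav-mark)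

  CompareResult : (Cell → Fin K) → List Bool → List Bool → Tape → Set
  CompareResult g ks u x = Σ Bool λ r → Σ Tape λ x′ → Runs (compare g ks) x r x′ × (r ≡ true → u ≡ ks) × (u ≡ ks → r ≡ true) × v (hd x′) ≡ true

  eqBitFin-nonbit : ∀ k x → isBitFin x ≡ false → eqBitFin k x ≡ false
  eqBitFin-nonbit false zero e = refl
  eqBitFin-nonbit true zero e = refl
  eqBitFin-nonbit false (suc zero) ()
  eqBitFin-nonbit true (suc zero) e = refl
  eqBitFin-nonbit false (suc (suc zero)) e = refl
  eqBitFin-nonbit true (suc (suc zero)) ()
  eqBitFin-nonbit false (suc (suc (suc x))) e = refl
  eqBitFin-nonbit true (suc (suc (suc x))) e = refl

  compare-run : ∀ g ks u L cs ys → map g cs ≡ map bitFin u → isBitFin (g (headᵇ ys)) ≡ false →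
    CompareResult g ks u (tape L (headᵇ (cs ++ ys)) (tailᵇ (cs ++ ys)))
  compare-run g [] [] L [] ys ec nb = true , _ ,
    subst (λ z → Runs (compare g []) (tape L (headᵇ ys) (tailᵇ ys)) z (move ● (mark (headᵇ ys)) (tape L (headᵇ ys) (tailᵇ ys)))) (cong not nb) (act-run _ mark ● _) ,
    (λ _ → refl) , (λ _ → refl) , refl
  compare-run g [] (b ∷ u) L [] ys () nb
  compare-run g ks [] L (c ∷ cs) ys () nb
  compare-run g [] (b ∷ u) L (c ∷ cs) ys ec nb = false , _ ,
    subst (λ z → Runs (compare g []) (tape L c (cs ++ ys)) z (move ● (mark c) (tape L c (cs ++ ys))))
      (cong not (trans (cong isBitFin (∷-injectiveˡ ec)) (isBitFin-bitFin b))) (act-run _ mark ● _) ,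
    (λ ()) , (λ ()) , refl
  compare-run g (k ∷ ks) [] L [] ys ec nb = false , _ ,
    branch-false′ (subst (λ z → Runs (act (λ c → eqBitFin k (g c)) mark ▸) (tape L (headᵇ ys) (tailᵇ ys)) z _) (eqBitFin-nonbit k (g (headᵇ ys)) nb) (act-run _ mark ▸ _))
      (act-run (λ _ → false) mark ● _) , (λ ()) , (λ ()) , refl
  compare-run g (k ∷ ks) (b ∷ u) L [] ys () nb
  compare-run g (k ∷ ks) (b ∷ u) L (c ∷ cs) ys ec nb = compare-bit k b refl refl (∷-injectiveˡ ec)
    where
    x0 : Tape
    x0 = tape L c (cs ++ ys)
    testFirst = act (λ c → eqBitFin k (g c)) mark ▸
    first-bit : ∀ r → eqBitFin k (g c) ≡ r → Runs testFirst x0 r (move ▸ (mark c) x0)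
    first-bit r e = subst (λ z → Runs testFirst x0 z (move ▸ (mark c) x0)) e (act-run _ mark ▸ x0)
    rest : CompareResult g ks u (tape (mark c ∷ L) (headᵇ (cs ++ ys)) (tailᵇ (cs ++ ys)))
    rest = compare-run g ks u (mark c ∷ L) cs ys (∷-injectiveʳ ec) nb
    yes : k ≡ b → eqBitFin k (g c) ≡ true → CompareResult g (k ∷ ks) (b ∷ u) x0
    yes refl e with rest
    ... | r , x′ , run , p1 , p2 , pv = r , x′ , branch-true′ (first-bit true e) run , (λ er → cong (k ∷_) (p1 er)) , (λ eu → p2 (∷-injectiveʳ eu)) , pv
    no : (k ≡ b → ⊥) → eqBitFin k (g c) ≡ false → CompareResult g (k ∷ ks) (b ∷ u) x0
    no ne e = false , _ , branch-false′ (first-bit false e) (act-run (λ _ → false) mark ● _) , (λ ()) , (λ eu → ⊥-elim (ne (sym (∷-injectiveˡ eu)))) , refl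
    compare-bit : ∀ k2 b2 → k2 ≡ k → b2 ≡ b → g c ≡ bitFin b2 → CompareResult g (k ∷ ks) (b ∷ u) x0
    compare-bit false false refl refl e = yes refl (cong (eqBitFin false) e)
    compare-bit true true refl refl e = yes refl (cong (eqBitFin true) e)
    compare-bit false true refl refl e = no (λ ()) (cong (eqBitFin false) e)
    compare-bit true false refl refl e = no (λ ()) (cong (eqBitFin true) e)

module Emitting (E : ℕ) where
  open Cells E
  open Lifting E
  open Layouts E
  open Cleaning E
  open Application E

  locate-mark : ∀ {X : Set} (f : Cell → X) (mk : X → Bool) (x₀ : X) → mk x₀ ≡ false → ∀ D₀ c Z →
    All (λ d → f d ≡ x₀) D₀ → ∀ pre y post → mk y ≡ true → AllFalse mk pre → AllFalse mk post →
    map f D₀ ʳ++ (f c ∷ map f Z) ≡ pre ++ y ∷ post →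
    Σ (List Cell) λ cs → Σ Cell λ c′ → Σ (List Cell) λ ds → (c ∷ Z ≡ cs ++ c′ ∷ ds) × All (λ d → mk (f d) ≡ false) cs ×
      (f c′ ≡ y) × (replicate (length D₀) x₀ ++ map f cs ≡ pre) × (map f ds ≡ post)
  locate-mark f mk x₀ m₀ D₀ c Z aD pre y post my fpre fpost e with first-true (λ d → mk (f d)) (c ∷ Z)
  ... | inj₁ (cs , c′ , ds , eZ , fcs , mc)
    with split-unique mk (replicate (length D₀) x₀ ++ map f cs) (f c′) (map f ds) pre y post mc fpre fpost e′
    where
    D₀-blank : map f D₀ ≡ replicate (length D₀) x₀
    D₀-blank = trans (map-cong-local aD) (map-const D₀)
      where
      map-const : ∀ (xs : List Cell) → map (λ _ → x₀) xs ≡ replicate (length xs) x₀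
      map-const []       = refl
      map-const (_ ∷ xs) = cong (x₀ ∷_) (map-const xs)
    e′ : (replicate (length D₀) x₀ ++ map f cs) ++ f c′ ∷ map f ds ≡ pre ++ y ∷ post
    e′ = trans (++-assoc (replicate (length D₀) x₀) (map f cs) _)
         (trans (sym (replicate-ʳ++ (length D₀) x₀ _))
         (trans (cong₂ _ʳ++_ (sym D₀-blank) (trans (sym (map-++ f cs (c′ ∷ ds))) (cong (map f) (sym eZ)))) e))
  ...   | e₁ , e₂ , e₃ = cs , c′ , ds , eZ , fcs , e₂ , e₁ , e₃
  locate-mark f mk x₀ m₀ D₀ c Z aD pre y post my fpre fpost e | inj₂ fz =
    ⊥-elim (marked pre (subst (AllFalse mk) e (ʳ++⁺ (map⁺ (All.map (λ p → trans (cong mk p) m₀) aD)) (map⁺ fz))))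
    where
    marked : ∀ pre → AllFalse mk (pre ++ y ∷ post) → ⊥
    marked []      (p ∷ _)  = true≢false my p
    marked (_ ∷ P) (_ ∷ ps) = marked P ps

  isSep : IOSym → Bool
  isSep ioSep = true
  isSep _     = false

  notSep : Cell → Bool
  notSep c = not (isSep (t c))

  toLeftEnd-io : Writes toLeftEnd (λ a b → t b ≡ t a)
  toLeftEnd-io = writes-weaken toLeftEnd {NavWrites} (λ a b p → proj₁ (proj₂ p)) toLeftEnd-writes

  leftEnd-io-blank : ∀ Lb → All Blank Lb → All (λ d → t d ≡ ioBlank) (visitedBlank ∷ tailᵇ Lb)
  leftEnd-io-blank Lb a = refl ∷ All.map (λ { refl → refl }) (all-tailᵇ a)

  no-sep-before : ∀ a ys → AllFalse isSep (replicate a ioBlank ++ map ioBit ys)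
  no-sep-before (suc a) ys       = refl ∷ no-sep-before a ys
  no-sep-before zero    []       = []
  no-sep-before zero    (y ∷ ys) = refl ∷ no-sep-before zero ys

  io-shape-split : ∀ a b ys (x : List IOSym) → x ≡ replicate a ioBlank ++ ((map ioBit ys ++ ioSep ∷ []) ++ replicate b ioBlank) →
    x ≡ (replicate a ioBlank ++ map ioBit ys) ++ ioSep ∷ replicate b ioBlank
  io-shape-split a b ys x e =
    trans e (trans (cong (replicate a ioBlank ++_) (++-assoc (map ioBit ys) (ioSep ∷ []) (replicate b ioBlank)))
                   (sym (++-assoc (replicate a ioBlank) (map ioBit ys) _)))

  toSep : Machine ⊤
  toSep = toLeftEnd ⟫ sweep notSep mark ▸ mark

  toSep-writes : Writes toSep NavWrites
  toSep-writes = seq-writes toLeftEnd (sweep notSep mark ▸ mark) NavWrites toLeftEnd-writes (sweep-writes notSep mark ▸ mark NavWrites nav-mark nav-mark)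

  record AtSep (z : List Bool) (x : Tape) : Set where
    field
      onSep : t (hd x) ≡ ioSep
      left  : Σ ℕ λ a → map t (lefts x) ≡ map ioBit z ʳ++ replicate a ioBlank
      right : Σ ℕ λ b → map t (rights x) ≡ replicate b ioBlank

  toSep-run : ∀ z L H R (g : VisitedRegion (tape L H R)) → v H ≡ true → IOShape z (IOTrack.contents (tape L H R)) →
    Reaches toSep (tape L H R) tt (AtSep z)
  toSep-run z L H R g vH shape with toLeftEnd-run g vH
  ... | c , Z , e , toLeft
    with IOTrack.padding-transport (padded-closed ioBlank _) (IOTrack.run-padding toLeftEnd toLeftEnd-io toLeft) shape
  ...   | a , b , eSh
    with locate-mark t isSep ioBlank refl (visitedBlank ∷ tailᵇ (VisitedRegion.blankL g)) c Z (leftEnd-io-blank (VisitedRegion.blankL g) (VisitedRegion.allBlankL g))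
           (replicate a ioBlank ++ map ioBit z) ioSep (replicate b ioBlank) refl
           (no-sep-before a z) (replicate⁺ b refl) (io-shape-split a b z _ eSh)
  ...     | cs , c′ , ds , eZ , fcs , tc′ , epre , eds =
    tape (map mark cs ʳ++ D₀) (mark c′) (padᵇ ds) ,
    seq-run′ toLeft (sweep-right-run′ notSep mark mark D₀ c Z cs (c′ ∷ ds) eZ (all-not (λ d → isSep (t d)) fcs) (cong (λ z → not (isSep z)) tc′)) ,
    record { onSep = tc′ ; left = a , left-io ; right = right-io ds eds }
    where
    Lb = VisitedRegion.blankL g
    D₀ = visitedBlank ∷ tailᵇ Lb
    D₀-blank : map t D₀ ≡ replicate (length D₀) ioBlank
    D₀-blank = ʳ++[]-replicate (map t D₀) (length D₀) ioBlank (trans (cong (_ʳ++ []) (map-cong-local (leftEnd-io-blank Lb (VisitedRegion.allBlankL g)))) (map-const-ʳ++ D₀))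
      where
      map-const-ʳ++ : ∀ (xs : List Cell) → map (λ _ → ioBlank) xs ʳ++ [] ≡ replicate (length xs) ioBlank
      map-const-ʳ++ xs = trans (cong (_ʳ++ []) (map-const xs)) (trans (replicate-ʳ++ (length xs) ioBlank []) (++-identityʳ _))
        where
        map-const : ∀ (xs : List Cell) → map (λ _ → ioBlank) xs ≡ replicate (length xs) ioBlank
        map-const []       = refl
        map-const (_ ∷ xs) = cong (ioBlank ∷_) (map-const xs)
    left-io : map t (map mark cs ʳ++ D₀) ≡ map ioBit z ʳ++ replicate a ioBlank
    left-io = begin
      map t (map mark cs ʳ++ D₀)                           ≡⟨ map-ʳ++ t (map mark cs) {D₀} ⟩
      map t (map mark cs) ʳ++ map t D₀                     ≡⟨ cong₂ _ʳ++_ (sym (map-∘ cs)) D₀-blank ⟩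
      map t cs ʳ++ replicate (length D₀) ioBlank           ≡⟨ cong (map t cs ʳ++_) (trans (replicate-ʳ++ (length D₀) ioBlank []) (++-identityʳ _)) ⟨
      map t cs ʳ++ (replicate (length D₀) ioBlank ʳ++ [])  ≡⟨ ++-ʳ++ (replicate (length D₀) ioBlank) ⟨
      (replicate (length D₀) ioBlank ++ map t cs) ʳ++ []   ≡⟨ cong (_ʳ++ []) epre ⟩
      (replicate a ioBlank ++ map ioBit z) ʳ++ []          ≡⟨ ++-ʳ++ (replicate a ioBlank) ⟩
      map ioBit z ʳ++ (replicate a ioBlank ʳ++ [])         ≡⟨ cong (map ioBit z ʳ++_) (trans (replicate-ʳ++ a ioBlank []) (++-identityʳ _)) ⟩
      map ioBit z ʳ++ replicate a ioBlank                  ∎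
      where open ≡-Reasoning
    right-io : ∀ ds → map t ds ≡ replicate b ioBlank → Σ ℕ λ b′ → map t (padᵇ ds) ≡ replicate b′ ioBlank
    right-io []       _  = 1 , refl
    right-io (d ∷ ds) e′ = b , e′

  emit : Bool → Machine ⊤
  emit b = toSep ⟫ act (λ _ → tt) (λ c → mark (setIO (ioBit b) c)) ▸ ⟫ act (λ _ → tt) (λ c → mark (setIO ioSep c)) ●

  emit-run : ∀ b z L H R → VisitedRegion (tape L H R) → v H ≡ true → IOShape z (IOTrack.contents (tape L H R)) →
    Reaches (emit b) (tape L H R) tt (λ x → IOShape (z ++ b ∷ []) (IOTrack.contents x) × v (hd x) ≡ true)
  emit-run b z L H R g vH shape = reaches-⟫ (toSep-run z L H R g vH shape) λ {x} atSep → write-bit x atSep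
    where
    write-bit : ∀ x → AtSep z x → Reaches (act (λ _ → tt) (λ c → mark (setIO (ioBit b) c)) ▸ ⟫ act (λ _ → tt) (λ c → mark (setIO ioSep c)) ●) x tt
                                        (λ x → IOShape (z ++ b ∷ []) (IOTrack.contents x) × v (hd x) ≡ true)
    write-bit (tape L′ H′ R′) record { left = a , eL ; right = b′ , eR } =
      _ , seq-run′ (act-run (λ _ → tt) (λ c → mark (setIO (ioBit b) c)) ▸ _) (act-run (λ _ → tt) (λ c → mark (setIO ioSep c)) ● _) ,
      (a , proj₁ (right-blank b′ R′ eR) , (begin
        map t L′ ʳ++ (ioBit b ∷ ioSep ∷ map t (padᵇ (tailᵇ R′)))
          ≡⟨ cong₂ (λ l r → l ʳ++ (ioBit b ∷ ioSep ∷ r)) eL (proj₂ (right-blank b′ R′ eR)) ⟩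
        (map ioBit z ʳ++ replicate a ioBlank) ʳ++ (ioBit b ∷ ioSep ∷ replicate (proj₁ (right-blank b′ R′ eR)) ioBlank)
          ≡⟨ ʳ++-ʳ++ (map ioBit z) ⟩
        replicate a ioBlank ʳ++ (map ioBit z ++ ioBit b ∷ ioSep ∷ replicate (proj₁ (right-blank b′ R′ eR)) ioBlank)
          ≡⟨ replicate-ʳ++ a ioBlank _ ⟩
        replicate a ioBlank ++ (map ioBit z ++ ioBit b ∷ ioSep ∷ replicate (proj₁ (right-blank b′ R′ eR)) ioBlank)
          ≡⟨ cong (λ w → replicate a ioBlank ++ w) (snoc-sep (map ioBit z)) ⟩
        replicate a ioBlank ++ ((map ioBit z ++ ioBit b ∷ []) ++ ioSep ∷ []) ++ replicate (proj₁ (right-blank b′ R′ eR)) ioBlank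
          ≡⟨ cong (λ w → replicate a ioBlank ++ (w ++ ioSep ∷ []) ++ replicate (proj₁ (right-blank b′ R′ eR)) ioBlank) (map-++ ioBit z (b ∷ [])) ⟨
        replicate a ioBlank ++ (map ioBit (z ++ b ∷ []) ++ ioSep ∷ []) ++ replicate (proj₁ (right-blank b′ R′ eR)) ioBlank ∎)) ,
      refl
      where
      open ≡-Reasoning
      right-blank : ∀ n R′ → map t R′ ≡ replicate n ioBlank → Σ ℕ λ n′ → map t (padᵇ (tailᵇ R′)) ≡ replicate n′ ioBlank
      right-blank n       []           _ = 1 , refl
      right-blank n       (_ ∷ [])     _ = 1 , refl
      right-blank (suc n) (_ ∷ _ ∷ _)  e = n , ∷-injectiveʳ e
      snoc-sep : ∀ (xs : List IOSym) {ys} → xs ++ ioBit b ∷ ioSep ∷ ys ≡ ((xs ++ ioBit b ∷ []) ++ ioSep ∷ []) ++ ys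
      snoc-sep []       = refl
      snoc-sep (x ∷ xs) = cong (x ∷_) (snoc-sep xs)

  eraseScratch : Cell → Cell
  eraseScratch c = mark (setScratch zero c)

  wipeScratch : Machine ⊤
  wipeScratch = toLeftEnd ⟫ sweep isVisited eraseScratch ▸ mark

  wipeScratch-run : ∀ L H R → VisitedRegion (tape L H R) → v H ≡ true →
    Reaches wipeScratch (tape L H R) tt (λ x → ScratchClear (ScratchTrack.contents x) × v (hd x) ≡ true)
  wipeScratch-run L H R g@(region Lv Lb Rv Rb refl refl aLv aLb aRv aRb) vH with toLeftEnd-run g vH
  ... | c , Z , e , toLeft = _ , seq-run′ toLeft wipe ,
    all-padded-[] zero _ (contents-all⁺ w2 zero L′ (mark (headᵇ Rb)) (padᵇ (tailᵇ Rb)) wiped (cong (λ z → w2 (mark z)) (headᵇ-blank aRb))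
      (all-padᵇ refl (all-tailᵇ (All.map (λ { refl → refl }) aRb)))) , refl
    where
    D₀ = visitedBlank ∷ tailᵇ Lb
    cs = map mark Lv ʳ++ (mark H ∷ Rv)
    L′ = map eraseScratch cs ʳ++ D₀
    wipe : Runs (sweep isVisited eraseScratch ▸ mark) (tape D₀ c Z) tt (tape L′ (mark (headᵇ Rb)) (padᵇ (tailᵇ Rb)))
    wipe = sweep-right-run′ isVisited eraseScratch mark D₀ c Z cs Rb (trans (sym e) (sym (ʳ++-++ (map mark Lv))))
             (ʳ++⁺ (map⁺ (All.map (λ _ → refl) aLv)) (refl ∷ aRv)) (blank-unvisited (headᵇ-blank aRb))
    erased : ∀ (xs : List Cell) → All (λ d → w2 (eraseScratch d) ≡ zero) xs
    erased []       = []
    erased (_ ∷ xs) = refl ∷ erased xs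
    wiped : All (λ d → w2 d ≡ zero) L′
    wiped = ʳ++⁺ (map⁺ (erased cs)) (refl ∷ All.map (λ { refl → refl }) (all-tailᵇ aLb))

module Popping (E : ℕ) where
  open Cells E
  open Lifting E
  open Layouts E
  open Cleaning E
  open Application E
  open Emitting E

  toLastBit : Machine ⊤
  toLastBit = toSep ⟫ act (λ _ → tt) (λ c → mark (setIO ioBlank c)) ◂

  ToLastBitResult : List Bool → Tape → Set
  ToLastBitResult z x = Σ (List Cell) λ LL → Σ (List Cell) λ RR → Runs toLastBit x tt (tape (tailᵇ LL) (headᵇ LL) RR) ×
    (Σ ℕ λ a → map t LL ≡ map ioBit z ʳ++ replicate a ioBlank) × (Σ ℕ λ b → map t RR ≡ replicate b ioBlank)

  toLastBit-run : ∀ z L H R (g : VisitedRegion (tape L H R)) → v H ≡ true → IOShape z (IOTrack.contents (tape L H R)) → ToLastBitResult z (tape L H R)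
  toLastBit-run z L H R g vH shape with toSep-run z L H R g vH shape
  ... | tape L′ H′ R′ , toSep′ , record { left = left ; right = b , eR } =
    L′ , mark (setIO ioBlank H′) ∷ R′ , seq-run′ toSep′ (act-run (λ _ → tt) (λ c → mark (setIO ioBlank c)) ◂ _) , left , suc b , cong (ioBlank ∷_) eR

  IOWrites : Cell → Cell → Set
  IOWrites a b = (v b ≡ true) × (workAnchor b ≡ workAnchor a) × (w2 b ≡ w2 a)

  nav⇒io : ∀ a b → NavWrites a b → IOWrites a b
  nav⇒io a b (p1 , p2 , p3 , p4 , p5) = p1 , cong₂ _,_ p4 p3 , p5

  io-setIO : ∀ x a → IOWrites a (mark (setIO x a))
  io-setIO x a = refl , refl , refl
  io-mark : ∀ a → IOWrites a (mark a)
  io-mark a = refl , refl , refl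

  toLastBit-writes : Writes toLastBit IOWrites
  toLastBit-writes = seq-writes toSep _ IOWrites (writes-weaken toSep {NavWrites} nav⇒io toSep-writes)
    (act-writes (λ _ → tt) (λ c → mark (setIO ioBlank c)) ◂ IOWrites (io-setIO ioBlank))

  act-io-writes : ∀ {X : Set} (f : Cell → X) u m → (∀ a → IOWrites a (u a)) → Writes (act f u m) IOWrites
  act-io-writes f u m h = act-writes f u m IOWrites h

  io-run-layout : ∀ {X} (A : Machine X) → Writes A IOWrites → ∀ {q x e x′} → Run A q x e x′ → ∀ {acc} →
    VisitedRegion x → WorkShape acc (WorkTrack.contents x) → ScratchClear (ScratchTrack.contents x) → VisitedRegion x′ × WorkShape acc (WorkTrack.contents x′) × ScratchClear (ScratchTrack.contents x′)
  io-run-layout A aw r g s1 s2 = run-visited A (writes-weaken A {IOWrites} (λ a b p → proj₁ p) aw) r g ,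
    WorkTrack.padding-transport (padded-closed noWork _) (WorkTrack.run-padding A (writes-weaken A {IOWrites} (λ a b p → proj₁ (proj₂ p)) aw) r) s1 ,
    ScratchTrack.padding-transport (padded-closed zero _) (ScratchTrack.run-padding A (writes-weaken A {IOWrites} (λ a b p → proj₂ (proj₂ p)) aw) r) s2

  isIOBit : Cell → Bool
  isIOBit c with t c
  ... | ioBit _ = true
  ... | _ = false

  ioBitOf : Cell → Bool
  ioBitOf c with t c
  ... | ioBit b = b
  ... | _ = false

  markSep : Cell → Cell
  markSep c = mark (setIO ioSep c)

  return : Bool → Machine Bool
  return b = act (λ _ → b) mark ●

  ioBits-snoc-ʳ++ : ∀ zs b (Y : List IOSym) → map ioBit (zs ++ b ∷ []) ʳ++ Y ≡ ioBit b ∷ (map ioBit zs ʳ++ Y)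
  ioBits-snoc-ʳ++ zs b Y = trans (cong (_ʳ++ Y) (map-++ ioBit zs (b ∷ []))) (++-ʳ++ (map ioBit zs))

  io-shape-reverse : ∀ zs a (LL′ : List Cell) (Y : List IOSym) b2 → map t LL′ ≡ map ioBit zs ʳ++ replicate a ioBlank → Y ≡ replicate b2 ioBlank →
    IOShape zs (map t LL′ ʳ++ (ioSep ∷ Y))
  io-shape-reverse zs a LL′ Y b2 e eY = a , b2 , (trans (cong (_ʳ++ (ioSep ∷ Y)) e) (trans (ʳ++-ʳ++ (map ioBit zs))
    (trans (replicate-ʳ++ a ioBlank _) (cong (replicate a ioBlank ++_) (trans (cong (λ z → map ioBit zs ++ ioSep ∷ z) eY) (sym (++-assoc (map ioBit zs) (ioSep ∷ []) (replicate b2 ioBlank))))))))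

  blank-io-padᵇ² : ∀ (RR : List Cell) b → map t RR ≡ replicate b ioBlank → Σ ℕ λ b2 → map t (padᵇ (padᵇ RR)) ≡ replicate b2 ioBlank
  blank-io-padᵇ² [] b e = 1 , refl
  blank-io-padᵇ² (r ∷ RR) b e = b , e

  isIOBit-bit : ∀ c b → t c ≡ ioBit b → isIOBit c ≡ true
  isIOBit-bit c b e rewrite e = refl
  isIOBit-blank : ∀ c → t c ≡ ioBlank → isIOBit c ≡ false
  isIOBit-blank c e rewrite e = refl
  ioBitOf-bit : ∀ c b → t c ≡ ioBit b → ioBitOf c ≡ b
  ioBitOf-bit c b e rewrite e = refl

  return-layout : ∀ {z acc L H R} → AnchoredLayout z acc (tape L H R) → AnchoredLayout z acc (tape L (mark H) (padᵇ R))
  return-layout {L = L} {H} {R} (l , mH) =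
    nav-layout (act (λ _ → true) mark ●) (act-writes (λ _ → true) mark ● NavWrites nav-mark) (act-run (λ _ → true) mark ● (tape L H R)) l refl , mH

  module ApplyAndContinue (N : D.TM) (le : D.TM.extra N ≤ E) where
    open Apply N le

    apply-continue-run : ∀ zs acc acc′ x → Layout zs acc x → D.Computes N acc acc′ →
      Reaches (apply ⟫ return true) x true (AnchoredLayout zs acc′)
    apply-continue-run zs acc acc′ x l computes with apply-run zs acc acc′ x l computes
    ... | tape L H R , applied , al = _ , seq-run′ applied (act-run (λ _ → true) mark ● _) , return-layout al

  testBit : Machine Bool
  testBit = act isIOBit mark ●

  readIOBit : Machine Bool
  readIOBit = act ioBitOf markSep ●

  -- Popping the last bit of the io word moves the separator onto it.
  PopBitResult : List Bool → Bool → List Bool → Tape → Set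
  PopBitResult zs b acc x = Σ Tape λ x₁ → Σ Tape λ x₂ → Σ Tape λ x₃ → Runs toLastBit x tt x₁ ×
    Runs testBit x₁ true x₂ × Runs readIOBit x₂ b x₃ × Layout zs acc x₃

  pop-bit-run : ∀ zs b acc x → Layout (zs ++ b ∷ []) acc x → PopBitResult zs b acc x
  pop-bit-run zs b acc (tape L H R) (layout g vH sh sWM sZ) with toLastBit-run (zs ++ b ∷ []) L H R g vH sh
  ... | LL , RR , toLast , (a , eLL) , (bb , eRR) with LL | trans eLL (ioBits-snoc-ʳ++ zs b (replicate a ioBlank))
  ...   | l₁ ∷ LL′ | e = x₁ , x₂ , x₃ , toLast ,
    subst (λ z → Runs testBit x₁ z x₂) (isIOBit-bit l₁ b (∷-injectiveˡ e)) (act-run isIOBit mark ● x₁) ,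
    subst (λ z → Runs readIOBit x₂ z x₃) (ioBitOf-bit l₁ b (∷-injectiveˡ e)) (act-run ioBitOf markSep ● x₂) ,
    layout (proj₁ t₃) refl (io-shape-reverse zs a LL′ _ (proj₁ (blank-io-padᵇ² RR bb eRR)) (∷-injectiveʳ e) (proj₂ (blank-io-padᵇ² RR bb eRR)))
      (proj₁ (proj₂ t₃)) (proj₂ (proj₂ t₃))
    where
    x₁ = tape LL′ l₁ RR
    x₂ = tape LL′ (mark l₁) (padᵇ RR)
    x₃ = tape LL′ (markSep (mark l₁)) (padᵇ (padᵇ RR))
    t₁ = io-run-layout toLastBit toLastBit-writes toLast g sWM sZ
    t₂ = io-run-layout testBit (act-io-writes isIOBit mark ● io-mark) (act-run isIOBit mark ● x₁) (proj₁ t₁) (proj₁ (proj₂ t₁)) (proj₂ (proj₂ t₁))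
    t₃ = io-run-layout readIOBit (act-io-writes ioBitOf markSep ● (io-setIO ioSep)) (act-run ioBitOf markSep ● x₂)
           (proj₁ t₂) (proj₁ (proj₂ t₂)) (proj₂ (proj₂ t₂))
  ...   | [] | ()

  stopEncoding : Machine Bool
  stopEncoding = act (λ _ → false) markSep ●

  PopEndResult : List Bool → Tape → Set
  PopEndResult acc x = Σ Tape λ x₁ → Σ Tape λ x₂ → Σ Tape λ x₃ → Runs toLastBit x tt x₁ ×
    Runs testBit x₁ false x₂ × Runs stopEncoding x₂ false x₃ × Layout [] acc x₃

  pop-end-run : ∀ acc x → Layout [] acc x → PopEndResult acc x
  pop-end-run acc (tape L H R) (layout g vH sh sWM sZ) with toLastBit-run [] L H R g vH sh
  ... | LL , RR , toLast , (a , eLL) , (bb , eRR) = x₁ , x₂ , x₃ , toLast ,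
    subst (λ z → Runs testBit x₁ z x₂) (isIOBit-blank (headᵇ LL) (head-blank LL a eLL)) (act-run isIOBit mark ● x₁) ,
    act-run (λ _ → false) markSep ● x₂ ,
    layout (proj₁ t₃) refl
      (io-shape-reverse [] (proj₁ (tail-blank LL a eLL)) (tailᵇ LL) _ (proj₁ (blank-io-padᵇ² RR bb eRR)) (proj₂ (tail-blank LL a eLL))
        (proj₂ (blank-io-padᵇ² RR bb eRR)))
      (proj₁ (proj₂ t₃)) (proj₂ (proj₂ t₃))
    where
    x₁ = tape (tailᵇ LL) (headᵇ LL) RR
    x₂ = tape (tailᵇ LL) (mark (headᵇ LL)) (padᵇ RR)
    x₃ = tape (tailᵇ LL) (markSep (mark (headᵇ LL))) (padᵇ (padᵇ RR))
    head-blank : ∀ LL a → map t LL ≡ replicate a ioBlank → t (headᵇ LL) ≡ ioBlank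
    head-blank []       a       e = refl
    head-blank (l ∷ LL) (suc a) e = ∷-injectiveˡ e
    tail-blank : ∀ LL a → map t LL ≡ replicate a ioBlank → Σ ℕ λ a′ → map t (tailᵇ LL) ≡ replicate a′ ioBlank
    tail-blank []       a       e = 0 , refl
    tail-blank (l ∷ LL) (suc a) e = a , ∷-injectiveʳ e
    t₁ = io-run-layout toLastBit toLastBit-writes toLast g sWM sZ
    t₂ = io-run-layout testBit (act-io-writes isIOBit mark ● io-mark) (act-run isIOBit mark ● x₁) (proj₁ t₁) (proj₁ (proj₂ t₁)) (proj₂ (proj₂ t₁))
    t₃ = io-run-layout stopEncoding (act-io-writes (λ _ → false) markSep ● (io-setIO ioSep)) (act-run (λ _ → false) markSep ● x₂)
           (proj₁ t₂) (proj₁ (proj₂ t₂)) (proj₂ (proj₂ t₂))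

  module Encoding (N₀ N₁ : D.TM) (le₀ : D.TM.extra N₀ ≤ E) (le₁ : D.TM.extra N₁ ≤ E) (ρ : List Bool → List Bool)
                  (N₀-computes : ∀ u → D.Computes N₀ (ρ u) (ρ (false ∷ u)))
                  (N₁-computes : ∀ u → D.Computes N₁ (ρ u) (ρ (true ∷ u))) where
    module A₀ = ApplyAndContinue N₀ le₀
    module A₁ = ApplyAndContinue N₁ le₁

    encodeStep : Machine Bool
    encodeStep = toLastBit ⟫ branch testBit (branch readIOBit (Apply.apply N₁ le₁ ⟫ return true) (Apply.apply N₀ le₀ ⟫ return true)) stopEncoding

    encodeStep-run : ∀ zs b u x → Layout (zs ++ b ∷ []) (ρ u) x → Reaches encodeStep x true (AnchoredLayout zs (ρ (b ∷ u)))
    encodeStep-run zs true u x l = case pop-bit-run zs true (ρ u) x l of λ where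
      (_ , _ , x₃ , toLast , isBit , readBit , l₃) → case A₁.apply-continue-run zs (ρ u) (ρ (true ∷ u)) x₃ l₃ (N₁-computes u) of λ where
        (x₄ , applied , l₄) → x₄ , seq-run′ toLast (branch-true′ isBit (branch-true′ readBit applied)) , l₄
    encodeStep-run zs false u x l = case pop-bit-run zs false (ρ u) x l of λ where
      (_ , _ , x₃ , toLast , isBit , readBit , l₃) → case A₀.apply-continue-run zs (ρ u) (ρ (false ∷ u)) x₃ l₃ (N₀-computes u) of λ where
        (x₄ , applied , l₄) → x₄ , seq-run′ toLast (branch-true′ isBit (branch-false′ readBit applied)) , l₄

    encode-run : ∀ rz u x → Layout (rz ʳ++ []) (ρ u) x → Reaches (loop encodeStep) x tt (Layout [] (ρ (rz ʳ++ u)))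
    encode-run [] u x l = case pop-end-run (ρ u) x l of λ where
      (_ , _ , x₃ , toLast , notBit , stop , l₃) → x₃ , loop-exit encodeStep (seq-run′ toLast (branch-false′ notBit stop)) , l₃
    encode-run (b ∷ rz) u x l = case encodeStep-run (rz ʳ++ []) b u x (subst (λ z → Layout z (ρ u) x) (sym (ʳ++-++ rz {[]} {b ∷ []})) l) of λ where
      (x₁ , step₁ , (l₁ , _)) → case encode-run rz (b ∷ u) x₁ l₁ of λ where
        (x₂ , rest , l₂) → x₂ , loop-again encodeStep step₁ rest , l₂

module Copying (E : ℕ) where
  open Cells E
  open Lifting E
  open Layouts E
  open Cleaning E
  open Application E
  open Emitting E
  open Popping E

  copyCell : Cell → Cell
  copyCell c = mark (setScratch (w c) c)

  copyWork : Machine ⊤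
  copyWork = sweep isWorkBit copyCell ▸ mark ⟫ sweep notAnchor mark ◂ mark

  ScratchWrites : Cell → Cell → Set
  ScratchWrites a b = (v b ≡ true) × (t b ≡ t a) × (workAnchor b ≡ workAnchor a)

  copyWork-writes : Writes copyWork ScratchWrites
  copyWork-writes = seq-writes (sweep isWorkBit copyCell ▸ mark) _ ScratchWrites (sweep-writes isWorkBit copyCell ▸ mark ScratchWrites (λ a → refl , refl , refl) (λ a → refl , refl , refl))
                  (sweep-writes notAnchor mark ◂ mark ScratchWrites (λ a → refl , refl , refl) (λ a → refl , refl , refl))

  work-zeros-not-bit : ∀ k (Y : List Cell) → map w Y ≡ replicate k zero → isBitFin (w (headᵇ Y)) ≡ false
  work-zeros-not-bit k [] e = refl
  work-zeros-not-bit (suc k) (y ∷ Y) e = cong isBitFin (∷-injectiveˡ e)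

  work-bits : ∀ (cs : List Cell) acc → map w cs ≡ map bitFin acc → All (λ c → isWorkBit c ≡ true) cs
  work-bits [] [] e = []
  work-bits (c ∷ cs) (b ∷ acc) e = trans (cong isBitFin (∷-injectiveˡ e)) (isBitFin-bitFin b) ∷ work-bits cs acc (∷-injectiveʳ e)

  scratch-copyCell : ∀ (cs : List Cell) → map w2 (map copyCell cs) ≡ map w cs
  scratch-copyCell [] = refl
  scratch-copyCell (c ∷ cs) = cong (w c ∷_) (scratch-copyCell cs)

  module CopyRun (N : D.TM) (le : D.TM.extra N ≤ E) where
    open Lift N le scratchLens

    scratch-zeros : ∀ (xs : List Cell) → All (λ c → w2 c ≡ zero) xs → Σ ℕ λ k → map w2 xs ≡ replicate k zero
    scratch-zeros xs a = all-≡-replicate zero (map w2 xs) (map⁺ a)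

    scratch-padded : ∀ (xs : List Cell) → All (λ c → w2 c ≡ zero) xs → PaddedTrack (map w2 xs) []
    scratch-padded xs a = scratch-zeros xs a

    CopyResult : List Bool → Tape → Set
    CopyResult acc x = Σ Tape λ x3 → Runs copyWork x tt x3 × Mirrors x3 (D.initial N acc)

    copyWork-run : ∀ ys acc L1 H1 R1 → AnchoredLayout ys acc (tape L1 H1 R1) → CopyResult acc (tape L1 H1 R1)
    copyWork-run ys acc L1 H1 R1 inv with anchored-tracks inv | contents-all⁻ w2 zero L1 H1 R1 (padded-[]-all zero _ (scratchClear (proj₁ inv)))
    ... | (a , wL) , (kk , wR) , mL1 , mR1 | zL , zH , zR with map-++-split w (H1 ∷ R1) (map bitFin acc) (replicate kk zero) wR
    ...   | cs , ys′ , eHR , ecs , eys = copy-prefix cs acc eHR ecs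
      where
      nb : isBitFin (w (headᵇ ys′)) ≡ false
      nb = work-zeros-not-bit kk ys′ eys
      copy-prefix : ∀ cs acc → H1 ∷ R1 ≡ cs ++ ys′ → map w cs ≡ map bitFin acc → CopyResult acc (tape L1 H1 R1)
      copy-prefix [] acc eHR ecs with map-bitFin-[] acc ecs
      ... | refl = x3 , seq-run (sweep isWorkBit copyCell ▸ mark) _ r1 r2 , scratch-padded L1 zL , zH ,
                   padded-padᵇ (padᵇ R1) [] (padded-padᵇ R1 [] (scratch-padded R1 zR))
        where
        r1 : Runs (sweep isWorkBit copyCell ▸ mark) (tape L1 H1 R1) tt (tape L1 (mark (headᵇ ys′)) (padᵇ (tailᵇ ys′)))
        r1 = subst (λ z → Runs (sweep isWorkBit copyCell ▸ mark) (tape L1 (headᵇ z) (tailᵇ z)) tt (tape L1 (mark (headᵇ ys′)) (padᵇ (tailᵇ ys′))))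
               (sym eHR) (sweep-right-run isWorkBit copyCell mark [] ys′ L1 [] nb)
        x2′ = tape L1 (mark H1) (padᵇ R1)
        e2 : tape L1 (mark (headᵇ ys′)) (padᵇ (tailᵇ ys′)) ≡ x2′
        e2 = cong (λ z → tape L1 (mark (headᵇ z)) (padᵇ (tailᵇ z))) (sym eHR)
        x3 = tape L1 (mark (mark H1)) (padᵇ (padᵇ R1))
        r2 : Runs (sweep notAnchor mark ◂ mark) (tape L1 (mark (headᵇ ys′)) (padᵇ (tailᵇ ys′))) tt x3
        r2 = subst (λ z → Runs (sweep notAnchor mark ◂ mark) z tt x3) (sym e2)
               (sweep-left-run notAnchor mark mark [] (mark H1 ∷ L1) (padᵇ R1) [] (cong not (proj₂ inv)))
      copy-prefix (c1 ∷ cs2) [] eHR ()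
      copy-prefix (c1 ∷ cs2) (b1 ∷ acc2) eHR ecs = x3 , seq-run (sweep isWorkBit copyCell ▸ mark) _ r1 r2 , scratch-padded L1 zL ,
           trans (∷-injectiveˡ ecs) (sym (embedSym-bitSym b1)) , wr3
        where
        eR1 : R1 ≡ cs2 ++ ys′
        eR1 = ∷-injectiveʳ eHR
        eH1 : H1 ≡ c1
        eH1 = ∷-injectiveˡ eHR
        aR : All (λ c → m c ≡ false) (cs2 ++ ys′)
        aR = subst (All (λ c → m c ≡ false)) eR1 mR1
        zR′ : All (λ c → w2 c ≡ zero) (cs2 ++ ys′)
        zR′ = subst (All (λ c → w2 c ≡ zero)) eR1 zR
        h2 = mark (headᵇ ys′)
        Lx = map copyCell cs2 ʳ++ (copyCell c1 ∷ L1)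
        x2 = tape Lx h2 (padᵇ (tailᵇ ys′))
        r1 : Runs (sweep isWorkBit copyCell ▸ mark) (tape L1 H1 R1) tt x2
        r1 = subst (λ z → Runs (sweep isWorkBit copyCell ▸ mark) (tape L1 (headᵇ z) (tailᵇ z)) tt x2)
               (sym eHR) (sweep-right-run isWorkBit copyCell mark (c1 ∷ cs2) ys′ L1 (work-bits (c1 ∷ cs2) (b1 ∷ acc2) ecs) nb)
        csL = h2 ∷ (map copyCell cs2 ʳ++ [])
        ysL = copyCell c1 ∷ L1
        x3 = tape L1 (mark (copyCell c1)) (padᵇ (map mark csL ʳ++ padᵇ (tailᵇ ys′)))
        eqL : (map copyCell cs2 ʳ++ []) ++ ysL ≡ Lx
        eqL = ʳ++-++ (map copyCell cs2)
        mys : All (λ c → m c ≡ false) ys′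
        mys = ++⁻ʳ cs2 aR
        allNotL : All (λ c → notAnchor c ≡ true) csL
        allNotL = not-false (all-headᵇ refl mys) ∷ ʳ++⁺ (map⁺ (all-not m (++⁻ˡ cs2 aR))) []
        r2 : Runs (sweep notAnchor mark ◂ mark) x2 tt x3
        r2 = subst (λ z → Runs (sweep notAnchor mark ◂ mark) (tape z h2 (padᵇ (tailᵇ ys′))) tt x3) eqL
               (sweep-left-run notAnchor mark mark csL ysL (padᵇ (tailᵇ ys′)) allNotL (cong not (trans (cong m (sym eH1)) (proj₂ inv))))
        zys : All (λ c → w2 c ≡ zero) ys′
        zys = ++⁻ʳ cs2 zR′
        wr3 : PaddedTrack (map w2 (padᵇ (map mark csL ʳ++ padᵇ (tailᵇ ys′)))) (map (D.bitSym N) acc2)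
        wr3 = suc j , (begin
            map w2 (padᵇ (map mark csL ʳ++ X))
              ≡⟨ cong (map w2) (padᵇ-ʳ++∷ M2 (mark h2) X) ⟩
            map w2 (M2 ʳ++ (mark h2 ∷ X))
              ≡⟨ map-ʳ++ w2 M2 {(mark h2 ∷ X)} ⟩
            map w2 M2 ʳ++ (w2 h2 ∷ map w2 X)
              ≡⟨ cong (_ʳ++ (w2 h2 ∷ map w2 X)) (trans (sym (map-∘ {g = w2} {f = mark} (map copyCell cs2 ʳ++ []))) (trans (map-ʳ++ w2 (map copyCell cs2) {[]}) (cong (_ʳ++ []) (scratch-copyCell cs2)))) ⟩
            (map w cs2 ʳ++ []) ʳ++ (w2 h2 ∷ map w2 X)
              ≡⟨ ʳ++-ʳ++ (map w cs2) {[]} {_} ⟩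
            map w cs2 ++ (w2 h2 ∷ map w2 X)
              ≡⟨ cong₂ (λ p q → p ++ q) (∷-injectiveʳ ecs) (cong₂ _∷_ (all-headᵇ refl zys) ej) ⟩
            map bitFin acc2 ++ replicate (suc j) zero
              ≡⟨ cong (_++ replicate (suc j) zero) (sym (embed-bits acc2)) ⟩
            map embedSym (map (D.bitSym N) acc2) ++ replicate (suc j) zero ∎)
          where
          open ≡-Reasoning
          X = padᵇ (tailᵇ ys′)
          M2 = map mark (map copyCell cs2 ʳ++ [])
          j = proj₁ (scratch-zeros X (all-padᵇ refl (all-tailᵇ zys)))
          ej = proj₂ (scratch-zeros X (all-padᵇ refl (all-tailᵇ zys)))

tagHead : List Bool → List Bool
tagHead (true ∷ _) = []
tagHead _ = false ∷ []

dropHead : List Bool → List Bool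
dropHead [] = []
dropHead (_ ∷ u) = u

module Decoding (E : ℕ) where
  open Cells E
  open Lifting E
  open Layouts E
  open Cleaning E
  open Application E
  open Emitting E
  open Popping E
  open Copying E
  open Comparison E

  compare-work-run : ∀ k0 ys acc L H R → AnchoredLayout ys acc (tape L H R) → CompareResult w k0 acc (tape L H R)
  compare-work-run k0 ys acc L H R inv with anchored-tracks inv
  ... | _ , (kk , wR) , _ with map-++-split w (H ∷ R) (map bitFin acc) (replicate kk zero) wR
  ...   | cs , ys′ , eHR , ecs , eys = subst (λ z → CompareResult w k0 acc (tape L (headᵇ z) (tailᵇ z))) (sym eHR) (compare-run w k0 acc L cs ys′ ecs (work-zeros-not-bit kk ys′ eys))

  scratch-run-layout : ∀ {X} (A : Machine X) → Writes A ScratchWrites → ∀ {q x e x′ z acc} → Run A q x e x′ →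
    VisitedRegion x → IOShape z (IOTrack.contents x) → WorkShape acc (WorkTrack.contents x) → VisitedRegion x′ × IOShape z (IOTrack.contents x′) × WorkShape acc (WorkTrack.contents x′)
  scratch-run-layout A aw r g sT sWM = run-visited A (writes-weaken A {ScratchWrites} (λ a b p → proj₁ p) aw) r g ,
    IOTrack.padding-transport (padded-closed ioBlank _) (IOTrack.run-padding A (writes-weaken A {ScratchWrites} (λ a b p → proj₁ (proj₂ p)) aw) r) sT ,
    WorkTrack.padding-transport (padded-closed noWork _) (WorkTrack.run-padding A (writes-weaken A {ScratchWrites} (λ a b p → proj₂ (proj₂ p)) aw) r) sWM

  wipeScratch-writes : Writes wipeScratch ScratchWrites
  wipeScratch-writes = seq-writes toLeftEnd _ ScratchWrites (writes-weaken toLeftEnd {NavWrites} (λ a b p → proj₁ p , proj₁ (proj₂ p) , cong₂ _,_ (proj₁ (proj₂ (proj₂ (proj₂ p)))) (proj₁ (proj₂ (proj₂ p)))) toLeftEnd-writes)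
             (sweep-writes isVisited eraseScratch ▸ mark ScratchWrites (λ a → refl , refl , refl) (λ a → refl , refl , refl))

  compare-scratch-writes : ∀ g k → Writes (compare g k) ScratchWrites
  compare-scratch-writes g k = writes-weaken (compare g k) {NavWrites} (λ a b p → proj₁ p , proj₁ (proj₂ p) , cong₂ _,_ (proj₁ (proj₂ (proj₂ (proj₂ p)))) (proj₁ (proj₂ (proj₂ p)))) (compare-writes g k)

  emit-writes : ∀ b → Writes (emit b) IOWrites
  emit-writes b = seq-writes toSep _ IOWrites (writes-weaken toSep {NavWrites} nav⇒io toSep-writes)
    ((seq-writes (act (λ _ → tt) (λ c → mark (setIO (ioBit b) c)) ▸) _ IOWrites (act-writes (λ _ → tt) (λ c → mark (setIO (ioBit b) c)) ▸ IOWrites (io-setIO (ioBit b)))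
      (act-writes (λ _ → tt) (λ c → mark (setIO ioSep c)) ● IOWrites (io-setIO ioSep))))

  -- tagHead is simulated on a copy of the work word in the scratch track, so that the work word
  -- survives for dropHead.
  module Decode (Nₕ Nₜ : D.TM) (leₕ : D.TM.extra Nₕ ≤ E) (leₜ : D.TM.extra Nₜ ≤ E)
                (ρ : List Bool → List Bool) (ρ-injective : Injective _≡_ _≡_ ρ)
                (Nₕ-computes : ∀ u → D.Computes Nₕ (ρ u) (ρ (tagHead u)))
                (Nₜ-computes : ∀ u → D.Computes Nₜ (ρ u) (ρ (dropHead u))) where
    module Head = Lift Nₕ leₕ scratchLens
    open ReadOut Nₕ leₕ scratchLens using (split-output)
    open CopyRun Nₕ leₕ using (copyWork-run)
    open ApplyAndContinue Nₜ leₜ using (apply-continue-run)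
    open Apply Nₜ leₜ using (apply)

    emitHead : Machine ⊤
    emitHead = branch (compare w2 (ρ [])) (wipeScratch ⟫ emit true) (wipeScratch ⟫ emit false)

    decodeBody : Machine Bool
    decodeBody = toAnchor ⟫ copyWork ⟫ Head.lifted ⟫ emitHead ⟫ apply ⟫ return true

    decodeStep : Machine Bool
    decodeStep = branch (compare w (ρ [])) (return false) decodeBody

    record ScratchMirrors (z acc : List Bool) (c : D.Config Nₕ) (x : Tape) : Set where
      field
        visits  : VisitedRegion x
        io      : IOShape z (IOTrack.contents x)
        work    : WorkShape acc (WorkTrack.contents x)
        mirrors : Head.Mirrors x c

    scratchMirrors-run : ∀ {X} (A : Machine X) → Writes A ScratchWrites → ∀ {q x e x′ z acc c} → Run A q x e x′ →
      VisitedRegion x → IOShape z (IOTrack.contents x) → WorkShape acc (WorkTrack.contents x) → Head.Mirrors x′ c →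
      ScratchMirrors z acc c x′
    scratchMirrors-run A aw r g sT sWM mirrors with scratch-run-layout A aw r g sT sWM
    ... | g′ , sT′ , sWM′ = record { visits = g′ ; io = sT′ ; work = sWM′ ; mirrors = mirrors }

    copy-run : ∀ z acc x → AnchoredLayout z acc x → Reaches copyWork x tt (ScratchMirrors z acc (D.initial Nₕ acc))
    copy-run z acc (tape L H R) al@(l , _) with copyWork-run z acc L H R al
    ... | x′ , copied , mirrors =
      x′ , copied , scratchMirrors-run copyWork copyWork-writes copied (visitedRegion l) (ioShape l) (workShape l) mirrors

    lifted-scratch-writes : Writes Head.lifted ScratchWrites
    lifted-scratch-writes q a with Head.lifted-writes q a
    ... | vb , tb , mb , wb = vb , tb , cong₂ _,_ wb mb

    initial-state : ∀ acc → D.Config.state (D.initial Nₕ acc) ≡ zero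
    initial-state []      = refl
    initial-state (b ∷ u) = refl

    head-run : ∀ z acc k c x → D.runFor Nₕ k (D.initial Nₕ acc) ≡ just c → ScratchMirrors z acc (D.initial Nₕ acc) x →
      Reaches Head.lifted x tt (ScratchMirrors z acc c)
    head-run z acc k c x runs sm with Head.lift-run k (D.initial Nₕ acc) c x runs (ScratchMirrors.mirrors sm)
    ... | x′ , lifted₀ , mirrors = x′ , lifted , scratchMirrors-run Head.lifted lifted-scratch-writes lifted
      (ScratchMirrors.visits sm) (ScratchMirrors.io sm) (ScratchMirrors.work sm) mirrors
      where
      lifted : Runs Head.lifted x tt x′
      lifted = subst (λ q → Run Head.lifted q x tt x′) (initial-state acc) lifted₀

    tagHead-compare : ∀ {x x′} b u r → ∀ out → out ≡ ρ (tagHead (b ∷ u)) →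
      Runs (compare w2 (ρ [])) x r x′ → (r ≡ true → out ≡ ρ []) → (out ≡ ρ [] → r ≡ true) → r ≡ b
    tagHead-compare true  u true  out e _ _ _       = refl
    tagHead-compare true  u false out e _ _ complete with complete e
    ... | ()
    tagHead-compare false u false out e _ _ _       = refl
    tagHead-compare false u true  out e _ sound _  with ρ-injective (trans (sym e) (sound refl))
    ... | ()

    branch-on : ∀ {x x₁ x₂} b {r} → r ≡ b → Runs (compare w2 (ρ [])) x r x₁ →
      Runs (wipeScratch ⟫ emit b) x₁ tt x₂ → Runs emitHead x tt x₂
    branch-on true  refl = branch-true′
    branch-on false refl = branch-false′

    emitHead-run : ∀ z b u c x → D.output Nₕ c ≡ ρ (tagHead (b ∷ u)) → ScratchMirrors z (ρ (b ∷ u)) c x →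
      Reaches emitHead x tt (Layout (z ++ b ∷ []) (ρ (b ∷ u)))
    emitHead-run z b u (D.config _ _ hf rf) (tape L H R) out sm =
      case ScratchMirrors.mirrors sm of λ where
      (_ , ph , (k , pr)) → case split-output (hf ∷ rf) k (H ∷ R) (cong₂ _∷_ ph pr) of λ where
       (ds , es , eY , wds , _ , nb) →
        case subst (λ z → CompareResult w2 (ρ []) (D.readBits Nₕ (hf ∷ rf)) (tape L (headᵇ z) (tailᵇ z))) (sym eY)
                   (compare-run w2 (ρ []) (D.readBits Nₕ (hf ∷ rf)) L ds es wds nb) of λ where
        (r , x₁@(tape L₁ H₁ R₁) , compared , sound , complete , v₁) →
         case scratch-run-layout (compare w2 (ρ [])) (compare-scratch-writes w2 (ρ [])) compared
                (ScratchMirrors.visits sm) (ScratchMirrors.io sm) (ScratchMirrors.work sm) of λ where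
         (g₁ , sT₁ , sWM₁) → case wipeScratch-run L₁ H₁ R₁ g₁ v₁ of λ where
          (x₂@(tape L₂ H₂ R₂) , wiped , clear₂ , v₂) →
           case scratch-run-layout wipeScratch wipeScratch-writes wiped g₁ sT₁ sWM₁ of λ where
           (g₂ , sT₂ , sWM₂) → case emit-run b z L₂ H₂ R₂ g₂ v₂ sT₂ of λ where
            (x₃ , emitted , sT₃ , v₃) → case io-run-layout (emit b) (emit-writes b) emitted g₂ sWM₂ clear₂ of λ where
             (g₃ , sWM₃ , clear₃) →
               x₃ , branch-on b (tagHead-compare b u r _ out compared sound complete) compared (seq-run′ wiped emitted) ,
               layout g₃ v₃ sT₃ sWM₃ clear₃

    body-run : ∀ z b u x → Layout z (ρ (b ∷ u)) x → Reaches decodeBody x true (AnchoredLayout (z ++ b ∷ []) (ρ u))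
    body-run z b u x l with Nₕ-computes (b ∷ u)
    ... | k , computes with map-just⁻ (D.output Nₕ) (D.runFor Nₕ k (D.initial Nₕ (ρ (b ∷ u)))) _ computes
    ...   | c , runs , out =
      reaches-⟫ (toAnchor-layout l) λ anchored →
      reaches-⟫ (copy-run z _ _ anchored) λ copied →
      reaches-⟫ (head-run z _ k c _ runs copied) λ headed →
      reaches-⟫ (emitHead-run z b u c _ out headed) λ emitted →
      apply-continue-run (z ++ b ∷ []) (ρ (b ∷ u)) (ρ u) _ emitted (Nₜ-computes (b ∷ u))

    decode-run : ∀ u z x → AnchoredLayout z (ρ u) x → Reaches (loop decodeStep) x tt (Layout (z ++ u) (ρ []))
    decode-run [] z x@(tape L H R) al@(l , _) = case compare-work-run (ρ []) z (ρ []) L H R al of λ where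
      (true , x₁@(tape L₁ H₁ R₁) , compared , _ , _ , v₁) →
        tape L₁ (mark H₁) (padᵇ R₁) , loop-exit decodeStep (branch-true′ compared (act-run (λ _ → false) mark ● x₁)) ,
        subst (λ z′ → Layout z′ (ρ []) _) (sym (++-identityʳ z))
          (nav-layout (return false) (act-writes (λ _ → false) mark ● NavWrites nav-mark) (act-run (λ _ → false) mark ● x₁)
            (nav-layout (compare w (ρ [])) (compare-writes w (ρ [])) compared l v₁) refl)
      (false , _ , _ , _ , complete , _) → ⊥-elim (case complete refl of λ ())
    decode-run (b ∷ u) z x@(tape L H R) al@(l , _) = case compare-work-run (ρ []) z (ρ (b ∷ u)) L H R al of λ where
      (true , _ , _ , sound , _ , _) → ⊥-elim (case ρ-injective (sound refl) of λ ())
      (false , x₁ , compared , _ , _ , v₁) →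
        case body-run z b u x₁ (nav-layout (compare w (ρ [])) (compare-writes w (ρ [])) compared l v₁) of λ where
        (x₂ , body , l₂) → case decode-run u (z ++ b ∷ []) x₂ l₂ of λ where
          (x₃ , rest , l₃) → x₃ , loop-again decodeStep (branch-false′ compared body) rest , subst (λ z′ → Layout z′ (ρ []) x₃) (++-assoc z (b ∷ []) u) l₃

module Initialisation (E : ℕ) where
  open Cells E
  open Lifting E
  open Layouts E
  open Cleaning E
  open Application E
  open Emitting E
  open Popping E

  writeWork : List Bool → Machine ⊤
  writeWork []       = act (λ _ → tt) mark ●
  writeWork (b ∷ ws) = act (λ _ → tt) (λ c → mark (setWork (bitFin b) c)) ▸ ⟫ writeWork ws

  writtenCells : List Bool → Cell → List Cell → List Cell
  writtenCells []       c R = []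
  writtenCells (b ∷ ws) c R = mark (setWork (bitFin b) c) ∷ writtenCells ws (headᵇ R) (tailᵇ R)

  writtenHead : List Bool → Cell → List Cell → Cell
  writtenHead []       c R = mark c
  writtenHead (b ∷ ws) c R = writtenHead ws (headᵇ R) (tailᵇ R)

  writtenRest : List Bool → Cell → List Cell → List Cell
  writtenRest []       c R = padᵇ R
  writtenRest (b ∷ ws) c R = writtenRest ws (headᵇ R) (tailᵇ R)

  writeWork-run : ∀ ws L c R → Runs (writeWork ws) (tape L c R) tt (tape (writtenCells ws c R ʳ++ L) (writtenHead ws c R) (writtenRest ws c R))
  writeWork-run []       L c R = act-run (λ _ → tt) mark ● (tape L c R)
  writeWork-run (b ∷ ws) L c R = seq-run′ (act-run (λ _ → tt) (λ c → mark (setWork (bitFin b) c)) ▸ (tape L c R))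
                                          (writeWork-run ws (mark (setWork (bitFin b) c) ∷ L) (headᵇ R) (tailᵇ R))

  writeWork-writes : ∀ ws → Writes (writeWork ws) WorkWrites
  writeWork-writes []       = act-writes (λ _ → tt) mark ● WorkWrites work-mark
  writeWork-writes (b ∷ ws) = seq-writes (act (λ _ → tt) (λ c → mark (setWork (bitFin b) c)) ▸) (writeWork ws) WorkWrites
    (act-writes (λ _ → tt) (λ c → mark (setWork (bitFin b) c)) ▸ WorkWrites (λ _ → refl , refl , refl)) (writeWork-writes ws)

  backToAnchor : Machine ⊤
  backToAnchor = sweep notAnchor mark ◂ mark

  initialise : List Bool → Machine ⊤
  initialise k₀ = sweep isIOBit mark ▸ markSep ⟫ setAnchorHere ⟫ writeWork k₀ ⟫ backToAnchor

  writtenCells-work : ∀ ws → map workAnchor (writtenCells ws blankCell []) ≡ map (λ c → bitFin c , false) ws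
  writtenCells-work []       = refl
  writtenCells-work (b ∷ ws) = cong ((bitFin b , false) ∷_) (writtenCells-work ws)

  writtenCells-unanchored : ∀ ws → All (λ c → m c ≡ false) (writtenCells ws blankCell [])
  writtenCells-unanchored []       = []
  writtenCells-unanchored (b ∷ ws) = refl ∷ writtenCells-unanchored ws

  writtenHead-blank : ∀ ws → writtenHead ws blankCell [] ≡ visitedBlank
  writtenHead-blank []       = refl
  writtenHead-blank (b ∷ ws) = writtenHead-blank ws

  writtenRest-blank : ∀ ws → writtenRest ws blankCell [] ≡ blankCell ∷ []
  writtenRest-blank []       = refl
  writtenRest-blank (b ∷ ws) = writtenRest-blank ws

  inputTape : List Bool → Tape
  inputTape []      = tape [] blankCell []
  inputTape (b ∷ w) = tape [] (rawBit b) (map rawBit w)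

  inputCells : List Bool → List Cell
  inputCells x = map mark (map rawBit x) ʳ++ []

  anchorCell : Cell
  anchorCell = cell true ioSep true zero zero

  markInput-run : ∀ x → Runs (sweep isIOBit mark ▸ markSep) (inputTape x) tt (tape (inputCells x) (markSep blankCell) (blankCell ∷ []))
  markInput-run x = subst (λ z → Runs (sweep isIOBit mark ▸ markSep) z tt (tape (inputCells x) (markSep blankCell) (blankCell ∷ [])))
    (input-split x) (sweep-right-run isIOBit mark markSep (map rawBit x) [] [] (raw-bits x) refl)
    where
    input-split : ∀ x → tape [] (headᵇ (map rawBit x ++ [])) (tailᵇ (map rawBit x ++ [])) ≡ inputTape x
    input-split []      = refl
    input-split (b ∷ x) = cong (tape [] (rawBit b)) (++-identityʳ (map rawBit x))
    raw-bits : ∀ x → All (λ c → isIOBit c ≡ true) (map rawBit x)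
    raw-bits []      = []
    raw-bits (b ∷ x) = refl ∷ raw-bits x

  inputCells-work : ∀ x → map workAnchor (inputCells x) ≡ replicate (length x) noWork
  inputCells-work x = trans (map-ʳ++ workAnchor (map mark (map rawBit x)) {[]})
    (trans (cong (_ʳ++ []) (no-work x)) (trans (replicate-ʳ++ (length x) noWork []) (++-identityʳ _)))
    where
    no-work : ∀ x → map workAnchor (map mark (map rawBit x)) ≡ replicate (length x) noWork
    no-work []      = refl
    no-work (b ∷ x) = cong (noWork ∷_) (no-work x)

  inputCells-io : ∀ x → map t (inputCells x) ʳ++ [] ≡ map ioBit x
  inputCells-io x = trans (cong (_ʳ++ []) (map-ʳ++ t (map mark (map rawBit x)) {[]}))
    (trans (ʳ++-ʳ++ (map t (map mark (map rawBit x))) {[]} {[]}) (trans (++-identityʳ _) (io-bits x)))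
    where
    io-bits : ∀ x → map t (map mark (map rawBit x)) ≡ map ioBit x
    io-bits []      = refl
    io-bits (b ∷ x) = cong (ioBit b ∷_) (io-bits x)

  inputCells-visited : ∀ x → All (λ c → v c ≡ true) (inputCells x)
  inputCells-visited x = ʳ++⁺ (visited x) []
    where
    visited : ∀ x → All (λ c → v c ≡ true) (map mark (map rawBit x))
    visited []      = []
    visited (b ∷ x) = refl ∷ visited x

  inputCells-scratch : ∀ x → All (λ c → w2 c ≡ zero) (inputCells x)
  inputCells-scratch x = ʳ++⁺ (clear x) []
    where
    clear : ∀ x → All (λ c → w2 c ≡ zero) (map mark (map rawBit x))
    clear []      = []
    clear (b ∷ x) = refl ∷ clear x

  initialise-run : ∀ x k₀ → Reaches (initialise k₀) (inputTape x) tt (AnchoredLayout x k₀)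
  initialise-run x k₀ = case back-run k₀ of λ where
      (x₄ , back , v₄ , m₄ , sWM) →
        case work-run-layout (writeWork k₀) (writeWork-writes k₀) (writeWork-run k₀ XL anchorCell (blankCell ∷ [])) g₂ sT₂ sZ₂ of λ where
        (g₃ , sT₃ , sZ₃) → case work-run-layout backToAnchor (sweep-writes notAnchor mark ◂ mark WorkWrites work-mark work-mark) back g₃ sT₃ sZ₃ of λ where
          (g₄ , sT₄ , sZ₄) →
            x₄ , seq-run′ (markInput-run x) (seq-run′ (act-run (λ _ → tt) (λ c → mark (setAnchor true c)) ● _)
                   (seq-run′ (writeWork-run k₀ XL anchorCell (blankCell ∷ [])) back)) ,
            layout g₄ v₄ sT₄ sWM sZ₄ , m₄
    where
    XL = inputCells x
    x₂ = tape XL anchorCell (blankCell ∷ [])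
    g₂ : VisitedRegion x₂
    g₂ = region XL [] [] (blankCell ∷ []) (sym (++-identityʳ XL)) refl (inputCells-visited x) [] [] (refl ∷ [])
    sT₂ : IOShape x (IOTrack.contents x₂)
    sT₂ = 0 , 1 , trans (sym (ʳ++-++ (map t XL) {[]} {ioSep ∷ ioBlank ∷ []}))
                        (trans (cong (_++ (ioSep ∷ ioBlank ∷ [])) (inputCells-io x)) (sym (++-assoc (map ioBit x) (ioSep ∷ []) (ioBlank ∷ []))))
    sZ₂ : ScratchClear (ScratchTrack.contents x₂)
    sZ₂ = all-padded-[] zero _ (contents-all⁺ w2 zero XL anchorCell (blankCell ∷ []) (inputCells-scratch x) refl (refl ∷ []))
    afterWrite : List Bool → Tape
    afterWrite k₀ = tape (writtenCells k₀ anchorCell (blankCell ∷ []) ʳ++ XL) (writtenHead k₀ anchorCell (blankCell ∷ []))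
                      (writtenRest k₀ anchorCell (blankCell ∷ []))
    back-run : ∀ k₀ → Σ Tape λ x₄ → Runs backToAnchor (afterWrite k₀) tt x₄ × v (hd x₄) ≡ true × m (hd x₄) ≡ true × WorkShape k₀ (WorkTrack.contents x₄)
    back-run [] = tape XL anchorCell (blankCell ∷ []) ,
      sweep-left-run notAnchor mark mark [] (anchorCell ∷ XL) (blankCell ∷ []) [] refl , refl , refl ,
      (length x , 1 , trans (cong (_ʳ++ ((zero , true) ∷ noWork ∷ [])) (inputCells-work x)) (replicate-ʳ++ (length x) noWork _))
    back-run (b ∷ ws) = tape XL (mark S) (padᵇ (map mark cs ʳ++ FR)) , back , refl , refl ,
      (length x , 2 , trans (cong (_ʳ++ ((bitFin b , true) ∷ map workAnchor (padᵇ (map mark cs ʳ++ FR)))) (inputCells-work x))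
         (trans (replicate-ʳ++ (length x) noWork _) (cong (λ z → replicate (length x) noWork ++ ((bitFin b , true) ∷ z)) rest)))
      where
      S  = mark (setWork (bitFin b) anchorCell)
      W  = writtenCells ws blankCell []
      FR = writtenRest ws blankCell []
      FH = writtenHead ws blankCell []
      cs = FH ∷ (W ʳ++ [])
      back : Runs backToAnchor (afterWrite (b ∷ ws)) tt (tape XL (mark S) (padᵇ (map mark cs ʳ++ FR)))
      back = subst (λ z → Runs backToAnchor (tape z FH FR) tt (tape XL (mark S) (padᵇ (map mark cs ʳ++ FR)))) (ʳ++-++ W)
        (sweep-left-run notAnchor mark mark cs (S ∷ XL) FR (cong notAnchor (writtenHead-blank ws) ∷ ʳ++⁺ (all-not m (writtenCells-unanchored ws)) []) refl)
      open ≡-Reasoning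
      rest : map workAnchor (padᵇ (map mark cs ʳ++ FR)) ≡ map (λ c → bitFin c , false) ws ++ (noWork ∷ noWork ∷ [])
      rest = begin
        map workAnchor (padᵇ (map mark cs ʳ++ FR))
          ≡⟨ cong (map workAnchor) (padᵇ-ʳ++∷ (map mark (W ʳ++ [])) (mark FH) FR) ⟩
        map workAnchor (map mark (W ʳ++ []) ʳ++ (mark FH ∷ FR))
          ≡⟨ map-ʳ++ workAnchor (map mark (W ʳ++ [])) {mark FH ∷ FR} ⟩
        map workAnchor (map mark (W ʳ++ [])) ʳ++ (workAnchor (mark FH) ∷ map workAnchor FR)
          ≡⟨ cong (_ʳ++ (workAnchor (mark FH) ∷ map workAnchor FR)) (trans (sym (map-∘ (W ʳ++ []))) (map-ʳ++ workAnchor W {[]})) ⟩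
        (map workAnchor W ʳ++ []) ʳ++ (workAnchor (mark FH) ∷ map workAnchor FR)
          ≡⟨ ʳ++-ʳ++ (map workAnchor W) {[]} ⟩
        map workAnchor W ++ (workAnchor (mark FH) ∷ map workAnchor FR)
          ≡⟨ cong₂ _++_ (writtenCells-work ws) (cong₂ _∷_ (cong (λ z → workAnchor (mark z)) (writtenHead-blank ws)) (cong (map workAnchor) (writtenRest-blank ws))) ⟩
        map (λ c → bitFin c , false) ws ++ (noWork ∷ noWork ∷ []) ∎

  isIOBlank : Cell → Bool
  isIOBlank c with t c
  ... | ioBlank = true
  ... | _ = false

  toRaw : Cell → Cell
  toRaw c = rawBit (ioBitOf c)

  keepCell : Cell → Cell
  keepCell c = c

  skipBlanks toRawBits backOverBits : Machine ⊤
  skipBlanks   = sweep isIOBlank mark ▸ mark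
  toRawBits    = sweep isIOBit toRaw ▸ mark
  backOverBits = sweep isIOBit keepCell ◂ mark

  stepLeft stepRight : Machine ⊤
  stepLeft  = act (λ _ → tt) keepCell ◂
  stepRight = act (λ _ → tt) keepCell ▸

  -- Rewrites the output word on the io track as raw bit cells, which the compiled machine reads as
  -- bits, and moves the head onto its first cell.
  finishOutput : Machine ⊤
  finishOutput = toLeftEnd ⟫ skipBlanks ⟫ toRawBits ⟫ stepLeft ⟫ backOverBits ⟫ stepRight

  replicate-ioBlank-cancel : ∀ n a (X : List IOSym) y → replicate n ioBlank ++ X ≡ replicate a ioBlank ++ map ioBit y → Σ ℕ λ j → X ≡ replicate j ioBlank ++ map ioBit y
  replicate-ioBlank-cancel zero a X y e = a , e
  replicate-ioBlank-cancel (suc n) (suc a) X y e = replicate-ioBlank-cancel n a X y (∷-injectiveʳ e)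
  replicate-ioBlank-cancel (suc n) zero X [] ()
  replicate-ioBlank-cancel (suc n) zero X (b ∷ y) ()

  all-ioBlank : ∀ (cs : List Cell) j → map t cs ≡ replicate j ioBlank → All (λ c → t c ≡ ioBlank) cs
  all-ioBlank [] j e = []
  all-ioBlank (c ∷ cs) (suc j) e = ∷-injectiveˡ e ∷ all-ioBlank cs j (∷-injectiveʳ e)

  isIOBlank-blank : ∀ c → t c ≡ ioBlank → isIOBlank c ≡ true
  isIOBlank-blank c e rewrite e = refl
  isIOBlank-bit : ∀ c b → t c ≡ ioBit b → isIOBlank c ≡ false
  isIOBlank-bit c b e rewrite e = refl
  isIOBlank-sep : ∀ c → t c ≡ ioSep → isIOBlank c ≡ false
  isIOBlank-sep c e rewrite e = refl
  isIOBit-sep : ∀ c → t c ≡ ioSep → isIOBit c ≡ false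
  isIOBit-sep c e rewrite e = refl

  map-toRaw : ∀ (cs : List Cell) y → map t cs ≡ map ioBit y → map toRaw cs ≡ map rawBit y
  map-toRaw [] [] e = refl
  map-toRaw (c ∷ cs) (b ∷ y) e = cong₂ _∷_ (cong rawBit (ioBitOf-bit c b (∷-injectiveˡ e))) (map-toRaw cs y (∷-injectiveʳ e))

  all-toRaw-isIOBit : ∀ (cs : List Cell) → All (λ c → isIOBit c ≡ true) (map toRaw cs)
  all-toRaw-isIOBit [] = []
  all-toRaw-isIOBit (c ∷ cs) = refl ∷ all-toRaw-isIOBit cs

  padᵇ-++∷ : ∀ (xs : List Cell) y ys → padᵇ (xs ++ y ∷ ys) ≡ xs ++ y ∷ ys
  padᵇ-++∷ [] y ys = refl
  padᵇ-++∷ (x ∷ xs) y ys = refl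

  FinishResult : List Bool → Tape → Set
  FinishResult y x = Σ Tape λ x′ → Runs finishOutput x tt x′ × Σ Cell λ c → Σ (List Cell) λ rest → (hd x′ ∷ rights x′ ≡ map rawBit y ++ c ∷ rest) × v c ≡ true

  finishOutput-run : ∀ y L H R → (g : VisitedRegion (tape L H R)) → v H ≡ true → IOShape y (IOTrack.contents (tape L H R)) → FinishResult y (tape L H R)
  finishOutput-run y L H R g vH sh = fromLeftEnd (toLeftEnd-run g vH)
    where
    blankL = VisitedRegion.blankL g
    D0 = visitedBlank ∷ tailᵇ blankL
    fromLeftEnd : (Σ Cell λ c → Σ (List Cell) λ Z → (map mark (VisitedRegion.visitedL g) ʳ++ (mark H ∷ R) ≡ c ∷ Z) ×
           Runs toLeftEnd (tape L H R) tt (tape D0 c Z)) → FinishResult y (tape L H R)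
    fromLeftEnd (c , Z , e , r1) = withIOShape (IOTrack.padding-transport (padded-closed ioBlank _) (IOTrack.run-padding toLeftEnd toLeftEnd-io r1) sh)
      where
      withIOShape : IOShape y (IOTrack.contents (tape D0 c Z)) → FinishResult y (tape L H R)
      withIOShape (a , bb , eSh) = fromSep (locate-mark t isSep ioBlank refl D0 c Z (leftEnd-io-blank blankL (VisitedRegion.allBlankL g)) (replicate a ioBlank ++ map ioBit y) ioSep (replicate bb ioBlank) refl
                               (no-sep-before a y) (replicate⁺ bb refl) (io-shape-split a bb y _ eSh))
        where
        fromSep : (Σ (List Cell) λ cs → Σ Cell λ c2 → Σ (List Cell) λ ds → (c ∷ Z ≡ cs ++ c2 ∷ ds) × All (λ d → isSep (t d) ≡ false) cs ×
              (t c2 ≡ ioSep) × (replicate (length D0) ioBlank ++ map t cs ≡ replicate a ioBlank ++ map ioBit y) × (map t ds ≡ replicate bb ioBlank)) → FinishResult y (tape L H R)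
        fromSep (cs , c2 , ds , eZ , fcs , tc2 , epre , eds) = withBlankPrefix (replicate-ioBlank-cancel (length D0) a (map t cs) y epre)
          where
          withBlankPrefix : (Σ ℕ λ j → map t cs ≡ replicate j ioBlank ++ map ioBit y) → FinishResult y (tape L H R)
          withBlankPrefix (j , ej) = withOutputCells (map-++-split t cs (replicate j ioBlank) (map ioBit y) ej)
            where
            withOutputCells : (Σ (List Cell) λ cs1 → Σ (List Cell) λ cs2 → (cs ≡ cs1 ++ cs2) × (map t cs1 ≡ replicate j ioBlank) × (map t cs2 ≡ map ioBit y)) →
              FinishResult y (tape L H R)
            withOutputCells (cs1 , cs2 , ecs , e1 , e2) = convertOutput cs2 y e2 eZ′
              where
              eZ′ : c ∷ Z ≡ cs1 ++ (cs2 ++ c2 ∷ ds)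
              eZ′ = trans eZ (trans (cong (_++ (c2 ∷ ds)) ecs) (++-assoc cs1 cs2 (c2 ∷ ds)))
              L2 = map mark cs1 ʳ++ D0
              aL2 : All (λ d → t d ≡ ioBlank) L2
              aL2 = ʳ++⁺ (map⁺ (all-ioBlank cs1 j e1)) (leftEnd-io-blank blankL (VisitedRegion.allBlankL g))
              hL2 : isIOBit (headᵇ L2) ≡ false
              hL2 = isIOBit-blank (headᵇ L2) (all-headᵇ refl aL2)
              convertOutput : ∀ cs2 y → map t cs2 ≡ map ioBit y → c ∷ Z ≡ cs1 ++ (cs2 ++ c2 ∷ ds) → FinishResult y (tape L H R)
              convertOutput [] [] e2 eZ2 = x6 , seq-run toLeftEnd _ r1 (seq-run skipBlanks _ r2 (seq-run toRawBits _ r3 (seq-run stepLeft _ r4 (seq-run backOverBits stepRight r5 r6)))) ,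
                   mark (mark c2) , padᵇ (padᵇ ds) , refl , refl
                where
                r2 : Runs skipBlanks (tape D0 c Z) tt (tape L2 (mark c2) (padᵇ ds))
                r2 = sweep-right-run′ isIOBlank mark mark D0 c Z cs1 (c2 ∷ ds) eZ2 (All.map (λ {d} p → isIOBlank-blank d p) (all-ioBlank cs1 j e1)) (isIOBlank-sep c2 tc2)
                x3 = tape L2 (mark (mark c2)) (padᵇ (padᵇ ds))
                r3 : Runs toRawBits (tape L2 (mark c2) (padᵇ ds)) tt x3
                r3 = sweep-right-run isIOBit toRaw mark [] (mark c2 ∷ padᵇ ds) L2 [] (isIOBit-sep (mark c2) tc2)
                x4 = tape (tailᵇ L2) (headᵇ L2) (mark (mark c2) ∷ padᵇ (padᵇ ds))
                r4 : Runs stepLeft x3 tt x4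
                r4 = act-run (λ _ → tt) keepCell ◂ x3
                x5 = tape (tailᵇ L2) (mark (headᵇ L2)) (mark (mark c2) ∷ padᵇ (padᵇ ds))
                r5 : Runs backOverBits x4 tt x5
                r5 = sweep-left-run isIOBit keepCell mark [] L2 (mark (mark c2) ∷ padᵇ (padᵇ ds)) [] hL2
                x6 = tape (mark (headᵇ L2) ∷ tailᵇ L2) (mark (mark c2)) (padᵇ (padᵇ ds))
                r6 : Runs stepRight x5 tt x6
                r6 = act-run (λ _ → tt) keepCell ▸ x5
              convertOutput [] (b ∷ y) () eZ2
              convertOutput (d1 ∷ cs2) [] () eZ2
              convertOutput (d1 ∷ cs2) (b1 ∷ y) e2 eZ2 = x6 , seq-run toLeftEnd _ r1 (seq-run skipBlanks _ r2 (seq-run toRawBits _ r3 (seq-run stepLeft _ r4 (seq-run backOverBits stepRight r5 r6)))) ,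
                   mark c2 , padᵇ ds , out , refl
                where
                W = cs2 ++ c2 ∷ ds
                r2 : Runs skipBlanks (tape D0 c Z) tt (tape L2 (mark d1) W)
                r2 = subst (λ z → Runs skipBlanks (tape D0 c Z) tt (tape L2 (mark d1) z)) (padᵇ-++∷ cs2 c2 ds)
                       (sweep-right-run′ isIOBlank mark mark D0 c Z cs1 (d1 ∷ W) eZ2 (All.map (λ {d} p → isIOBlank-blank d p) (all-ioBlank cs1 j e1)) (isIOBlank-bit d1 b1 (∷-injectiveˡ e2)))
                CS = mark d1 ∷ cs2
                LL = map toRaw CS ʳ++ L2
                x3 = tape LL (mark c2) (padᵇ ds)
                r3 : Runs toRawBits (tape L2 (mark d1) W) tt x3
                r3 = sweep-right-run isIOBit toRaw mark CS (c2 ∷ ds) L2 (bitsAll CS (b1 ∷ y) e2) (isIOBit-sep c2 tc2)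
                  where
                  bitsAll : ∀ (cs : List Cell) y → map t cs ≡ map ioBit y → All (λ c → isIOBit c ≡ true) cs
                  bitsAll [] [] e = []
                  bitsAll (c ∷ cs) (b ∷ y) e = isIOBit-bit c b (∷-injectiveˡ e) ∷ bitsAll cs y (∷-injectiveʳ e)
                x4 = tape (tailᵇ LL) (headᵇ LL) (mark c2 ∷ padᵇ ds)
                r4 : Runs stepLeft x3 tt x4
                r4 = act-run (λ _ → tt) keepCell ◂ x3
                CS′ = map toRaw CS ʳ++ []
                RR = mark c2 ∷ padᵇ ds
                x5 = tape (tailᵇ L2) (mark (headᵇ L2)) (padᵇ (map keepCell CS′ ʳ++ RR))
                r5 : Runs backOverBits x4 tt x5
                r5 = subst (λ z → Runs backOverBits (tape (tailᵇ z) (headᵇ z) RR) tt x5) (ʳ++-++ (map toRaw CS))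
                       (sweep-left-run isIOBit keepCell mark CS′ L2 RR (ʳ++⁺ (all-toRaw-isIOBit CS) []) hL2)
                P = padᵇ (map keepCell CS′ ʳ++ RR)
                x6 = tape (mark (headᵇ L2) ∷ tailᵇ L2) (headᵇ P) (tailᵇ P)
                r6 : Runs stepRight x5 tt x6
                r6 = act-run (λ _ → tt) keepCell ▸ x5
                open ≡-Reasoning
                out : headᵇ P ∷ tailᵇ P ≡ map rawBit (b1 ∷ y) ++ mark c2 ∷ padᵇ ds
                out = begin
                  headᵇ P ∷ tailᵇ P
                    ≡⟨ cong (λ z → headᵇ z ∷ tailᵇ z) (padᵇ-ʳ++∷ (map keepCell CS′) (mark c2) (padᵇ ds)) ⟩
                  headᵇ (map keepCell CS′ ʳ++ RR) ∷ tailᵇ (map keepCell CS′ ʳ++ RR)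
                    ≡⟨ cong (λ z → headᵇ (z ʳ++ RR) ∷ tailᵇ (z ʳ++ RR)) (map-id CS′) ⟩
                  headᵇ (CS′ ʳ++ RR) ∷ tailᵇ (CS′ ʳ++ RR)
                    ≡⟨ cong (λ z → headᵇ z ∷ tailᵇ z) (ʳ++-ʳ++ (map toRaw CS) {[]} {RR}) ⟩
                  headᵇ (map toRaw CS ++ RR) ∷ tailᵇ (map toRaw CS ++ RR)
                    ≡⟨ cong (λ z → headᵇ (z ++ RR) ∷ tailᵇ (z ++ RR)) (map-toRaw CS (b1 ∷ y) e2) ⟩
                  map rawBit (b1 ∷ y) ++ RR ∎

  finishOutput-run′ : ∀ y {acc} t → Layout y acc t → FinishResult y t
  finishOutput-run′ y (tape L H R) (layout g vH sh _ _) = finishOutput-run y L H R g vH sh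

module Assembly (E : ℕ) where
  open Cells E
  open Lifting E
  open Layouts E
  open Cleaning E
  open Application E
  open Popping E
  open Decoding E
  open Initialisation E

  encode-visited : ∀ c → v c ≡ true → Σ (Fin cellCount) λ j → encodeCell c ≡ suc (suc (suc j))
  encode-visited c@(cell true _ _ _ _) refl = Finite.index finite-Cell c , refl

  module _ (A : Machine ⊤) where
    readBits-output : ∀ y c rest → v c ≡ true → D.readBits (compile A) (map encodeCell (map rawBit y ++ c ∷ rest)) ≡ y
    readBits-output []          c rest vc with encode-visited c vc
    ... | j , e rewrite e = refl
    readBits-output (false ∷ y) c rest vc = cong (false ∷_) (readBits-output y c rest vc)
    readBits-output (true ∷ y)  c rest vc = cong (true ∷_) (readBits-output y c rest vc)

    initialTape-input : ∀ x → initialTape A x ≡ inputTape x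
    initialTape-input []      = refl
    initialTape-input (b ∷ x) = refl

  module Assembled (N₀ N₁ Nₕ Nₜ N_g : D.TM)
                   (le₀ : D.TM.extra N₀ ≤ E) (le₁ : D.TM.extra N₁ ≤ E) (leₕ : D.TM.extra Nₕ ≤ E)
                   (leₜ : D.TM.extra Nₜ ≤ E) (le_g : D.TM.extra N_g ≤ E)
                   (ρ : List Bool → List Bool) (ρ-injective : Injective _≡_ _≡_ ρ)
                   (N₀-computes : ∀ u → D.Computes N₀ (ρ u) (ρ (false ∷ u)))
                   (N₁-computes : ∀ u → D.Computes N₁ (ρ u) (ρ (true ∷ u)))
                   (Nₕ-computes : ∀ u → D.Computes Nₕ (ρ u) (ρ (tagHead u)))
                   (Nₜ-computes : ∀ u → D.Computes Nₜ (ρ u) (ρ (dropHead u))) where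
    open Encoding N₀ N₁ le₀ le₁ ρ N₀-computes N₁-computes
    open Decode Nₕ Nₜ leₕ leₜ ρ ρ-injective Nₕ-computes Nₜ-computes
    open Apply N_g le_g using (apply; apply-run)

    machine : Machine ⊤
    machine = initialise (ρ []) ⟫ loop encodeStep ⟫ apply ⟫ loop decodeStep ⟫ finishOutput

    Output : List Bool → Tape → Set
    Output y t = Σ Cell λ c → Σ (List Cell) λ rest → (hd t ∷ rights t ≡ map rawBit y ++ c ∷ rest) × v c ≡ true

    machine-run : ∀ x y → D.Computes N_g (ρ x) (ρ y) → Reaches machine (inputTape x) tt (Output y)
    machine-run x y N_g-computes =
      reaches-⟫ (initialise-run x (ρ [])) λ layout₁ →
      reaches-⟫ (encode-run (reverse x) [] _ (subst (λ z → Layout z (ρ []) _) (sym (reverse-involutive x)) (proj₁ layout₁))) λ layout₂ →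
      reaches-⟫ (apply-run [] (ρ x) (ρ y) _ (subst (λ z → Layout [] (ρ z) _) (reverse-involutive x) layout₂) N_g-computes) λ layout₃ →
      reaches-⟫ (decode-run y [] _ layout₃) λ layout₄ →
      finishOutput-run′ y _ layout₄

    machineTM : D.TM
    machineTM = compile machine

    machineTM-computes : ∀ x y → D.Computes N_g (ρ x) (ρ y) → D.Computes machineTM x y
    machineTM-computes x y N_g-computes = computes (machine-run x y N_g-computes)
      where
      computes : Reaches machine (inputTape x) tt (Output y) → D.Computes machineTM x y
      computes (t , run , c , rest , out , vc) =
        compile-computes machine x y t (subst (λ z → Runs machine z tt t) (sym (initialTape-input machine x)) run)
          (trans (cong (λ z → D.readBits machineTM (map encodeCell z)) out) (readBits-output machine y c rest vc))

open D using (Model; Word; TMmodel; SimulatesVia; Simulates; _⊇_)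

readBits-bits : ∀ (N : D.TM) w → D.readBits N (map (D.bitSym N) w) ≡ w
readBits-bits N []          = refl
readBits-bits N (false ∷ w) = cong (false ∷_) (readBits-bits N w)
readBits-bits N (true ∷ w)  = cong (true ∷_) (readBits-bits N w)

consTM : Bool → D.TM
consTM b = record { states = 3 ; extra = 0 ; δ = δ }
  where
  δ : Fin 4 → Fin 3 → Maybe (Fin 4 × Fin 3 × D.Move)
  δ zero                   a = just (suc zero , a , D.left)
  δ (suc zero)             a = just (suc (suc zero) , bitFin b , D.right)
  δ (suc (suc zero))       a = just (suc (suc (suc zero)) , a , D.left)
  δ (suc (suc (suc zero))) a = nothing

consTM-computes : ∀ b x → D.Computes (consTM b) x (b ∷ x)
consTM-computes false []          = 4 , refl
consTM-computes true  []          = 4 , refl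
consTM-computes false (false ∷ w) = 4 , cong (λ z → just (false ∷ false ∷ z)) (readBits-bits (consTM false) w)
consTM-computes false (true ∷ w)  = 4 , cong (λ z → just (false ∷ true ∷ z)) (readBits-bits (consTM false) w)
consTM-computes true  (false ∷ w) = 4 , cong (λ z → just (true ∷ false ∷ z)) (readBits-bits (consTM true) w)
consTM-computes true  (true ∷ w)  = 4 , cong (λ z → just (true ∷ true ∷ z)) (readBits-bits (consTM true) w)

tagHeadTM : D.TM
tagHeadTM = record { states = 2 ; extra = 0 ; δ = δ }
  where
  δ : Fin 3 → Fin 3 → Maybe (Fin 3 × Fin 3 × D.Move)
  δ zero             (suc (suc zero)) = just (suc zero , zero , D.right)
  δ zero             _                = just (suc zero , suc zero , D.right)
  δ (suc zero)       _                = just (suc (suc zero) , zero , D.left)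
  δ (suc (suc zero)) _                = nothing

tagHeadTM-computes : ∀ x → D.Computes tagHeadTM x (tagHead x)
tagHeadTM-computes []              = 3 , refl
tagHeadTM-computes (true ∷ [])     = 3 , refl
tagHeadTM-computes (false ∷ [])    = 3 , refl
tagHeadTM-computes (true ∷ _ ∷ _)  = 3 , refl
tagHeadTM-computes (false ∷ _ ∷ _) = 3 , refl

dropHeadTM : D.TM
dropHeadTM = record { states = 1 ; extra = 0 ; δ = δ }
  where
  δ : Fin 2 → Fin 3 → Maybe (Fin 2 × Fin 3 × D.Move)
  δ zero       a = just (suc zero , a , D.right)
  δ (suc zero) a = nothing

dropHeadTM-computes : ∀ x → D.Computes dropHeadTM x (dropHead x)
dropHeadTM-computes []            = 2 , refl
dropHeadTM-computes (b ∷ [])      = 2 , refl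
dropHeadTM-computes (b ∷ false ∷ w) = 2 , cong (λ z → just (false ∷ z)) (readBits-bits dropHeadTM w)
dropHeadTM-computes (b ∷ true ∷ w)  = 2 , cong (λ z → just (true ∷ z)) (readBits-bits dropHeadTM w)

module Completeness (M : Model Word) (M⊇TM : M ⊇ TMmodel)
                    (ρ : Word → Word) (ρ-injective : Injective _≡_ _≡_ ρ) (sim : SimulatesVia TMmodel M ρ) where

  -- extend ρ (g x) ≡ f (ρ x) with f total forces g to be total.
  simulating-TM : ∀ g → M g → Σ D.TM λ N → ∀ x → Σ Word λ y → g x ≡ just y × D.Computes N (ρ x) (ρ y)
  simulating-TM g Mg with sim g Mg
  ... | f , (N , N-computes-f) , commutes = N , λ x → simulated x (N-computes-f (ρ x))
    where
    simulated : ∀ x → (Σ Word λ z → f (ρ x) ≡ just z × D.Computes N (ρ x) z) →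
                Σ Word λ y → g x ≡ just y × D.Computes N (ρ x) (ρ y)
    simulated x (z , fρx , computes) with g x | trans (commutes x) fρx
    ... | just y  | ρy≡z = y , refl , subst (D.Computes N (ρ x)) (sym (just-injective ρy≡z)) computes
    ... | nothing | ()

  simulating-TM-total : ∀ (h : Word → Word) (N : D.TM) → (∀ x → D.Computes N x (h x)) →
    Σ D.TM λ N′ → ∀ x → D.Computes N′ (ρ x) (ρ (h x))
  simulating-TM-total h N computes with simulating-TM (λ x → just (h x)) (M⊇TM _ (N , λ x → h x , refl , computes x))
  ... | N′ , simulated = N′ , λ x → just-computes x (simulated x)
    where
    just-computes : ∀ x → (Σ Word λ y → just (h x) ≡ just y × D.Computes N′ (ρ x) (ρ y)) → D.Computes N′ (ρ x) (ρ (h x))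
    just-computes x (y , refl , computes) = computes

  M⊆TM : ∀ g → M g → TMmodel g
  M⊆TM g Mg = machineTM , λ x → computes x (N_g-computes x)
    where
    open Σ (simulating-TM-total (false ∷_) (consTM false) (consTM-computes false)) renaming (proj₁ to N₀; proj₂ to N₀-computes)
    open Σ (simulating-TM-total (true ∷_) (consTM true) (consTM-computes true)) renaming (proj₁ to N₁; proj₂ to N₁-computes)
    open Σ (simulating-TM-total tagHead tagHeadTM tagHeadTM-computes) renaming (proj₁ to Nₕ; proj₂ to Nₕ-computes)
    open Σ (simulating-TM-total dropHead dropHeadTM dropHeadTM-computes) renaming (proj₁ to Nₜ; proj₂ to Nₜ-computes)
    open Σ (simulating-TM g Mg) renaming (proj₁ to N_g; proj₂ to N_g-computes)
    e₀ e₁ eₕ eₜ e_g E : ℕ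
    e₀  = D.TM.extra N₀
    e₁  = D.TM.extra N₁
    eₕ  = D.TM.extra Nₕ
    eₜ  = D.TM.extra Nₜ
    e_g = D.TM.extra N_g
    E   = e₀ + e₁ + eₕ + eₜ + e_g

    open Assembly.Assembled E N₀ N₁ Nₕ Nₜ N_g
      (m≤n⇒m≤n+o e_g (m≤n⇒m≤n+o eₜ (m≤n⇒m≤n+o eₕ (m≤m+n e₀ e₁))))
      (m≤n⇒m≤n+o e_g (m≤n⇒m≤n+o eₜ (m≤n⇒m≤n+o eₕ (m≤n+m e₁ e₀))))
      (m≤n⇒m≤n+o e_g (m≤n⇒m≤n+o eₜ (m≤n+m eₕ (e₀ + e₁))))
      (m≤n⇒m≤n+o e_g (m≤n+m eₜ (e₀ + e₁ + eₕ)))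
      (m≤n+m e_g (e₀ + e₁ + eₕ + eₜ))
      ρ ρ-injective N₀-computes N₁-computes Nₕ-computes Nₜ-computes

    computes : ∀ x → (Σ Word λ y → g x ≡ just y × D.Computes N_g (ρ x) (ρ y)) → Σ Word λ y → g x ≡ just y × D.Computes machineTM x y
    computes x (y , gx , N_g-computes) = y , gx , machineTM-computes x y N_g-computes

mainTheorem4 : (M : Model Word) → M ⊇ TMmodel → Simulates TMmodel M →
               (g : Word → Maybe Word) → M g → TMmodel g
mainTheorem4 M M⊇TM (ρ , ρ-injective , sim) = Completeness.M⊆TM M M⊇TM ρ ρ-injective sim
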